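{- Let $q \geq 2$, let $n \geq 0$ and $r \geq 1$ be integers, and let $P_{n,q}^r$ denote the probability that a partition $\lambda$ of $n$ chosen from the measure $P_{n,q}$ satisfies $\lambda_1 < r$, where \[ P_{n,q}(\lambda) = \frac{q^n (\frac{1}{q})_n}{\prod_{j \geq 1} q^{(\lambda_j')^2} (\frac{1}{q})_{m_j(\lambda)}} \quad (|\lambda| = n). \] Then $P_{n,q}^r$ equals $q^n (1/q)_n$ times the coefficient of $u^n$ in the formal power series \[ \prod_{i \geq 1} \frac{1}{1-u/q^i} \sum_{m=0}^{\infty} \frac{(-1)^m (1-u/q^{2m})\, u^{rm}\, (u/q)_{m-1}}{q^{rm^2+\binom{m}{2}} (1/q)_m}. \]
   Context: For a partition $\lambda$, $\lambda_1$ is its largest part, $m_i(\lambda)$ the number of parts equal to $i$, and $\lambda'$ the transpose partition with $\lambda_i' = m_i(\lambda)+m_{i+1}(\lambda)+\cdots$. Notation: $(x)_n = (1-x)(1-x/q)\cdots(1-x/q^{n-1})$ for $n \geq 0$ (so $(x)_0=1$), extended to $n=-1$ by $(x)_n = (x)_{n+1}/(1-x/q^n)$, i.e. $(u/q)_{ -1} = 1/(1-u)$; thus the $m=0$ summand equals $1$. -}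

module Defs where

open import Data.Nat as ℕ using (ℕ; zero; suc; _∸_)
open import Data.Integer using (+_)
open import Data.Rational using (ℚ; 0ℚ; 1ℚ; _+_; _*_; _-_; -_; _÷_; _/_)
open import Data.Rational.Properties using (_≟_)
open import Data.Rational.Base using (≢-nonZero)
open import Data.List using (List; []; _∷_; [_]; map; foldr; concatMap; filter; applyUpTo; upTo; length)
open import Relation.Nullary using (yes; no)
open import Data.Bool using (if_then_else_)

ℕ→ℚ : ℕ → ℚ
ℕ→ℚ k = + k / 1

-- division, totalised by x ÷' 0 = 0 (only ever applied to nonzero
-- denominators in this development, since q ≥ 2)
_÷'_ : ℚ → ℚ → ℚ
x ÷' y with y ≟ 0ℚ
... | yes _ = 0ℚ
... | no y≢0 = _÷_ x y {{≢-nonZero y≢0}}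

infixl 7 _÷'_

_^ℚ_ : ℚ → ℕ → ℚ
x ^ℚ zero = 1ℚ
x ^ℚ suc k = x * (x ^ℚ k)

sumℚ : List ℚ → ℚ
sumℚ = foldr _+_ 0ℚ

prodℚ : List ℚ → ℚ
prodℚ = foldr _*_ 1ℚ

poch : (q : ℕ) → ℚ → ℕ → ℚ
poch q x k = prodℚ (map (λ i → 1ℚ - x ÷' (ℕ→ℚ q ^ℚ i)) (upTo k))

-- Partitions, as nonincreasing lists of positive parts

-- ptns f n k : all partitions of n with all parts ≤ k  (fuel f ≥ n)
ptns : ℕ → ℕ → ℕ → List (List ℕ)
ptns _ zero _ = [ [] ]
ptns zero (suc n) _ = []
ptns (suc f) (suc n) k =
  concatMap (λ j → map (j ∷_) (ptns f (suc n ∸ j) j))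
            (filter (ℕ._≤? suc n) (applyUpTo suc k))

partitions : ℕ → List (List ℕ)
partitions n = ptns n n n

largestPart : List ℕ → ℕ
largestPart [] = 0
largestPart (x ∷ _) = x

mult : ℕ → List ℕ → ℕ
mult j ps = length (filter (ℕ._≟ j) ps)

conj : ℕ → List ℕ → ℕ
conj j ps = length (filter (j ℕ.≤?_) ps)

-- P_{n,q}(λ) = q^n (1/q)_n / ∏_{j ≥ 1} q^{(λ'_j)^2} (1/q)_{m_j(λ)}
-- (factors with j > λ₁ equal 1, so the product runs over j = 1..λ₁)
Pmeas : (q n : ℕ) → List ℕ → ℚ
Pmeas q n ps =
  (ℕ→ℚ q ^ℚ n * poch q (1ℚ ÷' ℕ→ℚ q) n)
  ÷' prodℚ (map (λ j → (ℕ→ℚ q ^ℚ (conj j ps ℕ.* conj j ps))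
                        * poch q (1ℚ ÷' ℕ→ℚ q) (mult j ps))
                (applyUpTo suc (largestPart ps)))

Pr : (q n r : ℕ) → ℚ
Pr q n r = sumℚ (map (Pmeas q n) (filter (λ p → largestPart p ℕ.<? r) (partitions n)))

Series : Set
Series = ℕ → ℚ

_⊛_ : Series → Series → Series
(f ⊛ g) k = sumℚ (map (λ i → f i * g (k ∸ i)) (upTo (suc k)))

infixl 7 _⊛_

_⊕_ : Series → Series → Series
(f ⊕ g) k = f k + g k

zeroS : Series
zeroS _ = 0ℚ

oneS : Series
oneS zero = 1ℚ
oneS (suc _) = 0ℚ

scale : ℚ → Series → Series
scale c f k = c * f k

shift : ℕ → Series → Series
shift e f k with k ℕ.<? e
... | yes _ = 0ℚ
... | no _ = f (k ∸ e)

oneMinus : ℚ → Series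
oneMinus a zero = 1ℚ
oneMinus a (suc zero) = - a
oneMinus a (suc (suc _)) = 0ℚ

-- 1/(1 - a u) = Σ_k a^k u^k
geom : ℚ → Series
geom a k = a ^ℚ k

prodS : List Series → Series
prodS = foldr _⊛_ oneS

sumS : List Series → Series
sumS = foldr _⊕_ zeroS

-- (u/q)_{m-1}  :  m = 0 gives (u/q)_{-1} = 1/(1-u);
-- m = k+1 gives (1 - u/q)(1 - u/q^2)...(1 - u/q^k)
uPoch : (q : ℕ) → ℕ → Series
uPoch q zero = geom 1ℚ
uPoch q (suc k) = prodS (map (λ i → oneMinus (1ℚ ÷' (ℕ→ℚ q ^ℚ suc i))) (upTo k))

summand : (q r m : ℕ) → Series
summand q r m =
  scale ((- 1ℚ) ^ℚ m ÷' (ℕ→ℚ q ^ℚ (r ℕ.* m ℕ.* m ℕ.+ (m ℕ.* (m ∸ 1)) ℕ./ 2)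
                          * poch q (1ℚ ÷' ℕ→ℚ q) m))
        (oneMinus (1ℚ ÷' (ℕ→ℚ q ^ℚ (2 ℕ.* m))) ⊛ shift (r ℕ.* m) (uPoch q m))

-- Σ_{m=0}^{M} summand m.  For r ≥ 1 the summands with m > n are
-- O(u^{n+1}), so M = n gives the exact coefficient of u^n.
sumPart : (q r M : ℕ) → Series
sumPart q r M = sumS (map (summand q r) (upTo (suc M)))

prodPart : (q N : ℕ) → Series
prodPart q N = prodS (map (λ i → geom (1ℚ ÷' (ℕ→ℚ q ^ℚ suc i))) (upTo N))

approx : (q n r N : ℕ) → ℚ
approx q n r N =
  ℕ→ℚ q ^ℚ n * poch q (1ℚ ÷' ℕ→ℚ q) n * (prodPart q N ⊛ sumPart q r n) n

{-# OPTIONS --safe #-}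
module Submission where

-- P_{n,q}(λ) = qⁿ (1/q)ₙ · w(λ) with w(λ) = ∏ⱼ q^-(λ'ⱼ)² / (1/q)_{mⱼ(λ)}, so the
-- claim is about Z_k(n), the sum of w over partitions of n with parts ≤ k = r - 1.  Splitting off
-- the m parts equal to k gives Z_k(n) = Σₘ q^-(2m(n-km) + km²) / (1/q)ₘ · Z_{k-1}(n - km).
-- On the series side, Euler's identity ∏_{i≥a} 1/(1 - u/qⁱ) = Σⱼ q^-(aj) uʲ / (1/q)ⱼ makes the
-- coefficient of uⁿ (with the full product) an explicit finite sum seriesCoeff r n.  The
-- q-binomial theorem shows that seriesCoeff obeys the same recursion in r, and for r = 1 the sum
-- telescopes to δ_{n,0} = Z_0(n).  Truncating the product after N factors moves the coefficient
-- of uʲ by at most j q^-N times its limit, so the truncated expressions converge like q^-N.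

import Data.Nat

module FiniteSums where
  open import Data.Nat as ℕ using (ℕ; zero; suc; _∸_; z≤n; s≤s)
  import Data.Nat.Properties as ℕP
  open import Data.Rational
  open import Data.Rational.Properties
  open import Data.List using (map; applyUpTo; upTo)
  open import Data.Maybe.Base using (Maybe; just; nothing)
  open import Level using (0ℓ)
  open import Relation.Binary.PropositionalEquality
  open import Relation.Nullary using (yes; no)
  open import Function using (_∘_)
  open import Tactic.RingSolver using (solve-∀)
  import Tactic.RingSolver.Core.AlmostCommutativeRing as ACR
  open import Defs using (sumℚ; prodℚ)

  ℚ-ring : ACR.AlmostCommutativeRing 0ℓ 0ℓ
  ℚ-ring = ACR.fromCommutativeRing +-*-commutativeRing z?
    where
    z? : ∀ x → Maybe (0ℚ ≡ x)
    z? x with 0ℚ ≟ x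
    ... | yes p = just p
    ... | no _ = nothing

  Σ< : ℕ → (ℕ → ℚ) → ℚ
  Σ< zero f = 0ℚ
  Σ< (suc n) f = Σ< n f + f n

  sum-cong-< : ∀ n {f g : ℕ → ℚ} → (∀ i → i ℕ.< n → f i ≡ g i) → Σ< n f ≡ Σ< n g
  sum-cong-< zero h = refl
  sum-cong-< (suc n) h = cong₂ _+_ (sum-cong-< n (λ i i<n → h i (ℕP.m≤n⇒m≤1+n i<n))) (h n ℕP.≤-refl)

  sum-cong : ∀ n {f g : ℕ → ℚ} → (∀ i → f i ≡ g i) → Σ< n f ≡ Σ< n g
  sum-cong n h = sum-cong-< n (λ i _ → h i)

  sum-sucˡ : ∀ n (f : ℕ → ℚ) → Σ< (suc n) f ≡ f 0 + Σ< n (f ∘ suc)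
  sum-sucˡ zero f = trans (+-identityˡ (f 0)) (sym (+-identityʳ (f 0)))
  sum-sucˡ (suc n) f = trans (cong (_+ f (suc n)) (sum-sucˡ n f)) (+-assoc (f 0) _ _)

  sum-+ : ∀ n (f g : ℕ → ℚ) → Σ< n (λ i → f i + g i) ≡ Σ< n f + Σ< n g
  sum-+ zero f g = refl
  sum-+ (suc n) f g rewrite sum-+ n f g = lem (Σ< n f) (Σ< n g) (f n) (g n)
    where lem : ∀ a b c d → a + b + (c + d) ≡ a + c + (b + d)
          lem = solve-∀ ℚ-ring

  sum-*ˡ : ∀ n (c : ℚ) (f : ℕ → ℚ) → c * Σ< n f ≡ Σ< n (λ i → c * f i)
  sum-*ˡ zero c f = *-zeroʳ c
  sum-*ˡ (suc n) c f = trans (*-distribˡ-+ c (Σ< n f) (f n)) (cong (_+ c * f n) (sum-*ˡ n c f))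

  sum-*ʳ : ∀ n (c : ℚ) (f : ℕ → ℚ) → Σ< n f * c ≡ Σ< n (λ i → f i * c)
  sum-*ʳ n c f = trans (*-comm _ c) (trans (sum-*ˡ n c f) (sum-cong n (λ i → *-comm c (f i))))

  sum-neg : ∀ n (f : ℕ → ℚ) → - Σ< n f ≡ Σ< n (λ i → - f i)
  sum-neg zero f = refl
  sum-neg (suc n) f = trans (neg-distrib-+ (Σ< n f) (f n)) (cong (_+ - f n) (sum-neg n f))

  sum-- : ∀ n (f g : ℕ → ℚ) → Σ< n (λ i → f i - g i) ≡ Σ< n f - Σ< n g
  sum-- n f g = trans (sum-+ n f (λ i → - g i)) (cong (Σ< n f +_) (sym (sum-neg n g)))

  sum-0 : ∀ n {f : ℕ → ℚ} → (∀ i → i ℕ.< n → f i ≡ 0ℚ) → Σ< n f ≡ 0ℚ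
  sum-0 zero h = refl
  sum-0 (suc n) h = trans (cong₂ _+_ (sum-0 n (λ i i<n → h i (ℕP.m≤n⇒m≤1+n i<n))) (h n ℕP.≤-refl)) (+-identityˡ 0ℚ)

  sum-split : ∀ m n (f : ℕ → ℚ) → Σ< (m ℕ.+ n) f ≡ Σ< m f + Σ< n (λ i → f (m ℕ.+ i))
  sum-split m zero f = trans (cong (λ k → Σ< k f) (ℕP.+-identityʳ m)) (sym (+-identityʳ _))
  sum-split m (suc n) f = trans (cong (λ k → Σ< k f) (ℕP.+-suc m n))
    (trans (cong (_+ f (m ℕ.+ n)) (sum-split m n f)) (+-assoc (Σ< m f) _ _))

  sum-truncate : ∀ {m n} (f : ℕ → ℚ) → m ℕ.≤ n → (∀ i → m ℕ.≤ i → i ℕ.< n → f i ≡ 0ℚ) → Σ< n f ≡ Σ< m f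
  sum-truncate {m} {n} f m≤n h = begin
      Σ< n f ≡⟨ cong (λ k → Σ< k f) (sym (ℕP.m+[n∸m]≡n m≤n)) ⟩
      Σ< (m ℕ.+ (n ∸ m)) f ≡⟨ sum-split m (n ∸ m) f ⟩
      Σ< m f + Σ< (n ∸ m) (λ i → f (m ℕ.+ i)) ≡⟨ cong (Σ< m f +_) (sum-0 (n ∸ m) (λ i i< → h (m ℕ.+ i) (ℕP.m≤m+n m i) (sub i i<))) ⟩
      Σ< m f + 0ℚ ≡⟨ +-identityʳ _ ⟩
      Σ< m f ∎
    where
    open ≡-Reasoning
    sub : ∀ i → i ℕ.< n ∸ m → m ℕ.+ i ℕ.< n
    sub i i< = ℕP.≤-trans (ℕP.≤-reflexive (sym (ℕP.+-suc m i))) (ℕP.≤-trans (ℕP.+-monoʳ-≤ m i<) (ℕP.≤-reflexive (ℕP.m+[n∸m]≡n m≤n)))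

  sum-swap : ∀ m n (f : ℕ → ℕ → ℚ) → Σ< m (λ i → Σ< n (λ j → f i j)) ≡ Σ< n (λ j → Σ< m (λ i → f i j))
  sum-swap zero n f = sym (sum-0 n (λ _ _ → refl))
  sum-swap (suc m) n f = trans (cong (_+ Σ< n (f m)) (sum-swap m n f)) (sym (sum-+ n _ _))

  sum-reverse : ∀ n (f : ℕ → ℚ) → Σ< n f ≡ Σ< n (λ i → f (n ∸ suc i))
  sum-reverse zero f = refl
  sum-reverse (suc n) f = begin
      Σ< n f + f n ≡⟨ +-comm (Σ< n f) (f n) ⟩
      f n + Σ< n f ≡⟨ cong (f n +_) (sum-reverse n f) ⟩
      f n + Σ< n (λ i → f (n ∸ suc i)) ≡⟨ cong (f n +_) refl ⟩
      f n + Σ< n (λ i → f (suc n ∸ suc (suc i))) ≡⟨ sym (sum-sucˡ n (λ i → f (suc n ∸ suc i))) ⟩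
      Σ< (suc n) (λ i → f (suc n ∸ suc i)) ∎
    where open ≡-Reasoning

  sum-triangle : ∀ N (F : ℕ → ℕ → ℚ) → Σ< N (λ i → Σ< (suc i) (F i)) ≡ Σ< N (λ j → Σ< (N ∸ j) (λ k → F (j ℕ.+ k) j))
  sum-triangle zero F = refl
  sum-triangle (suc N) F = begin
      Σ< N (λ i → Σ< (suc i) (F i)) + Σ< (suc N) (F N)
        ≡⟨ cong (_+ Σ< (suc N) (F N)) (sum-triangle N F) ⟩
      Σ< N (λ j → Σ< (N ∸ j) (λ k → F (j ℕ.+ k) j)) + Σ< (suc N) (F N)
        ≡⟨ cong (_+ Σ< (suc N) (F N)) (sym (trans (cong (Σ< N columns +_) last-column-empty) (+-identityʳ (Σ< N columns)))) ⟩
      Σ< (suc N) (λ j → Σ< (N ∸ j) (λ k → F (j ℕ.+ k) j)) + Σ< (suc N) (F N)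
        ≡⟨ sym (sum-+ (suc N) _ _) ⟩
      Σ< (suc N) (λ j → Σ< (N ∸ j) (λ k → F (j ℕ.+ k) j) + F N j)
        ≡⟨ sum-cong-< (suc N) (λ j j< → step j j<) ⟩
      Σ< (suc N) (λ j → Σ< (suc N ∸ j) (λ k → F (j ℕ.+ k) j)) ∎
    where
    open ≡-Reasoning
    columns : ℕ → ℚ
    columns j = Σ< (N ∸ j) (λ k → F (j ℕ.+ k) j)
    last-column-empty : columns N ≡ 0ℚ
    last-column-empty = cong (λ x → Σ< x (λ k → F (N ℕ.+ k) N)) (ℕP.n∸n≡0 N)
    step : ∀ j → j ℕ.< suc N → Σ< (N ∸ j) (λ k → F (j ℕ.+ k) j) + F N j ≡ Σ< (suc N ∸ j) (λ k → F (j ℕ.+ k) j)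
    step j (s≤s j≤N) rewrite ℕP.+-∸-assoc 1 j≤N = cong (λ x → Σ< (N ∸ j) (λ k → F (j ℕ.+ k) j) + F x j) (sym (ℕP.m+[n∸m]≡n j≤N))

  sum-antidiagonals : ∀ n (F : ℕ → ℕ → ℚ) → (∀ m l → n ℕ.< m ℕ.+ l → F m l ≡ 0ℚ) →
    Σ< (suc n) (λ m → Σ< (suc n) (λ l → F m l)) ≡ Σ< (suc n) (λ p → Σ< (suc p) (λ l → F (p ∸ l) l))
  sum-antidiagonals n F z = begin
      Σ< (suc n) (λ m → Σ< (suc n) (λ l → F m l)) ≡⟨ sum-swap (suc n) (suc n) F ⟩
      Σ< (suc n) (λ l → Σ< (suc n) (λ m → F m l)) ≡⟨ sum-cong-< (suc n) (λ l l< → sum-truncate (λ m → F m l) (ℕP.m∸n≤m (suc n) l) (λ m le _ → z m l (lt l m l< le))) ⟩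
      Σ< (suc n) (λ l → Σ< (suc n ∸ l) (λ m → F m l)) ≡⟨ sum-cong (suc n) (λ l → sum-cong (suc n ∸ l) (λ m → cong (λ x → F x l) (sym (ℕP.m+n∸m≡n l m)))) ⟩
      Σ< (suc n) (λ l → Σ< (suc n ∸ l) (λ m → F ((l ℕ.+ m) ∸ l) l)) ≡⟨ sym (sum-triangle (suc n) (λ p l → F (p ∸ l) l)) ⟩
      Σ< (suc n) (λ p → Σ< (suc p) (λ l → F (p ∸ l) l)) ∎
    where
    open ≡-Reasoning
    lt : ∀ l m → l ℕ.< suc n → suc n ∸ l ℕ.≤ m → n ℕ.< m ℕ.+ l
    lt l m (s≤s l≤n) le = subst (ℕ._≤ m ℕ.+ l) (ℕP.m∸n+n≡m (ℕP.m≤n⇒m≤1+n l≤n)) (ℕP.+-monoˡ-≤ l le)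

  sum-mono : ∀ n {f g : ℕ → ℚ} → (∀ i → i ℕ.< n → f i ≤ g i) → Σ< n f ≤ Σ< n g
  sum-mono zero h = ≤-refl
  sum-mono (suc n) h = +-mono-≤ (sum-mono n (λ i i< → h i (ℕP.m≤n⇒m≤1+n i<))) (h n ℕP.≤-refl)

  sum-abs : ∀ n (f : ℕ → ℚ) → ∣ Σ< n f ∣ ≤ Σ< n (λ i → ∣ f i ∣)
  sum-abs zero f = ≤-refl
  sum-abs (suc n) f = ≤-trans (∣p+q∣≤∣p∣+∣q∣ (Σ< n f) (f n)) (+-monoˡ-≤ ∣ f n ∣ (sum-abs n f))

  sumℚ-applyUpTo : ∀ n (h : ℕ → ℚ) (g : ℕ → ℕ) → sumℚ (map h (applyUpTo g n)) ≡ Σ< n (h ∘ g)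
  sumℚ-applyUpTo zero h g = refl
  sumℚ-applyUpTo (suc n) h g = trans (cong (h (g 0) +_) (sumℚ-applyUpTo n h (g ∘ suc))) (sym (sum-sucˡ n (h ∘ g)))

  sumℚ-upTo : ∀ n (h : ℕ → ℚ) → sumℚ (map h (upTo n)) ≡ Σ< n h
  sumℚ-upTo n h = sumℚ-applyUpTo n h (λ x → x)

  Π< : ℕ → (ℕ → ℚ) → ℚ
  Π< zero f = 1ℚ
  Π< (suc n) f = Π< n f * f n

  prod-cong-< : ∀ n {f g : ℕ → ℚ} → (∀ i → i ℕ.< n → f i ≡ g i) → Π< n f ≡ Π< n g
  prod-cong-< zero h = refl
  prod-cong-< (suc n) h = cong₂ _*_ (prod-cong-< n (λ i i<n → h i (ℕP.m≤n⇒m≤1+n i<n))) (h n ℕP.≤-refl)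

  prod-sucˡ : ∀ n (f : ℕ → ℚ) → Π< (suc n) f ≡ f 0 * Π< n (f ∘ suc)
  prod-sucˡ zero f = trans (*-identityˡ (f 0)) (sym (*-identityʳ (f 0)))
  prod-sucˡ (suc n) f = trans (cong (_* f (suc n)) (prod-sucˡ n f)) (*-assoc (f 0) _ _)

  prod-* : ∀ n (f g : ℕ → ℚ) → Π< n (λ i → f i * g i) ≡ Π< n f * Π< n g
  prod-* zero f g = refl
  prod-* (suc n) f g rewrite prod-* n f g = lem (Π< n f) (Π< n g) (f n) (g n)
    where lem : ∀ a b c d → a * b * (c * d) ≡ a * c * (b * d)
          lem = solve-∀ ℚ-ring

  prod-truncate : ∀ {m n} (f : ℕ → ℚ) → m ℕ.≤ n → (∀ i → m ℕ.≤ i → i ℕ.< n → f i ≡ 1ℚ) → Π< n f ≡ Π< m f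
  prod-truncate {m} {zero} f z≤n h = refl
  prod-truncate {m} {suc n} f m≤sn h with m ℕ.≟ suc n
  ... | yes refl = refl
  ... | no m≢ = trans (cong (Π< n f *_) (h n (ℕP.≤-pred (ℕP.≤∧≢⇒< m≤sn m≢)) ℕP.≤-refl))
          (trans (*-identityʳ _) (prod-truncate f (ℕP.≤-pred (ℕP.≤∧≢⇒< m≤sn m≢)) (λ i le lt → h i le (ℕP.m≤n⇒m≤1+n lt))))

  prod-zero : ∀ n (f : ℕ → ℚ) j → j ℕ.< n → f j ≡ 0ℚ → Π< n f ≡ 0ℚ
  prod-zero (suc n) f j j<n fj≡0 with j ℕ.≟ n
  ... | yes refl = trans (cong (Π< n f *_) fj≡0) (*-zeroʳ (Π< n f))
  ... | no j≢n = trans (cong (_* f n) (prod-zero n f j (ℕP.≤∧≢⇒< (ℕP.≤-pred j<n) j≢n) fj≡0)) (*-zeroˡ (f n))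

  prod-one : ∀ K → Π< K (λ _ → 1ℚ) ≡ 1ℚ
  prod-one zero = refl
  prod-one (suc K) = trans (*-identityʳ _) (prod-one K)

  prodℚ-applyUpTo : ∀ n (h : ℕ → ℚ) (g : ℕ → ℕ) → prodℚ (map h (applyUpTo g n)) ≡ Π< n (h ∘ g)
  prodℚ-applyUpTo zero h g = refl
  prodℚ-applyUpTo (suc n) h g = trans (cong (h (g 0) *_) (prodℚ-applyUpTo n h (g ∘ suc))) (sym (prod-sucˡ n (h ∘ g)))


module PowerSeries where
  open import Data.Nat as ℕ using (ℕ; zero; suc; _∸_; s≤s)
  import Data.Nat.Properties as ℕP
  open import Data.Rational using (ℚ; 0ℚ; 1ℚ; _+_; _*_; _-_; -_)
  open import Data.Rational.Properties
  open import Data.List using (List; []; _∷_; map; applyUpTo)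
  open import Relation.Binary.PropositionalEquality
  open import Relation.Nullary using (yes; no; Dec)
  open import Function using (_∘_)
  open import Data.Empty using (⊥-elim)
  open import Tactic.RingSolver using (solve-∀)
  open import Defs
  open FiniteSums

  ⊛-coeff : ∀ (f g : Series) k → (f ⊛ g) k ≡ Σ< (suc k) (λ i → f i * g (k ∸ i))
  ⊛-coeff f g k = sumℚ-upTo (suc k) (λ i → f i * g (k ∸ i))

  ⊛-cong : ∀ {f f' g g'} → f ≗ f' → g ≗ g' → f ⊛ g ≗ f' ⊛ g'
  ⊛-cong {f} {f'} {g} {g'} ff gg k = trans (⊛-coeff f g k) (trans (sum-cong (suc k) (λ i → cong₂ _*_ (ff i) (gg (k ∸ i)))) (sym (⊛-coeff f' g' k)))

  ⊛-comm : ∀ f g → f ⊛ g ≗ g ⊛ f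
  ⊛-comm f g k = begin
      (f ⊛ g) k ≡⟨ ⊛-coeff f g k ⟩
      Σ< (suc k) (λ i → f i * g (k ∸ i)) ≡⟨ sum-reverse (suc k) _ ⟩
      Σ< (suc k) (λ i → f (k ∸ i) * g (k ∸ (k ∸ i))) ≡⟨ sum-cong-< (suc k) (λ i i< → trans (cong (λ x → f (k ∸ i) * g x) (ℕP.m∸[m∸n]≡n (ℕP.≤-pred i<))) (*-comm (f (k ∸ i)) (g i))) ⟩
      Σ< (suc k) (λ i → g i * f (k ∸ i)) ≡⟨ sym (⊛-coeff g f k) ⟩
      (g ⊛ f) k ∎
    where open ≡-Reasoning

  ⊛-assoc : ∀ f g h → (f ⊛ g) ⊛ h ≗ f ⊛ (g ⊛ h)
  ⊛-assoc f g h k = begin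
      ((f ⊛ g) ⊛ h) k ≡⟨ ⊛-coeff (f ⊛ g) h k ⟩
      Σ< (suc k) (λ i → (f ⊛ g) i * h (k ∸ i)) ≡⟨ sum-cong (suc k) (λ i → trans (cong (_* h (k ∸ i)) (⊛-coeff f g i)) (sum-*ʳ (suc i) _ _)) ⟩
      Σ< (suc k) (λ i → Σ< (suc i) (λ j → f j * g (i ∸ j) * h (k ∸ i))) ≡⟨ sum-triangle (suc k) (λ i j → f j * g (i ∸ j) * h (k ∸ i)) ⟩
      Σ< (suc k) (λ j → Σ< (suc k ∸ j) (λ l → f j * g ((j ℕ.+ l) ∸ j) * h (k ∸ (j ℕ.+ l)))) ≡⟨ sum-cong-< (suc k) step ⟩
      Σ< (suc k) (λ j → f j * (g ⊛ h) (k ∸ j)) ≡⟨ sym (⊛-coeff f (g ⊛ h) k) ⟩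
      (f ⊛ (g ⊛ h)) k ∎
    where
    open ≡-Reasoning
    step : ∀ j → j ℕ.< suc k → Σ< (suc k ∸ j) (λ l → f j * g ((j ℕ.+ l) ∸ j) * h (k ∸ (j ℕ.+ l))) ≡ f j * (g ⊛ h) (k ∸ j)
    step j (s≤s j≤k) = begin
        Σ< (suc k ∸ j) (λ l → f j * g ((j ℕ.+ l) ∸ j) * h (k ∸ (j ℕ.+ l)))
          ≡⟨ cong (λ x → Σ< x (λ l → f j * g ((j ℕ.+ l) ∸ j) * h (k ∸ (j ℕ.+ l)))) (ℕP.+-∸-assoc 1 j≤k) ⟩
        Σ< (suc (k ∸ j)) (λ l → f j * g ((j ℕ.+ l) ∸ j) * h (k ∸ (j ℕ.+ l)))
          ≡⟨ sum-cong (suc (k ∸ j)) (λ l → trans (*-assoc (f j) (g (j ℕ.+ l ∸ j)) (h (k ∸ (j ℕ.+ l)))) (cong₂ (λ a b → f j * (g a * h b)) (ℕP.m+n∸m≡n j l) (sym (ℕP.∸-+-assoc k j l)))) ⟩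
        Σ< (suc (k ∸ j)) (λ l → f j * (g l * h (k ∸ j ∸ l)))
          ≡⟨ sym (sum-*ˡ (suc (k ∸ j)) (f j) _) ⟩
        f j * Σ< (suc (k ∸ j)) (λ l → g l * h (k ∸ j ∸ l))
          ≡⟨ cong (f j *_) (sym (⊛-coeff g h (k ∸ j))) ⟩
        f j * (g ⊛ h) (k ∸ j) ∎

  ⊛-oneʳ : ∀ f → f ⊛ oneS ≗ f
  ⊛-oneʳ f k = begin
      (f ⊛ oneS) k ≡⟨ ⊛-coeff f oneS k ⟩
      Σ< k (λ i → f i * oneS (k ∸ i)) + f k * oneS (k ∸ k) ≡⟨ cong₂ _+_ (sum-0 k (λ i i<k → z i i<k)) (cong (λ x → f k * oneS x) (ℕP.n∸n≡0 k)) ⟩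
      0ℚ + f k * 1ℚ ≡⟨ trans (+-identityˡ _) (*-identityʳ _) ⟩
      f k ∎
    where
    open ≡-Reasoning
    z : ∀ i → i ℕ.< k → f i * oneS (k ∸ i) ≡ 0ℚ
    z i i<k with k ∸ i | ℕP.m>n⇒m∸n≢0 i<k
    ... | zero | h = ⊥-elim (h refl)
    ... | suc _ | _ = *-zeroʳ (f i)

  ⊛-distribˡ : ∀ f g h → f ⊛ (g ⊕ h) ≗ (f ⊛ g) ⊕ (f ⊛ h)
  ⊛-distribˡ f g h k = trans (⊛-coeff f (g ⊕ h) k) (trans (trans (sum-cong (suc k) (λ i → *-distribˡ-+ (f i) _ _)) (sum-+ (suc k) _ _))
    (cong₂ _+_ (sym (⊛-coeff f g k)) (sym (⊛-coeff f h k))))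

  ⊛-zeroʳ : ∀ f → f ⊛ zeroS ≗ zeroS
  ⊛-zeroʳ f k = trans (⊛-coeff f zeroS k) (sum-0 (suc k) (λ i _ → *-zeroʳ (f i)))

  ⊛-scale : ∀ f c g → f ⊛ scale c g ≗ scale c (f ⊛ g)
  ⊛-scale f c g k = trans (⊛-coeff f (scale c g) k) (trans (sum-cong (suc k) (λ i → lem (f i) c (g (k ∸ i))))
     (trans (sym (sum-*ˡ (suc k) c _)) (cong (c *_) (sym (⊛-coeff f g k)))))
    where lem : ∀ a b d → a * (b * d) ≡ b * (a * d)
          lem = solve-∀ ℚ-ring

  ⊛-sumS : ∀ f (L : List Series) → f ⊛ sumS L ≗ sumS (map (f ⊛_) L)
  ⊛-sumS f [] = ⊛-zeroʳ f
  ⊛-sumS f (x ∷ L) k = trans (⊛-distribˡ f x (sumS L) k) (cong ((f ⊛ x) k +_) (⊛-sumS f L k))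

  ⊛-linear : ∀ N (w : ℕ → ℚ) g (F : ℕ → Series) i → Σ< N (λ l → w l * (g ⊛ F l) i) ≡ (g ⊛ (λ j → Σ< N (λ l → w l * F l j))) i
  ⊛-linear N w g F i = begin
      Σ< N (λ l → w l * (g ⊛ F l) i) ≡⟨ sum-cong N (λ l → trans (cong (w l *_) (⊛-coeff g (F l) i)) (sum-*ˡ (suc i) (w l) _)) ⟩
      Σ< N (λ l → Σ< (suc i) (λ x → w l * (g x * F l (i ∸ x)))) ≡⟨ sum-swap N (suc i) _ ⟩
      Σ< (suc i) (λ x → Σ< N (λ l → w l * (g x * F l (i ∸ x)))) ≡⟨ sum-cong (suc i) (λ x → trans (sum-cong N (λ l → lem (w l) (g x) (F l (i ∸ x)))) (sym (sum-*ˡ N (g x) _))) ⟩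
      Σ< (suc i) (λ x → g x * Σ< N (λ l → w l * F l (i ∸ x))) ≡⟨ sym (⊛-coeff g (λ j → Σ< N (λ l → w l * F l j)) i) ⟩
      (g ⊛ (λ j → Σ< N (λ l → w l * F l j))) i ∎
    where
    open ≡-Reasoning
    lem : ∀ a b c → a * (b * c) ≡ b * (a * c)
    lem = solve-∀ ℚ-ring

  oneMinus-⊛-zero : ∀ x g → (oneMinus x ⊛ g) 0 ≡ g 0
  oneMinus-⊛-zero x g = trans (⊛-coeff (oneMinus x) g 0) (trans (+-identityˡ _) (*-identityˡ (g 0)))

  oneMinus-⊛-suc : ∀ x g k → (oneMinus x ⊛ g) (suc k) ≡ g (suc k) - x * g k
  oneMinus-⊛-suc x g k = begin
      (oneMinus x ⊛ g) (suc k) ≡⟨ ⊛-coeff (oneMinus x) g (suc k) ⟩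
      Σ< (suc (suc k)) (λ i → oneMinus x i * g (suc k ∸ i)) ≡⟨ sum-sucˡ (suc k) _ ⟩
      1ℚ * g (suc k) + Σ< (suc k) (λ i → oneMinus x (suc i) * g (k ∸ i)) ≡⟨ cong (1ℚ * g (suc k) +_) (sum-sucˡ k _) ⟩
      1ℚ * g (suc k) + ((- x) * g k + Σ< k (λ i → oneMinus x (suc (suc i)) * g (k ∸ suc i))) ≡⟨ cong (λ z → 1ℚ * g (suc k) + ((- x) * g k + z)) (sum-0 k (λ i _ → *-zeroˡ (g (k ∸ suc i)))) ⟩
      1ℚ * g (suc k) + ((- x) * g k + 0ℚ) ≡⟨ lem (g (suc k)) x (g k) ⟩
      g (suc k) - x * g k ∎
    where
    open ≡-Reasoning
    lem : ∀ a b c → 1ℚ * a + ((- b) * c + 0ℚ) ≡ a - b * c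
    lem = solve-∀ ℚ-ring

  sumS-applyUpTo : ∀ n (h : ℕ → Series) (g : ℕ → ℕ) k → sumS (map h (applyUpTo g n)) k ≡ Σ< n (λ m → h (g m) k)
  sumS-applyUpTo zero h g k = refl
  sumS-applyUpTo (suc n) h g k = trans (cong (h (g 0) k +_) (sumS-applyUpTo n h (g ∘ suc) k)) (sym (sum-sucˡ n (λ m → h (g m) k)))

  shift-< : ∀ e g k → k ℕ.< e → shift e g k ≡ 0ℚ
  shift-< e g k k<e with k ℕ.<? e
  ... | yes _ = refl
  ... | no ¬p = ⊥-elim (¬p k<e)

  shift-≥ : ∀ e g k → e ℕ.≤ k → shift e g k ≡ g (k ∸ e)
  shift-≥ e g k e≤k with k ℕ.<? e
  ... | yes p = ⊥-elim (ℕP.<⇒≱ p e≤k)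
  ... | no _ = refl

  shift-cong : ∀ e {f g} → f ≗ g → shift e f ≗ shift e g
  shift-cong e {f} {g} fg k with k ℕ.<? e
  ... | yes _ = refl
  ... | no _ = fg (k ∸ e)

  shift-cong-≤ : ∀ e f g n → (∀ j → j ℕ.≤ n → f j ≡ g j) → shift e f n ≡ shift e g n
  shift-cong-≤ e f g n h with n ℕ.<? e
  ... | yes _ = refl
  ... | no _ = h (n ∸ e) (ℕP.m∸n≤m n e)

  ⊛-shift : ∀ f e g → f ⊛ shift e g ≗ shift e (f ⊛ g)
  ⊛-shift f e g k = by-cases (k ℕ.<? e)
    where
    by-cases : Dec (k ℕ.< e) → (f ⊛ shift e g) k ≡ shift e (f ⊛ g) k
    by-cases (yes k<e) = begin
      (f ⊛ shift e g) k                           ≡⟨ ⊛-coeff f (shift e g) k ⟩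
      Σ< (suc k) (λ i → f i * shift e g (k ∸ i))  ≡⟨ sum-0 (suc k) (λ i _ → vanish i (ℕP.≤-<-trans (ℕP.m∸n≤m k i) k<e)) ⟩
      0ℚ                                          ≡⟨ sym (shift-< e (f ⊛ g) k k<e) ⟩
      shift e (f ⊛ g) k                           ∎
      where
      open ≡-Reasoning
      vanish : ∀ i → k ∸ i ℕ.< e → f i * shift e g (k ∸ i) ≡ 0ℚ
      vanish i k∸i<e = trans (cong (f i *_) (shift-< e g (k ∸ i) k∸i<e)) (*-zeroʳ (f i))
    by-cases (no k≮e) = begin
      (f ⊛ shift e g) k                                 ≡⟨ ⊛-coeff f (shift e g) k ⟩
      Σ< (suc k) (λ i → f i * shift e g (k ∸ i))        ≡⟨ sum-truncate _ (s≤s (ℕP.m∸n≤m k e)) vanish ⟩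
      Σ< (suc (k ∸ e)) (λ i → f i * shift e g (k ∸ i))  ≡⟨ sum-cong-< (suc (k ∸ e)) (λ i i< → cong (f i *_) (unshift i (ℕP.≤-pred i<))) ⟩
      Σ< (suc (k ∸ e)) (λ i → f i * g (k ∸ e ∸ i))      ≡⟨ sym (⊛-coeff f g (k ∸ e)) ⟩
      (f ⊛ g) (k ∸ e)                                   ≡⟨ sym (shift-≥ e (f ⊛ g) k e≤k) ⟩
      shift e (f ⊛ g) k                                 ∎
      where
      open ≡-Reasoning
      e≤k : e ℕ.≤ k
      e≤k = ℕP.≮⇒≥ k≮e
      vanish : ∀ i → suc (k ∸ e) ℕ.≤ i → i ℕ.< suc k → f i * shift e g (k ∸ i) ≡ 0ℚ
      vanish i k∸e<i (s≤s i≤k) = trans (cong (f i *_) (shift-< e g (k ∸ i) k∸i<e)) (*-zeroʳ (f i))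
        where
        k∸i<e : k ∸ i ℕ.< e
        k∸i<e = subst (k ∸ i ℕ.<_) (ℕP.m∸[m∸n]≡n e≤k) (ℕP.∸-monoʳ-< k∸e<i i≤k)
      unshift : ∀ i → i ℕ.≤ k ∸ e → shift e g (k ∸ i) ≡ g (k ∸ e ∸ i)
      unshift i i≤k∸e = trans (shift-≥ e g (k ∸ i) e≤k∸i) (cong g (∸-comm k i e))
        where
        e≤k∸i : e ℕ.≤ k ∸ i
        e≤k∸i = subst (ℕ._≤ k ∸ i) (ℕP.m∸[m∸n]≡n e≤k) (ℕP.∸-monoʳ-≤ k i≤k∸e)
        ∸-comm : ∀ m n o → m ∸ n ∸ o ≡ m ∸ o ∸ n
        ∸-comm m n o = trans (ℕP.∸-+-assoc m n o) (trans (cong (m ∸_) (ℕP.+-comm n o)) (sym (ℕP.∸-+-assoc m o n)))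

  shift-scale : ∀ c e f n → c * shift e f n ≡ shift e (λ j → c * f j) n
  shift-scale c e f n with n ℕ.<? e
  ... | yes _ = *-zeroʳ c
  ... | no _ = refl

  shift-scale-at : ∀ e f g c N → (∀ j → j ℕ.+ e ≡ N → f j ≡ c * g j) → shift e f N ≡ c * shift e g N
  shift-scale-at e f g c N h with N ℕ.<? e
  ... | yes _ = sym (*-zeroʳ c)
  ... | no p = h (N ∸ e) (ℕP.m∸n+n≡m (ℕP.≮⇒≥ p))

  shift-sum : ∀ N e (F : ℕ → Series) n → Σ< N (λ l → shift e (F l) n) ≡ shift e (λ j → Σ< N (λ l → F l j)) n
  shift-sum N e F n with n ℕ.<? e
  ... | yes _ = sum-0 N (λ _ _ → refl)
  ... | no _ = refl

  shift-shift : ∀ e1 e2 f n → shift e1 (shift e2 f) n ≡ shift (e1 ℕ.+ e2) f n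
  shift-shift e1 e2 f n with n ℕ.<? e1 | n ℕ.<? e1 ℕ.+ e2
  ... | yes _ | yes _ = refl
  ... | yes p | no q = ⊥-elim (q (ℕP.<-≤-trans p (ℕP.m≤m+n e1 e2)))
  ... | no p | yes q = shift-< e2 f (n ∸ e1) (ℕP.+-cancelʳ-< e1 (n ∸ e1) e2 (subst (ℕ._< e2 ℕ.+ e1) (sym (ℕP.m∸n+n≡m (ℕP.≮⇒≥ p))) (subst (n ℕ.<_) (ℕP.+-comm e1 e2) q)))
  ... | no p | no q = trans (shift-≥ e2 f (n ∸ e1) (ℕP.+-cancelʳ-≤ e1 e2 (n ∸ e1) (subst (e2 ℕ.+ e1 ℕ.≤_) (sym (ℕP.m∸n+n≡m (ℕP.≮⇒≥ p))) (subst (ℕ._≤ n) (ℕP.+-comm e1 e2) (ℕP.≮⇒≥ q))))) (cong f (ℕP.∸-+-assoc n e1 e2))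


module Rationals where
  open import Data.Nat as ℕ using (ℕ; suc)
  import Data.Nat.Properties as ℕP
  open import Data.Nat.Coprimality as Cop using (Coprime)
  import Data.Integer as ℤ
  import Data.Integer.Properties as ℤP
  open import Data.Rational
  open import Data.Rational.Properties
  open import Relation.Binary.PropositionalEquality
  open import Relation.Nullary using (yes; no)
  open import Data.Product using (_,_; ∃-syntax)
  open import Data.Empty using (⊥-elim)
  open import Tactic.RingSolver using (solve-∀)
  open import Defs using (ℕ→ℚ; _÷'_)
  open import Algebra.Properties.Group +-0-group using (x∙y⁻¹≈ε⇒x≈y)
  open FiniteSums using (ℚ-ring)

  ÷'-≢0 : ∀ x y (nz : y ≢ 0ℚ) → x ÷' y ≡ (x * (1/ y) {{≢-nonZero nz}})
  ÷'-≢0 x y nz with y ≟ 0ℚ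
  ... | yes y≡0 = ⊥-elim (nz y≡0)
  ... | no _ = refl

  inverse-unique : ∀ a b c → a * b ≡ 1ℚ → a * c ≡ 1ℚ → b ≡ c
  inverse-unique a b c ab ac = begin
      b ≡⟨ sym (*-identityˡ b) ⟩
      1ℚ * b ≡⟨ cong (_* b) (sym ac) ⟩
      a * c * b ≡⟨ lem a b c ⟩
      a * b * c ≡⟨ cong (_* c) ab ⟩
      1ℚ * c ≡⟨ *-identityˡ c ⟩
      c ∎
    where
    open ≡-Reasoning
    lem : ∀ a b c → a * c * b ≡ a * b * c
    lem = solve-∀ ℚ-ring

  *-fixed⇒0 : ∀ x y → y ≢ 1ℚ → y * x ≡ x → x ≡ 0ℚ
  *-fixed⇒0 x y y≢1 yx≡x = begin
      x                             ≡⟨ sym (*-identityʳ x) ⟩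
      x * 1ℚ                        ≡⟨ cong (x *_) (sym (*-inverseʳ (1ℚ - y))) ⟩
      x * ((1ℚ - y) * 1/ (1ℚ - y))  ≡⟨ sym (*-assoc x (1ℚ - y) _) ⟩
      x * (1ℚ - y) * 1/ (1ℚ - y)    ≡⟨ cong (_* 1/ (1ℚ - y)) x[1-y]≡0 ⟩
      0ℚ * 1/ (1ℚ - y)              ≡⟨ *-zeroˡ (1/ (1ℚ - y)) ⟩
      0ℚ                            ∎
    where
    open ≡-Reasoning
    instance
      1-y≢0 : NonZero (1ℚ - y)
      1-y≢0 = ≢-nonZero (λ 1-y≡0 → y≢1 (sym (x∙y⁻¹≈ε⇒x≈y 1ℚ y 1-y≡0)))
    lem : ∀ x y → x * (1ℚ - y) ≡ x - y * x
    lem = solve-∀ ℚ-ring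
    x[1-y]≡0 : x * (1ℚ - y) ≡ 0ℚ
    x[1-y]≡0 = trans (lem x y) (trans (cong (λ z → x - z) yx≡x) (+-inverseʳ x))

  ℕ→ℚ≡mkℚ : ∀ k → ℕ→ℚ k ≡ mkℚ (ℤ.+ k) 0 (Cop.sym (Cop.1-coprimeTo k))
  ℕ→ℚ≡mkℚ k = ↥p/↧p≡p (mkℚ (ℤ.+ k) 0 (Cop.sym (Cop.1-coprimeTo k)))

  ℕ→ℚ-mono-< : ∀ {a b} → a ℕ.< b → ℕ→ℚ a < ℕ→ℚ b
  ℕ→ℚ-mono-< {a} {b} a<b rewrite ℕ→ℚ≡mkℚ a | ℕ→ℚ≡mkℚ b = *<* (subst₂ ℤ._<_ (sym (ℤP.*-identityʳ (ℤ.+ a))) (sym (ℤP.*-identityʳ (ℤ.+ b))) (ℤ.+<+ a<b))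

  ℕ→ℚ-mono-≤ : ∀ {a b} → a ℕ.≤ b → ℕ→ℚ a ≤ ℕ→ℚ b
  ℕ→ℚ-mono-≤ {a} {b} a≤b rewrite ℕ→ℚ≡mkℚ a | ℕ→ℚ≡mkℚ b = *≤* (subst₂ ℤ._≤_ (sym (ℤP.*-identityʳ (ℤ.+ a))) (sym (ℤP.*-identityʳ (ℤ.+ b))) (ℤ.+≤+ a≤b))

  ℕ→ℚ-+ : ∀ a b → ℕ→ℚ a + ℕ→ℚ b ≡ ℕ→ℚ (a ℕ.+ b)
  ℕ→ℚ-+ a b rewrite ℕ→ℚ≡mkℚ a | ℕ→ℚ≡mkℚ b = cong (λ z → z / 1) (trans (cong₂ ℤ._+_ (ℤP.*-identityʳ (ℤ.+ a)) (ℤP.*-identityʳ (ℤ.+ b))) (sym (ℤP.pos-+ a b)))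

  ℕ→ℚ-* : ∀ a b → ℕ→ℚ a * ℕ→ℚ b ≡ ℕ→ℚ (a ℕ.* b)
  ℕ→ℚ-* a b rewrite ℕ→ℚ≡mkℚ a | ℕ→ℚ≡mkℚ b = cong (λ z → z / 1) (sym (ℤP.pos-* a b))

  archimedean : ∀ x → ∃[ N ] (x < ℕ→ℚ N)
  archimedean (mkℚ (ℤ.+ n) d c) = suc n , subst (mkℚ (ℤ.+ n) d c <_) (sym (ℕ→ℚ≡mkℚ (suc n)))
    (*<* (subst₂ ℤ._<_ (sym (ℤP.*-identityʳ (ℤ.+ n))) (sym (ℤP.pos-* (suc n) (suc d))) (ℤ.+<+ (ℕP.m≤m*n (suc n) (suc d)))))
  archimedean (mkℚ ℤ.-[1+ n ] d c) = 1 , subst (mkℚ ℤ.-[1+ n ] d c <_) (sym (ℕ→ℚ≡mkℚ 1)) (*<* ℤ.-<+)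

  ≤-*ˡ : ∀ {a b} c → 0ℚ ≤ c → a ≤ b → c * a ≤ c * b
  ≤-*ˡ c h = *-monoˡ-≤-nonNeg c {{nonNegative h}}

  ≤-*ʳ : ∀ {a b} c → 0ℚ ≤ c → a ≤ b → a * c ≤ b * c
  ≤-*ʳ c h = *-monoʳ-≤-nonNeg c {{nonNegative h}}

  <-*ˡ : ∀ {a b} c → 0ℚ < c → a < b → c * a < c * b
  <-*ˡ c h = *-monoʳ-<-pos c {{positive h}}

  0≤* : ∀ {a b} → 0ℚ ≤ a → 0ℚ ≤ b → 0ℚ ≤ a * b
  0≤* {a} {b} ha hb = subst (_≤ a * b) (*-zeroʳ a) (≤-*ˡ a ha hb)

  ≤⇒0≤- : ∀ {a b} → a ≤ b → 0ℚ ≤ b - a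
  ≤⇒0≤- {a} {b} h = subst (_≤ b - a) (+-inverseʳ a) (+-monoˡ-≤ (- a) h)

  0≤-⇒≤ : ∀ {a b} → 0ℚ ≤ b - a → a ≤ b
  0≤-⇒≤ {a} {b} h = subst₂ _≤_ (+-identityˡ a) (lem b a) (+-monoˡ-≤ a h)
    where lem : ∀ b a → b - a + a ≡ b
          lem = solve-∀ ℚ-ring


module Partitions where
  open import Data.Nat as ℕ using (ℕ; zero; suc; _∸_; z≤n; s≤s)
  import Data.Nat.Properties as ℕP
  open import Data.Rational
  open import Data.Rational.Properties
  open import Data.List using (List; []; _∷_; map; applyUpTo; filter; concatMap; _++_; length)
  open import Data.Nat.ListAction using (sum)
  import Data.List.Properties as LP
  open import Relation.Binary.PropositionalEquality
  open import Relation.Nullary using (yes; no; Dec; ¬_)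
  open import Data.Product using (_×_; _,_; proj₁; proj₂)
  open import Data.Unit using (⊤; tt)
  open import Data.Empty using (⊥-elim)
  open import Function using (_∘_)
  open import Data.Nat.Solver using (module +-*-Solver)
  open import Defs
  open FiniteSums

  sumOver : (List ℕ → ℚ) → List (List ℕ) → ℚ
  sumOver w L = sumℚ (map w L)

  sumOver-cong : ∀ {w w'} (L : List (List ℕ)) → (∀ μ → w μ ≡ w' μ) → sumOver w L ≡ sumOver w' L
  sumOver-cong L h = cong sumℚ (LP.map-cong h L)

  sumOver-++ : ∀ w xs ys → sumOver w (xs ++ ys) ≡ sumOver w xs + sumOver w ys
  sumOver-++ w [] ys = sym (+-identityˡ _)
  sumOver-++ w (x ∷ xs) ys = trans (cong (w x +_) (sumOver-++ w xs ys)) (sym (+-assoc (w x) _ _))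

  sumOver-concatMap : ∀ w (h : ℕ → List (List ℕ)) (L : List ℕ) → sumOver w (concatMap h L) ≡ sumℚ (map (sumOver w ∘ h) L)
  sumOver-concatMap w h [] = refl
  sumOver-concatMap w h (x ∷ L) = trans (sumOver-++ w (h x) (concatMap h L)) (cong (sumOver w (h x) +_) (sumOver-concatMap w h L))

  sumOver-map-∷ : ∀ w j X → sumOver w (map (j ∷_) X) ≡ sumOver (w ∘ (j ∷_)) X
  sumOver-map-∷ w j [] = refl
  sumOver-map-∷ w j (x ∷ X) = cong (w (j ∷ x) +_) (sumOver-map-∷ w j X)

  sumOver-*ʳ : ∀ w c (L : List (List ℕ)) → sumOver (λ μ → w μ * c) L ≡ sumOver w L * c
  sumOver-*ʳ w c [] = sym (*-zeroˡ c)
  sumOver-*ʳ w c (x ∷ L) = trans (cong (w x * c +_) (sumOver-*ʳ w c L)) (sym (*-distribʳ-+ c (w x) (sumOver w L)))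

  sumOver-*ˡ : ∀ w c (L : List (List ℕ)) → sumOver (λ μ → c * w μ) L ≡ c * sumOver w L
  sumOver-*ˡ w c L = trans (sumOver-cong L (λ μ → *-comm c (w μ))) (trans (sumOver-*ʳ w c L) (*-comm _ c))

  ifYes : ∀ {A : Set} → Dec A → ℚ → ℚ
  ifYes (yes _) x = x
  ifYes (no _) x = 0ℚ

  ifYes-yes : ∀ {A : Set} (d : Dec A) {x} → A → ifYes d x ≡ x
  ifYes-yes (yes _) _ = refl
  ifYes-yes (no ¬p) p = ⊥-elim (¬p p)

  ifYes-no : ∀ {A : Set} (d : Dec A) {x} → ¬ A → ifYes d x ≡ 0ℚ
  ifYes-no (yes p) ¬p = ⊥-elim (¬p p)
  ifYes-no (no _) _ = refl

  ifYes-cong : ∀ {A : Set} (d : Dec A) {x y} → (A → x ≡ y) → ifYes d x ≡ ifYes d y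
  ifYes-cong (yes p) h = h p
  ifYes-cong (no _) h = refl

  ifYes-zero : ∀ {A : Set} (d : Dec A) → ifYes d 0ℚ ≡ 0ℚ
  ifYes-zero (yes _) = refl
  ifYes-zero (no _) = refl

  ifYes-*ʳ : ∀ {A : Set} (d : Dec A) x c → ifYes d (x * c) ≡ ifYes d x * c
  ifYes-*ʳ (yes _) x c = refl
  ifYes-*ʳ (no _) x c = sym (*-zeroˡ c)

  sum-filter-≤ : ∀ (F : ℕ → ℚ) N g k → sumℚ (map F (filter (ℕ._≤? N) (applyUpTo g k))) ≡ Σ< k (λ i → ifYes (g i ℕ.≤? N) (F (g i)))
  sum-filter-≤ F N g zero = refl
  sum-filter-≤ F N g (suc k) = trans (go (g 0 ℕ.≤? N)) (sym (sum-sucˡ k (λ i → ifYes (g i ℕ.≤? N) (F (g i)))))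
    where
    go : Dec (g 0 ℕ.≤ N) → sumℚ (map F (filter (ℕ._≤? N) (applyUpTo g (suc k)))) ≡ ifYes (g 0 ℕ.≤? N) (F (g 0)) + Σ< k (λ i → ifYes (g (suc i) ℕ.≤? N) (F (g (suc i))))
    go (yes p) = trans (cong (λ L → sumℚ (map F L)) (LP.filter-accept (ℕ._≤? N) p)) (cong₂ _+_ (sym (ifYes-yes (g 0 ℕ.≤? N) p)) (sum-filter-≤ F N (g ∘ suc) k))
    go (no p) = trans (cong (λ L → sumℚ (map F L)) (LP.filter-reject (ℕ._≤? N) p)) (trans (sum-filter-≤ F N (g ∘ suc) k) (trans (sym (+-identityˡ _)) (cong (_+ Σ< k (λ i → ifYes (g (suc i) ℕ.≤? N) (F (g (suc i))))) (sym (ifYes-no (g 0 ℕ.≤? N) p)))))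

  sumOver-ptns : ∀ w f n k → sumOver w (ptns (suc f) (suc n) k) ≡ Σ< k (λ i → ifYes (suc i ℕ.≤? suc n) (sumOver (w ∘ (suc i ∷_)) (ptns f (suc n ∸ suc i) (suc i))))
  sumOver-ptns w f n k = begin
      sumOver w (concatMap h (filter (ℕ._≤? suc n) (applyUpTo suc k))) ≡⟨ sumOver-concatMap w h (filter (ℕ._≤? suc n) (applyUpTo suc k)) ⟩
      sumℚ (map (sumOver w ∘ h) (filter (ℕ._≤? suc n) (applyUpTo suc k))) ≡⟨ sum-filter-≤ (sumOver w ∘ h) (suc n) suc k ⟩
      Σ< k (λ i → ifYes (suc i ℕ.≤? suc n) (sumOver w (h (suc i)))) ≡⟨ sum-cong k (λ i → cong (ifYes (suc i ℕ.≤? suc n)) (sumOver-map-∷ w (suc i) (ptns f (suc n ∸ suc i) (suc i)))) ⟩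
      Σ< k (λ i → ifYes (suc i ℕ.≤? suc n) (sumOver (w ∘ (suc i ∷_)) (ptns f (suc n ∸ suc i) (suc i)))) ∎
    where
    open ≡-Reasoning
    h : ℕ → List (List ℕ)
    h j = map (j ∷_) (ptns f (suc n ∸ j) j)

  Parts≤ : ℕ → List ℕ → Set
  Parts≤ k [] = ⊤
  Parts≤ k (x ∷ μ) = (1 ℕ.≤ x) × (x ℕ.≤ k) × Parts≤ x μ

  sumOver-ptns-cong : ∀ f n k (w w' : List ℕ → ℚ) → (∀ μ → Parts≤ k μ → sum μ ≡ n → w μ ≡ w' μ) → sumOver w (ptns f n k) ≡ sumOver w' (ptns f n k)
  sumOver-ptns-cong f zero k w w' h = cong (_+ 0ℚ) (h [] tt refl)
  sumOver-ptns-cong zero (suc n) k w w' h = refl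
  sumOver-ptns-cong (suc f) (suc n) k w w' h = trans (sumOver-ptns w f n k) (trans (sum-cong-< k step) (sym (sumOver-ptns w' f n k)))
    where
    step : ∀ i → i ℕ.< k → ifYes (suc i ℕ.≤? suc n) (sumOver (w ∘ (suc i ∷_)) (ptns f (suc n ∸ suc i) (suc i)))
                          ≡ ifYes (suc i ℕ.≤? suc n) (sumOver (w' ∘ (suc i ∷_)) (ptns f (suc n ∸ suc i) (suc i)))
    step i i<k = ifYes-cong (suc i ℕ.≤? suc n) (λ { (s≤s i≤n) → sumOver-ptns-cong f (n ∸ i) (suc i) (w ∘ (suc i ∷_)) (w' ∘ (suc i ∷_))
       (λ ν gν sν → h (suc i ∷ ν) (s≤s z≤n , i<k , gν) (cong suc (trans (cong (i ℕ.+_) sν) (ℕP.m+[n∸m]≡n i≤n)))) })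

  Parts≤-largestPart : ∀ k μ → Parts≤ k μ → largestPart μ ℕ.≤ k
  Parts≤-largestPart k [] _ = z≤n
  Parts≤-largestPart k (x ∷ μ) (_ , x≤k , _) = x≤k

  Parts≤-largestPart-self : ∀ k μ → Parts≤ k μ → Parts≤ (largestPart μ) μ
  Parts≤-largestPart-self k [] _ = tt
  Parts≤-largestPart-self k (x ∷ μ) (p , _ , g) = p , ℕP.≤-refl , g

  Parts≤-mono : ∀ {k k'} μ → k ℕ.≤ k' → Parts≤ k μ → Parts≤ k' μ
  Parts≤-mono [] _ _ = tt
  Parts≤-mono (x ∷ μ) k≤k' (p , x≤k , g) = p , ℕP.≤-trans x≤k k≤k' , g

  conj-yes : ∀ {i x} μ → i ℕ.≤ x → conj i (x ∷ μ) ≡ suc (conj i μ)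
  conj-yes {i} μ p = cong length (LP.filter-accept (i ℕ.≤?_) p)

  conj-no : ∀ {i x} μ → ¬ (i ℕ.≤ x) → conj i (x ∷ μ) ≡ conj i μ
  conj-no {i} μ p = cong length (LP.filter-reject (i ℕ.≤?_) p)

  mult-yes : ∀ {i x} μ → x ≡ i → mult i (x ∷ μ) ≡ suc (mult i μ)
  mult-yes {i} μ p = cong length (LP.filter-accept (ℕ._≟ i) p)

  mult-no : ∀ {i x} μ → x ≢ i → mult i (x ∷ μ) ≡ mult i μ
  mult-no {i} μ p = cong length (LP.filter-reject (ℕ._≟ i) p)

  Parts≤-beyond : ∀ k μ → Parts≤ k μ → ∀ i → k ℕ.< i → (conj i μ ≡ 0) × (mult i μ ≡ 0)
  Parts≤-beyond k [] _ i _ = refl , refl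
  Parts≤-beyond k (x ∷ μ) (_ , x≤k , g) i k<i =
    let ih = Parts≤-beyond x μ g i (ℕP.≤-<-trans x≤k k<i) in
    trans (conj-no {i} {x} μ (λ i≤x → ℕP.<⇒≱ k<i (ℕP.≤-trans i≤x x≤k))) (proj₁ ih) ,
    trans (mult-no {i} {x} μ (λ { refl → ℕP.<⇒≱ k<i x≤k })) (proj₂ ih)

  Σℕ : ℕ → (ℕ → ℕ) → ℕ
  Σℕ zero h = 0
  Σℕ (suc K) h = Σℕ K h ℕ.+ h K

  Σℕ-2+1 : ∀ K h → Σℕ K (λ i → 2 ℕ.* h i ℕ.+ 1) ≡ 2 ℕ.* Σℕ K h ℕ.+ K
  Σℕ-2+1 zero h = refl
  Σℕ-2+1 (suc K) h = trans (cong (ℕ._+ (2 ℕ.* h K ℕ.+ 1)) (Σℕ-2+1 K h))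
    (solve 3 (λ s k x → con 2 :* s :+ k :+ (con 2 :* x :+ con 1) := con 2 :* (s :+ x) :+ (con 1 :+ k)) refl (Σℕ K h) K (h K))
    where open +-*-Solver

  Σℕ-+ : ∀ K g h → Σℕ K (λ i → g i ℕ.+ h i) ≡ Σℕ K g ℕ.+ Σℕ K h
  Σℕ-+ zero g h = refl
  Σℕ-+ (suc K) g h = trans (cong (ℕ._+ (g K ℕ.+ h K)) (Σℕ-+ K g h))
    (solve 4 (λ a b c d → a :+ b :+ (c :+ d) := a :+ c :+ (b :+ d)) refl (Σℕ K g) (Σℕ K h) (g K) (h K))
    where open +-*-Solver

  indicator : ∀ {A : Set} → Dec A → ℕ
  indicator (yes _) = 1
  indicator (no _) = 0

  conj-cons : ∀ i x μ → conj i (x ∷ μ) ≡ indicator (i ℕ.≤? x) ℕ.+ conj i μ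
  conj-cons i x μ = go (i ℕ.≤? x)
    where
    go : (d : Dec (i ℕ.≤ x)) → conj i (x ∷ μ) ≡ indicator d ℕ.+ conj i μ
    go (yes p) = conj-yes μ p
    go (no p) = conj-no μ p

  Σℕ-indicator : ∀ K x → Σℕ K (λ i → indicator (suc i ℕ.≤? x)) ≡ K ℕ.⊓ x
  Σℕ-indicator zero x = refl
  Σℕ-indicator (suc K) x = trans (cong (ℕ._+ indicator (suc K ℕ.≤? x)) (Σℕ-indicator K x)) (go (suc K ℕ.≤? x))
    where
    go : (d : Dec (suc K ℕ.≤ x)) → K ℕ.⊓ x ℕ.+ indicator d ≡ suc K ℕ.⊓ x
    go (yes p) = trans (cong (ℕ._+ 1) (ℕP.m≤n⇒m⊓n≡m (ℕP.<⇒≤ p))) (trans (ℕP.+-comm K 1) (sym (ℕP.m≤n⇒m⊓n≡m p)))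
    go (no p) = trans (ℕP.+-identityʳ _) (trans (ℕP.m≥n⇒m⊓n≡n (ℕP.≤-pred (ℕP.≰⇒> p))) (sym (ℕP.m≥n⇒m⊓n≡n (ℕP.<⇒≤ (ℕP.≰⇒> p)))))

  Σℕ-conj : ∀ K μ → Parts≤ K μ → Σℕ K (λ i → conj (suc i) μ) ≡ sum μ
  Σℕ-conj K [] g = Σℕ-zero K
    where Σℕ-zero : ∀ K → Σℕ K (λ i → 0) ≡ 0
          Σℕ-zero zero = refl
          Σℕ-zero (suc K) = trans (ℕP.+-identityʳ _) (Σℕ-zero K)
  Σℕ-conj K (x ∷ μ) (p , x≤K , g) = begin
      Σℕ K (λ i → conj (suc i) (x ∷ μ)) ≡⟨ Σℕ-cong K (λ i → conj-cons (suc i) x μ) ⟩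
      Σℕ K (λ i → indicator (suc i ℕ.≤? x) ℕ.+ conj (suc i) μ) ≡⟨ Σℕ-+ K _ _ ⟩
      Σℕ K (λ i → indicator (suc i ℕ.≤? x)) ℕ.+ Σℕ K (λ i → conj (suc i) μ) ≡⟨ cong₂ ℕ._+_ (trans (Σℕ-indicator K x) (ℕP.m≥n⇒m⊓n≡n x≤K)) (Σℕ-conj K μ (Parts≤-mono μ x≤K g)) ⟩
      x ℕ.+ sum μ ∎
    where
    open ≡-Reasoning
    Σℕ-cong : ∀ K {f g : ℕ → ℕ} → (∀ i → f i ≡ g i) → Σℕ K f ≡ Σℕ K g
    Σℕ-cong zero h = refl
    Σℕ-cong (suc K) h = cong₂ ℕ._+_ (Σℕ-cong K h) (h K)

  module _ (r : ℕ) where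
    LargestBelow : List ℕ → Set
    LargestBelow p = largestPart p ℕ.< r
    largestBelow? : (p : List ℕ) → Dec (LargestBelow p)
    largestBelow? p = largestPart p ℕ.<? r

    sumOver-filter-++ : ∀ w xs ys → sumOver w (filter largestBelow? (xs ++ ys)) ≡ sumOver w (filter largestBelow? xs) + sumOver w (filter largestBelow? ys)
    sumOver-filter-++ w xs ys = trans (cong (sumOver w) (LP.filter-++ largestBelow? xs ys)) (sumOver-++ w (filter largestBelow? xs) (filter largestBelow? ys))

    sumOver-filter-concatMap : ∀ w (h : ℕ → List (List ℕ)) (L : List ℕ) → sumOver w (filter largestBelow? (concatMap h L)) ≡ sumℚ (map (λ j → sumOver w (filter largestBelow? (h j))) L)
    sumOver-filter-concatMap w h [] = refl
    sumOver-filter-concatMap w h (x ∷ L) = trans (sumOver-filter-++ w (h x) (concatMap h L)) (cong (sumOver w (filter largestBelow? (h x)) +_) (sumOver-filter-concatMap w h L))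

    sumOver-filter-map-∷ : ∀ w j X → sumOver w (filter largestBelow? (map (j ∷_) X)) ≡ ifYes (j ℕ.<? r) (sumOver (w ∘ (j ∷_)) X)
    sumOver-filter-map-∷ w j X = go (j ℕ.<? r) X
      where
      go : (d : Dec (j ℕ.< r)) → ∀ X → sumOver w (filter largestBelow? (map (j ∷_) X)) ≡ ifYes d (sumOver (w ∘ (j ∷_)) X)
      go (yes p) [] = refl
      go (yes p) (x ∷ X) = trans (cong (sumOver w) (LP.filter-accept largestBelow? {j ∷ x} p)) (cong (w (j ∷ x) +_) (go (yes p) X))
      go (no p) [] = refl
      go (no p) (x ∷ X) = trans (cong (sumOver w) (LP.filter-reject largestBelow? {j ∷ x} p)) (go (no p) X)

    sumOver-filter-ptns : 1 ℕ.≤ r → ∀ w f n k → sumOver w (filter largestBelow? (ptns f n k)) ≡ sumOver w (ptns f n (k ℕ.⊓ (r ∸ 1)))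
    sumOver-filter-ptns r≥1 w f zero k = cong (sumOver w) (LP.filter-accept largestBelow? {[]} r≥1)
    sumOver-filter-ptns r≥1 w zero (suc n) k = refl
    sumOver-filter-ptns r≥1 w (suc f) (suc n) k = begin
        sumOver w (filter largestBelow? (concatMap h (filter (ℕ._≤? suc n) (applyUpTo suc k)))) ≡⟨ sumOver-filter-concatMap w h (filter (ℕ._≤? suc n) (applyUpTo suc k)) ⟩
        sumℚ (map (λ j → sumOver w (filter largestBelow? (h j))) (filter (ℕ._≤? suc n) (applyUpTo suc k))) ≡⟨ sum-filter-≤ (λ j → sumOver w (filter largestBelow? (h j))) (suc n) suc k ⟩
        Σ< k (λ i → ifYes (suc i ℕ.≤? suc n) (sumOver w (filter largestBelow? (h (suc i))))) ≡⟨ sum-cong k (λ i → cong (ifYes (suc i ℕ.≤? suc n)) (sumOver-filter-map-∷ w (suc i) (ptns f (suc n ∸ suc i) (suc i)))) ⟩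
        Σ< k (λ i → ifYes (suc i ℕ.≤? suc n) (ifYes (suc i ℕ.<? r) (branch i))) ≡⟨ sum-truncate _ (ℕP.m⊓n≤m k (r ∸ 1)) vanish ⟩
        Σ< (k ℕ.⊓ (r ∸ 1)) (λ i → ifYes (suc i ℕ.≤? suc n) (ifYes (suc i ℕ.<? r) (branch i))) ≡⟨ sum-cong-< (k ℕ.⊓ (r ∸ 1)) (λ i lt → ifYes-cong (suc i ℕ.≤? suc n) (λ _ → ifYes-yes (suc i ℕ.<? r) (suc-i<r i lt))) ⟩
        Σ< (k ℕ.⊓ (r ∸ 1)) (λ i → ifYes (suc i ℕ.≤? suc n) (branch i)) ≡⟨ sym (sumOver-ptns w f n (k ℕ.⊓ (r ∸ 1))) ⟩
        sumOver w (ptns (suc f) (suc n) (k ℕ.⊓ (r ∸ 1))) ∎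
      where
      open ≡-Reasoning
      h : ℕ → List (List ℕ)
      h j = map (j ∷_) (ptns f (suc n ∸ j) j)
      branch : ℕ → ℚ
      branch i = sumOver (w ∘ (suc i ∷_)) (ptns f (suc n ∸ suc i) (suc i))
      vanish : ∀ i → k ℕ.⊓ (r ∸ 1) ℕ.≤ i → i ℕ.< k → ifYes (suc i ℕ.≤? suc n) (ifYes (suc i ℕ.<? r) (branch i)) ≡ 0ℚ
      vanish i le lt = trans (ifYes-cong (suc i ℕ.≤? suc n) (λ _ → ifYes-no (suc i ℕ.<? r) r≤suc-i)) (ifYes-zero (suc i ℕ.≤? suc n))
        where
        r≤suc-i : ¬ (suc i ℕ.< r)
        r≤suc-i si<r = ℕP.<-irrefl refl (ℕP.<-≤-trans (ℕP.⊓-glb lt (ℕP.∸-monoˡ-≤ 1 si<r)) le)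
      suc-i<r : ∀ i → i ℕ.< k ℕ.⊓ (r ∸ 1) → suc i ℕ.< r
      suc-i<r i lt = subst (suc i ℕ.<_) (trans (ℕP.+-comm 1 (r ∸ 1)) (ℕP.m∸n+n≡m r≥1)) (s≤s (ℕP.<-≤-trans lt (ℕP.m⊓n≤n k (r ∸ 1))))


module FixedBase (q : Data.Nat.ℕ) (hq : 2 Data.Nat.≤ q) where
  open import Data.Nat as ℕ using (ℕ; zero; suc; _∸_; z≤n; s≤s)
  import Data.Nat.Properties as ℕP
  open import Data.Nat.ListAction using (sum)
  open import Data.Rational
  open import Data.Rational.Properties
  open import Data.List using (List; []; _∷_; map; applyUpTo; upTo; filter)
  import Data.List.Properties as LP
  open import Relation.Binary.PropositionalEquality
  open import Relation.Nullary using (yes; no; Dec)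
  open import Data.Product using (_,_; proj₁; proj₂; ∃-syntax)
  open import Function using (_∘_)
  open import Data.Nat.DivMod using (m*n/n≡m)
  open import Data.Nat.Solver using (module +-*-Solver)
  open import Tactic.RingSolver using (solve-∀)
  open import Defs
  open FiniteSums
  open PowerSeries
  open Rationals
  open Partitions

  Q : ℚ
  Q = ℕ→ℚ q

  1<Q : 1ℚ < Q
  1<Q = ℕ→ℚ-mono-< {1} {q} hq

  0<Q : 0ℚ < Q
  0<Q = <-trans (ℕ→ℚ-mono-< {0} {1} (s≤s z≤n)) 1<Q

  Q≢0 : Q ≢ 0ℚ
  Q≢0 e = <-irrefl (sym e) 0<Q

  q⁻¹ : ℚ
  q⁻¹ = 1ℚ ÷' Q

  q⁻¹≡1/Q : q⁻¹ ≡ (1/ Q) {{≢-nonZero Q≢0}}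
  q⁻¹≡1/Q = trans (÷'-≢0 1ℚ Q Q≢0) (*-identityˡ _)

  q⁻¹*Q : q⁻¹ * Q ≡ 1ℚ
  q⁻¹*Q = trans (cong (_* Q) q⁻¹≡1/Q) (*-inverseˡ Q {{≢-nonZero Q≢0}})

  0<q⁻¹ : 0ℚ < q⁻¹
  0<q⁻¹ = subst (0ℚ <_) (sym q⁻¹≡1/Q) (positive⁻¹ _ {{1/pos⇒pos Q {{positive 0<Q}}}})

  q⁻¹<1 : q⁻¹ < 1ℚ
  q⁻¹<1 = subst₂ _<_ (*-identityʳ q⁻¹) q⁻¹*Q (*-monoʳ-<-pos q⁻¹ {{positive 0<q⁻¹}} 1<Q)

  q⁻ : ℕ → ℚ
  q⁻ k = q⁻¹ ^ℚ k

  q⁻-+ : ∀ a b → q⁻ (a ℕ.+ b) ≡ q⁻ a * q⁻ b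
  q⁻-+ zero b = sym (*-identityˡ _)
  q⁻-+ (suc a) b = trans (cong (q⁻¹ *_) (q⁻-+ a b)) (sym (*-assoc q⁻¹ (q⁻ a) (q⁻ b)))

  q⁻-1 : q⁻ 1 ≡ q⁻¹
  q⁻-1 = *-identityʳ q⁻¹

  q⁻-* : ∀ k i → q⁻ (k ℕ.* i) ≡ q⁻ i ^ℚ k
  q⁻-* zero i = refl
  q⁻-* (suc k) i = trans (q⁻-+ i (k ℕ.* i)) (cong (q⁻ i *_) (q⁻-* k i))

  0<q⁻ : ∀ k → 0ℚ < q⁻ k
  0<q⁻ zero = ℕ→ℚ-mono-< {0} {1} (s≤s z≤n)
  0<q⁻ (suc k) = positive⁻¹ _ {{pos*pos⇒pos q⁻¹ {{positive 0<q⁻¹}} (q⁻ k) {{positive (0<q⁻ k)}}}}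

  0≤q⁻ : ∀ k → 0ℚ ≤ q⁻ k
  0≤q⁻ k = <⇒≤ (0<q⁻ k)

  q⁻≤1 : ∀ k → q⁻ k ≤ 1ℚ
  q⁻≤1 zero = ≤-refl
  q⁻≤1 (suc k) = ≤-trans (*-monoˡ-≤-nonNeg q⁻¹ {{nonNegative (<⇒≤ 0<q⁻¹)}} (q⁻≤1 k)) (≤-trans (≤-reflexive (*-identityʳ q⁻¹)) (<⇒≤ q⁻¹<1))

  q⁻-suc<1 : ∀ k → q⁻ (suc k) < 1ℚ
  q⁻-suc<1 k = ≤-<-trans (≤-trans (*-monoˡ-≤-nonNeg q⁻¹ {{nonNegative (<⇒≤ 0<q⁻¹)}} (q⁻≤1 k)) (≤-reflexive (*-identityʳ q⁻¹))) q⁻¹<1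

  q⁻-+≤ : ∀ N j → q⁻ (N ℕ.+ j) ≤ q⁻ N
  q⁻-+≤ N j = subst₂ _≤_ (sym (q⁻-+ N j)) (*-identityʳ (q⁻ N)) (≤-*ˡ (q⁻ N) (0≤q⁻ N) (q⁻≤1 j))

  Q^*q⁻ : ∀ k → (Q ^ℚ k) * q⁻ k ≡ 1ℚ
  Q^*q⁻ zero = refl
  Q^*q⁻ (suc k) = trans (lem Q (Q ^ℚ k) q⁻¹ (q⁻ k)) (trans (cong₂ _*_ (trans (*-comm Q q⁻¹) q⁻¹*Q) (Q^*q⁻ k)) (*-identityˡ 1ℚ))
    where lem : ∀ a b c d → a * b * (c * d) ≡ (a * c) * (b * d)
          lem = solve-∀ ℚ-ring

  Q^≢0 : ∀ k → Q ^ℚ k ≢ 0ℚ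
  Q^≢0 k e = <-irrefl refl (subst (0ℚ <_) (trans (sym (Q^*q⁻ k)) (trans (cong (_* q⁻ k) e) (*-zeroˡ (q⁻ k)))) (ℕ→ℚ-mono-< {0} {1} (s≤s z≤n)))

  ÷'-Q^ : ∀ x k → x ÷' (Q ^ℚ k) ≡ x * q⁻ k
  ÷'-Q^ x k = trans (÷'-≢0 x (Q ^ℚ k) (Q^≢0 k)) (cong (x *_) inv)
    where
    instance
      nz : NonZero (Q ^ℚ k)
      nz = ≢-nonZero (Q^≢0 k)
    inv : 1/ (Q ^ℚ k) ≡ q⁻ k
    inv = begin
        1/ (Q ^ℚ k) ≡⟨ sym (*-identityˡ _) ⟩
        1ℚ * 1/ (Q ^ℚ k) ≡⟨ cong (_* 1/ (Q ^ℚ k)) (sym (trans (*-comm (q⁻ k) (Q ^ℚ k)) (Q^*q⁻ k))) ⟩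
        q⁻ k * (Q ^ℚ k) * 1/ (Q ^ℚ k) ≡⟨ *-assoc (q⁻ k) _ _ ⟩
        q⁻ k * ((Q ^ℚ k) * 1/ (Q ^ℚ k)) ≡⟨ cong (q⁻ k *_) (*-inverseʳ (Q ^ℚ k)) ⟩
        q⁻ k * 1ℚ ≡⟨ *-identityʳ (q⁻ k) ⟩
        q⁻ k ∎
      where open ≡-Reasoning

  Q^≡ℕ→ℚ : ∀ N → Q ^ℚ N ≡ ℕ→ℚ (q ℕ.^ N)
  Q^≡ℕ→ℚ zero = refl
  Q^≡ℕ→ℚ (suc N) = trans (cong (Q *_) (Q^≡ℕ→ℚ N)) (ℕ→ℚ-* q (q ℕ.^ N))

  suc≤q^ : ∀ N → suc N ℕ.≤ q ℕ.^ N
  suc≤q^ zero = ℕP.≤-refl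
  suc≤q^ (suc N) = ℕP.≤-trans (s≤s (s≤s (ℕP.m≤m+n N N))) (ℕP.≤-trans (ℕP.≤-reflexive e) (ℕP.*-mono-≤ hq (suc≤q^ N)))
    where
    open +-*-Solver
    e : suc (suc (N ℕ.+ N)) ≡ 2 ℕ.* suc N
    e = solve 1 (λ N → con 1 :+ (con 1 :+ (N :+ N)) := con 2 :* (con 1 :+ N)) refl N

  qPoch : ℕ → ℚ
  qPoch m = Π< m (λ i → 1ℚ - q⁻ (suc i))

  0<1-q⁻-suc : ∀ k → 0ℚ < 1ℚ - q⁻ (suc k)
  0<1-q⁻-suc k = subst (_< 1ℚ - q⁻ (suc k)) (+-inverseʳ (q⁻ (suc k))) (+-monoˡ-< (- q⁻ (suc k)) (q⁻-suc<1 k))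

  0<qPoch : ∀ m → 0ℚ < qPoch m
  0<qPoch zero = ℕ→ℚ-mono-< {0} {1} (s≤s z≤n)
  0<qPoch (suc m) = positive⁻¹ _ {{pos*pos⇒pos (qPoch m) {{positive (0<qPoch m)}} _ {{positive (0<1-q⁻-suc m)}}}}

  qPoch≢0 : ∀ m → qPoch m ≢ 0ℚ
  qPoch≢0 m e = <-irrefl (sym e) (0<qPoch m)

  qPoch⁻¹ : ℕ → ℚ
  qPoch⁻¹ m = (1/ (qPoch m)) {{≢-nonZero (qPoch≢0 m)}}

  qPoch*qPoch⁻¹ : ∀ m → qPoch m * qPoch⁻¹ m ≡ 1ℚ
  qPoch*qPoch⁻¹ m = *-inverseʳ (qPoch m) {{≢-nonZero (qPoch≢0 m)}}

  qPoch⁻¹-0 : qPoch⁻¹ 0 ≡ 1ℚ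
  qPoch⁻¹-0 = trans (sym (*-identityˡ (qPoch⁻¹ 0))) (qPoch*qPoch⁻¹ 0)

  qPoch⁻¹-suc : ∀ m → qPoch⁻¹ m ≡ qPoch⁻¹ (suc m) * (1ℚ - q⁻ (suc m))
  qPoch⁻¹-suc m = inverse-unique (qPoch m) (qPoch⁻¹ m) _ (qPoch*qPoch⁻¹ m) (trans (lem (qPoch m) (qPoch⁻¹ (suc m)) (1ℚ - q⁻ (suc m))) (qPoch*qPoch⁻¹ (suc m)))
    where lem : ∀ a b c → a * (b * c) ≡ a * c * b
          lem = solve-∀ ℚ-ring

  0<qPoch⁻¹ : ∀ m → 0ℚ < qPoch⁻¹ m
  0<qPoch⁻¹ m = positive⁻¹ _ {{1/pos⇒pos (qPoch m) {{positive (0<qPoch m)}}}}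

  0≤qPoch⁻¹ : ∀ k → 0ℚ ≤ qPoch⁻¹ k
  0≤qPoch⁻¹ k = <⇒≤ (0<qPoch⁻¹ k)

  poch≡qPoch : ∀ m → poch q (1ℚ ÷' Q) m ≡ qPoch m
  poch≡qPoch m = trans (prodℚ-applyUpTo m (λ i → 1ℚ - (1ℚ ÷' Q) ÷' (Q ^ℚ i)) (λ x → x)) (prod-cong-< m (λ i _ → cong (λ x → 1ℚ - x) (trans (÷'-Q^ _ i) (trans (cong (_* q⁻ i) (sym q⁻-1)) (sym (q⁻-+ 1 i))))))

  -- Euler products

  -- By Euler's identity euler a is ∏_{i ≥ a} 1/(1 - u/qⁱ), so euler 1 is the product of the statement.
  euler : ℕ → Series
  euler a j = q⁻ (a ℕ.* j) * qPoch⁻¹ j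

  infiniteProduct : Series
  infiniteProduct = euler 1

  euler-step : ∀ a → euler a ⊛ oneMinus (q⁻ a) ≗ euler (suc a)
  euler-step a k = trans (⊛-comm (euler a) (oneMinus (q⁻ a)) k) (go k)
    where
    go : ∀ k → (oneMinus (q⁻ a) ⊛ euler a) k ≡ euler (suc a) k
    go zero = trans (oneMinus-⊛-zero (q⁻ a) (euler a)) (cong (λ z → q⁻ z * qPoch⁻¹ 0) (trans (ℕP.*-zeroʳ a) (sym (ℕP.*-zeroʳ (suc a)))))
    go (suc j) = begin
        (oneMinus (q⁻ a) ⊛ euler a) (suc j) ≡⟨ oneMinus-⊛-suc (q⁻ a) (euler a) j ⟩
        q⁻ (a ℕ.* suc j) * qPoch⁻¹ (suc j) - q⁻ a * (q⁻ (a ℕ.* j) * qPoch⁻¹ j) ≡⟨ cong₂ (λ x y → q⁻ x * qPoch⁻¹ (suc j) - q⁻ a * (q⁻ (a ℕ.* j) * y)) (ℕP.*-suc a j) (qPoch⁻¹-suc j) ⟩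
        q⁻ (a ℕ.+ a ℕ.* j) * qPoch⁻¹ (suc j) - q⁻ a * (q⁻ (a ℕ.* j) * (qPoch⁻¹ (suc j) * (1ℚ - q⁻ (suc j)))) ≡⟨ cong (λ x → x * qPoch⁻¹ (suc j) - q⁻ a * (q⁻ (a ℕ.* j) * (qPoch⁻¹ (suc j) * (1ℚ - q⁻ (suc j))))) (q⁻-+ a (a ℕ.* j)) ⟩
        q⁻ a * q⁻ (a ℕ.* j) * qPoch⁻¹ (suc j) - q⁻ a * (q⁻ (a ℕ.* j) * (qPoch⁻¹ (suc j) * (1ℚ - q⁻ (suc j)))) ≡⟨ lem (q⁻ a) (q⁻ (a ℕ.* j)) (qPoch⁻¹ (suc j)) (q⁻ (suc j)) ⟩
        q⁻ (suc j) * (q⁻ a * q⁻ (a ℕ.* j)) * qPoch⁻¹ (suc j) ≡⟨ cong (_* qPoch⁻¹ (suc j)) (sym (trans (q⁻-+ (suc j) (a ℕ.* suc j)) (cong (q⁻ (suc j) *_) (trans (cong q⁻ (ℕP.*-suc a j)) (q⁻-+ a (a ℕ.* j)))))) ⟩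
        q⁻ (suc a ℕ.* suc j) * qPoch⁻¹ (suc j) ∎
      where
      open ≡-Reasoning
      lem : ∀ A X I B → A * X * I - A * (X * (I * (1ℚ - B))) ≡ B * (A * X) * I
      lem = solve-∀ ℚ-ring

  euler-⊛-oneMinus-prod : ∀ k a (g : ℕ → ℕ) → (∀ i → g i ≡ a ℕ.+ i) →
    euler (suc a) ⊛ prodS (map (oneMinus ∘ q⁻ ∘ suc) (applyUpTo g k)) ≗ euler (suc (a ℕ.+ k))
  euler-⊛-oneMinus-prod zero a g e x = trans (⊛-oneʳ (euler (suc a)) x) (cong (λ z → euler (suc z) x) (sym (ℕP.+-identityʳ a)))
  euler-⊛-oneMinus-prod (suc k) a g e x = begin
      (euler (suc a) ⊛ (oneMinus (q⁻ (suc (g 0))) ⊛ rest)) x ≡⟨ ⊛-cong {euler (suc a)} {euler (suc a)} {oneMinus (q⁻ (suc (g 0))) ⊛ rest} {oneMinus (q⁻ (suc a)) ⊛ rest} (λ _ → refl) (⊛-cong {oneMinus (q⁻ (suc (g 0)))} {oneMinus (q⁻ (suc a))} {rest} {rest} (λ y → cong (λ z → oneMinus (q⁻ (suc z)) y) (trans (e 0) (ℕP.+-identityʳ a))) (λ _ → refl)) x ⟩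
      (euler (suc a) ⊛ (oneMinus (q⁻ (suc a)) ⊛ rest)) x ≡⟨ sym (⊛-assoc (euler (suc a)) _ rest x) ⟩
      ((euler (suc a) ⊛ oneMinus (q⁻ (suc a))) ⊛ rest) x ≡⟨ ⊛-cong {euler (suc a) ⊛ oneMinus (q⁻ (suc a))} {euler (suc (suc a))} {rest} {rest} (euler-step (suc a)) (λ _ → refl) x ⟩
      (euler (suc (suc a)) ⊛ rest) x ≡⟨ euler-⊛-oneMinus-prod k (suc a) (g ∘ suc) (λ i → trans (e (suc i)) (ℕP.+-suc a i)) x ⟩
      euler (suc (suc a ℕ.+ k)) x ≡⟨ cong (λ z → euler (suc z) x) (sym (ℕP.+-suc a k)) ⟩
      euler (suc (a ℕ.+ suc k)) x ∎
    where
    open ≡-Reasoning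
    rest : Series
    rest = prodS (map (oneMinus ∘ q⁻ ∘ suc) (applyUpTo (g ∘ suc) k))

  sum-q⁻*qPoch⁻¹ : ∀ n → Σ< (suc n) (λ i → q⁻ i * qPoch⁻¹ i) ≡ qPoch⁻¹ n
  sum-q⁻*qPoch⁻¹ zero = trans (+-identityˡ _) (*-identityˡ (qPoch⁻¹ 0))
  sum-q⁻*qPoch⁻¹ (suc n) = begin
      Σ< (suc n) (λ i → q⁻ i * qPoch⁻¹ i) + q⁻ (suc n) * qPoch⁻¹ (suc n) ≡⟨ cong (_+ q⁻ (suc n) * qPoch⁻¹ (suc n)) (trans (sum-q⁻*qPoch⁻¹ n) (qPoch⁻¹-suc n)) ⟩
      qPoch⁻¹ (suc n) * (1ℚ - q⁻ (suc n)) + q⁻ (suc n) * qPoch⁻¹ (suc n) ≡⟨ lem (qPoch⁻¹ (suc n)) (q⁻ (suc n)) ⟩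
      qPoch⁻¹ (suc n) ∎
    where
    open ≡-Reasoning
    lem : ∀ I B → I * (1ℚ - B) + B * I ≡ I
    lem = solve-∀ ℚ-ring

  1^ℚ : ∀ k → 1ℚ ^ℚ k ≡ 1ℚ
  1^ℚ zero = refl
  1^ℚ (suc k) = trans (*-identityˡ _) (1^ℚ k)

  infiniteProduct-⊛-uPoch : ∀ m → infiniteProduct ⊛ uPoch q m ≗ euler m
  infiniteProduct-⊛-uPoch zero n = begin
      (infiniteProduct ⊛ geom 1ℚ) n ≡⟨ ⊛-coeff infiniteProduct (geom 1ℚ) n ⟩
      Σ< (suc n) (λ i → q⁻ (1 ℕ.* i) * qPoch⁻¹ i * (1ℚ ^ℚ (n ∸ i))) ≡⟨ sum-cong (suc n) (λ i → trans (cong₂ (λ x y → q⁻ x * qPoch⁻¹ i * y) (ℕP.*-identityˡ i) (1^ℚ (n ∸ i))) (*-identityʳ _)) ⟩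
      Σ< (suc n) (λ i → q⁻ i * qPoch⁻¹ i) ≡⟨ sum-q⁻*qPoch⁻¹ n ⟩
      qPoch⁻¹ n ≡⟨ sym (*-identityˡ (qPoch⁻¹ n)) ⟩
      euler 0 n ∎
    where open ≡-Reasoning
  infiniteProduct-⊛-uPoch (suc k) n = begin
      (infiniteProduct ⊛ prodS (map (λ i → oneMinus (1ℚ ÷' (ℕ→ℚ q ^ℚ suc i))) (upTo k))) n
        ≡⟨ cong (λ L → (infiniteProduct ⊛ prodS L) n) (LP.map-cong (λ i → cong oneMinus (trans (÷'-Q^ 1ℚ (suc i)) (*-identityˡ _))) (upTo k)) ⟩
      (infiniteProduct ⊛ prodS (map (oneMinus ∘ q⁻ ∘ suc) (upTo k))) n ≡⟨ euler-⊛-oneMinus-prod k 0 (λ x → x) (λ _ → refl) n ⟩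
      euler (suc k) n ∎
    where open ≡-Reasoning

  tri : ℕ → ℕ
  tri zero = 0
  tri (suc m) = tri m ℕ.+ m

  tri*2 : ∀ m → m ℕ.* (m ∸ 1) ≡ tri m ℕ.* 2
  tri*2 zero = refl
  tri*2 (suc m) = begin
      suc m ℕ.* m ≡⟨ refl ⟩
      m ℕ.+ m ℕ.* m ≡⟨ cong (m ℕ.+_) (sq m) ⟩
      m ℕ.+ (m ℕ.* (m ∸ 1) ℕ.+ m) ≡⟨ cong (λ z → m ℕ.+ (z ℕ.+ m)) (tri*2 m) ⟩
      m ℕ.+ (tri m ℕ.* 2 ℕ.+ m) ≡⟨ solve 2 (λ a b → a :+ (b :* con 2 :+ a) := (b :+ a) :* con 2) refl m (tri m) ⟩
      (tri m ℕ.+ m) ℕ.* 2 ∎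
    where
    open ≡-Reasoning
    open +-*-Solver
    sq : ∀ m → m ℕ.* m ≡ m ℕ.* (m ∸ 1) ℕ.+ m
    sq zero = refl
    sq (suc k) = trans (ℕP.*-suc (suc k) k) (ℕP.+-comm (suc k) (suc k ℕ.* k))

  choose2≡tri : ∀ m → (m ℕ.* (m ∸ 1)) ℕ./ 2 ≡ tri m
  choose2≡tri m = trans (cong (ℕ._/ 2) (tri*2 m)) (m*n/n≡m (tri m) 2)

  sgn : ℕ → ℚ
  sgn m = (- 1ℚ) ^ℚ m

  summandCoeff : ℕ → ℕ → ℚ
  summandCoeff r m = sgn m * (q⁻ (r ℕ.* m ℕ.* m ℕ.+ tri m) * qPoch⁻¹ m)

  ÷'-Q^*poch : ∀ x e m → x ÷' (ℕ→ℚ q ^ℚ e * poch q (1ℚ ÷' ℕ→ℚ q) m) ≡ x * (q⁻ e * qPoch⁻¹ m)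
  ÷'-Q^*poch x e m = begin
      x ÷' (Q ^ℚ e * poch q (1ℚ ÷' Q) m) ≡⟨ cong (λ z → x ÷' (Q ^ℚ e * z)) (poch≡qPoch m) ⟩
      x ÷' (Q ^ℚ e * qPoch m) ≡⟨ ÷'-≢0 x (Q ^ℚ e * qPoch m) nz ⟩
      x * (1/ (Q ^ℚ e * qPoch m)) {{≢-nonZero nz}} ≡⟨ cong (x *_) (inverse-unique (Q ^ℚ e * qPoch m) _ _ (*-inverseʳ (Q ^ℚ e * qPoch m) {{≢-nonZero nz}}) prod1) ⟩
      x * (q⁻ e * qPoch⁻¹ m) ∎
    where
    open ≡-Reasoning
    lem : ∀ a b c d → a * b * (c * d) ≡ (a * c) * (b * d)
    lem = solve-∀ ℚ-ring
    prod1 : Q ^ℚ e * qPoch m * (q⁻ e * qPoch⁻¹ m) ≡ 1ℚ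
    prod1 = trans (lem (Q ^ℚ e) (qPoch m) (q⁻ e) (qPoch⁻¹ m)) (trans (cong₂ _*_ (Q^*q⁻ e) (qPoch*qPoch⁻¹ m)) (*-identityˡ 1ℚ))
    nz : Q ^ℚ e * qPoch m ≢ 0ℚ
    nz eq = <-irrefl refl (subst (0ℚ <_) (trans (sym prod1) (trans (cong (_* (q⁻ e * qPoch⁻¹ m)) eq) (*-zeroˡ (q⁻ e * qPoch⁻¹ m)))) (0<q⁻ 0))

  summandSeries : ℕ → Series
  summandSeries m = oneMinus (q⁻ (2 ℕ.* m)) ⊛ euler m

  summand≗scale : ∀ r m → summand q r m ≗ scale (summandCoeff r m) (oneMinus (q⁻ (2 ℕ.* m)) ⊛ shift (r ℕ.* m) (uPoch q m))
  summand≗scale r m k = cong₂ _*_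
    (trans (÷'-Q^*poch (sgn m) (r ℕ.* m ℕ.* m ℕ.+ (m ℕ.* (m ∸ 1)) ℕ./ 2) m) (cong (λ z → sgn m * (q⁻ (r ℕ.* m ℕ.* m ℕ.+ z) * qPoch⁻¹ m)) (choose2≡tri m)))
    (⊛-cong {oneMinus (1ℚ ÷' (ℕ→ℚ q ^ℚ (2 ℕ.* m)))} {oneMinus (q⁻ (2 ℕ.* m))} {shift (r ℕ.* m) (uPoch q m)} {shift (r ℕ.* m) (uPoch q m)}
       (λ j → cong (λ z → oneMinus z j) (trans (÷'-Q^ 1ℚ (2 ℕ.* m)) (*-identityˡ (q⁻ (2 ℕ.* m))))) (λ _ → refl) k)

  infiniteProduct-⊛-summand : ∀ r m n → (infiniteProduct ⊛ summand q r m) n ≡ summandCoeff r m * shift (r ℕ.* m) (summandSeries m) n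
  infiniteProduct-⊛-summand r m n = begin
      (infiniteProduct ⊛ summand q r m) n ≡⟨ ⊛-cong {infiniteProduct} {infiniteProduct} {summand q r m} {scale (summandCoeff r m) (A ⊛ shift s U)} (λ _ → refl) (summand≗scale r m) n ⟩
      (infiniteProduct ⊛ scale (summandCoeff r m) (A ⊛ shift s U)) n ≡⟨ ⊛-scale infiniteProduct (summandCoeff r m) (A ⊛ shift s U) n ⟩
      summandCoeff r m * (infiniteProduct ⊛ (A ⊛ shift s U)) n ≡⟨ cong (summandCoeff r m *_) (sym (⊛-assoc infiniteProduct A (shift s U) n)) ⟩
      summandCoeff r m * ((infiniteProduct ⊛ A) ⊛ shift s U) n ≡⟨ cong (summandCoeff r m *_) (⊛-cong {infiniteProduct ⊛ A} {A ⊛ infiniteProduct} {shift s U} {shift s U} (⊛-comm infiniteProduct A) (λ _ → refl) n) ⟩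
      summandCoeff r m * ((A ⊛ infiniteProduct) ⊛ shift s U) n ≡⟨ cong (summandCoeff r m *_) (⊛-assoc A infiniteProduct (shift s U) n) ⟩
      summandCoeff r m * (A ⊛ (infiniteProduct ⊛ shift s U)) n ≡⟨ cong (summandCoeff r m *_) (⊛-cong {A} {A} (λ _ → refl) (⊛-shift infiniteProduct s U) n) ⟩
      summandCoeff r m * (A ⊛ shift s (infiniteProduct ⊛ U)) n ≡⟨ cong (summandCoeff r m *_) (⊛-cong {A} {A} (λ _ → refl) (shift-cong s (infiniteProduct-⊛-uPoch m)) n) ⟩
      summandCoeff r m * (A ⊛ shift s (euler m)) n ≡⟨ cong (summandCoeff r m *_) (⊛-shift A s (euler m) n) ⟩
      summandCoeff r m * shift s (summandSeries m) n ∎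
    where
    open ≡-Reasoning
    A : Series
    A = oneMinus (q⁻ (2 ℕ.* m))
    s : ℕ
    s = r ℕ.* m
    U : Series
    U = uPoch q m

  infiniteProduct-⊛-sumPart : ∀ r M n → (infiniteProduct ⊛ sumPart q r M) n ≡ Σ< (suc M) (λ m → summandCoeff r m * shift (r ℕ.* m) (summandSeries m) n)
  infiniteProduct-⊛-sumPart r M n = begin
      (infiniteProduct ⊛ sumS (map (summand q r) (upTo (suc M)))) n ≡⟨ ⊛-sumS infiniteProduct (map (summand q r) (upTo (suc M))) n ⟩
      sumS (map (infiniteProduct ⊛_) (map (summand q r) (upTo (suc M)))) n ≡⟨ cong (λ L → sumS L n) (sym (LP.map-∘ {g = infiniteProduct ⊛_} {f = summand q r} (upTo (suc M)))) ⟩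
      sumS (map ((infiniteProduct ⊛_) ∘ summand q r) (upTo (suc M))) n ≡⟨ sumS-applyUpTo (suc M) ((infiniteProduct ⊛_) ∘ summand q r) (λ x → x) n ⟩
      Σ< (suc M) (λ m → (infiniteProduct ⊛ summand q r m) n) ≡⟨ sum-cong (suc M) (λ m → infiniteProduct-⊛-summand r m n) ⟩
      Σ< (suc M) (λ m → summandCoeff r m * shift (r ℕ.* m) (summandSeries m) n) ∎
    where open ≡-Reasoning

  -- The q-binomial theorem

  qBinom : ℕ → ℕ → ℚ
  qBinom p l = qPoch p * qPoch⁻¹ (p ∸ l) * qPoch⁻¹ l

  gaussCoeff : ℕ → ℚ
  gaussCoeff l = sgn l * q⁻ (tri l)

  gaussCoeff-suc : ∀ l → gaussCoeff (suc l) ≡ - (q⁻ l * gaussCoeff l)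
  gaussCoeff-suc l = begin
      (- 1ℚ) * sgn l * q⁻ (tri l ℕ.+ l) ≡⟨ cong ((- 1ℚ) * sgn l *_) (q⁻-+ (tri l) l) ⟩
      (- 1ℚ) * sgn l * (q⁻ (tri l) * q⁻ l) ≡⟨ lem (sgn l) (q⁻ (tri l)) (q⁻ l) ⟩
      - (q⁻ l * (sgn l * q⁻ (tri l))) ∎
    where
    open ≡-Reasoning
    lem : ∀ s x y → (- 1ℚ) * s * (x * y) ≡ - (y * (s * x))
    lem = solve-∀ ℚ-ring

  qBinom-0 : ∀ p → qBinom p 0 ≡ 1ℚ
  qBinom-0 p = trans (*-identityʳ _) (qPoch*qPoch⁻¹ p)

  qBinom-diag : ∀ p → qBinom p p ≡ 1ℚ
  qBinom-diag p = trans (cong (λ z → qPoch p * qPoch⁻¹ z * qPoch⁻¹ p) (ℕP.n∸n≡0 p)) (trans (cong (_* qPoch⁻¹ p) (*-identityʳ (qPoch p))) (qPoch*qPoch⁻¹ p))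

  qBinom-pascal-+ : ∀ l d → qBinom (suc (l ℕ.+ suc d)) (suc l) ≡ qBinom (l ℕ.+ suc d) (suc l) + q⁻ (suc d) * qBinom (l ℕ.+ suc d) l
  qBinom-pascal-+ l d = begin
      qPoch (suc p) * qPoch⁻¹ (suc p ∸ suc l) * qPoch⁻¹ (suc l) ≡⟨ cong (λ z → qPoch (suc p) * qPoch⁻¹ z * qPoch⁻¹ (suc l)) e1 ⟩
      qPoch p * (1ℚ - q⁻ (suc p)) * qPoch⁻¹ (suc d) * qPoch⁻¹ (suc l) ≡⟨ cong (λ z → qPoch p * (1ℚ - z) * qPoch⁻¹ (suc d) * qPoch⁻¹ (suc l)) e4 ⟩
      qPoch p * (1ℚ - q⁻ (suc d) * q⁻ (suc l)) * qPoch⁻¹ (suc d) * qPoch⁻¹ (suc l) ≡⟨ lem (qPoch p) (q⁻ (suc d)) (q⁻ (suc l)) (qPoch⁻¹ (suc d)) (qPoch⁻¹ (suc l)) ⟩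
      qPoch p * (qPoch⁻¹ (suc d) * (1ℚ - q⁻ (suc d))) * qPoch⁻¹ (suc l) + q⁻ (suc d) * (qPoch p * qPoch⁻¹ (suc d) * (qPoch⁻¹ (suc l) * (1ℚ - q⁻ (suc l)))) ≡⟨ cong₂ (λ x y → qPoch p * x * qPoch⁻¹ (suc l) + q⁻ (suc d) * (qPoch p * qPoch⁻¹ (suc d) * y)) (sym (qPoch⁻¹-suc d)) (sym (qPoch⁻¹-suc l)) ⟩
      qPoch p * qPoch⁻¹ d * qPoch⁻¹ (suc l) + q⁻ (suc d) * (qPoch p * qPoch⁻¹ (suc d) * qPoch⁻¹ l) ≡⟨ cong₂ (λ x y → qPoch p * qPoch⁻¹ x * qPoch⁻¹ (suc l) + q⁻ (suc d) * (qPoch p * qPoch⁻¹ y * qPoch⁻¹ l)) (sym e2) (sym e3) ⟩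
      qBinom p (suc l) + q⁻ (suc d) * qBinom p l ∎
    where
    open ≡-Reasoning
    p : ℕ
    p = l ℕ.+ suc d
    e1 : suc p ∸ suc l ≡ suc d
    e1 = ℕP.m+n∸m≡n l (suc d)
    e2 : p ∸ suc l ≡ d
    e2 = trans (cong (_∸ suc l) (ℕP.+-suc l d)) (ℕP.m+n∸m≡n l d)
    e3 : p ∸ l ≡ suc d
    e3 = ℕP.m+n∸m≡n l (suc d)
    e4 : q⁻ (suc p) ≡ q⁻ (suc d) * q⁻ (suc l)
    e4 = trans (cong q⁻ (trans (cong suc (ℕP.+-comm l (suc d))) (sym (ℕP.+-suc (suc d) l)))) (q⁻-+ (suc d) (suc l))
    lem : ∀ Pp A B I J → Pp * (1ℚ - A * B) * I * J ≡ Pp * (I * (1ℚ - A)) * J + A * (Pp * I * (J * (1ℚ - B)))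
    lem = solve-∀ ℚ-ring

  qBinom-pascal : ∀ p l → l ℕ.< p → qBinom (suc p) (suc l) ≡ qBinom p (suc l) + q⁻ (p ∸ l) * qBinom p l
  qBinom-pascal p l l<p = subst (λ p → qBinom (suc p) (suc l) ≡ qBinom p (suc l) + q⁻ (p ∸ l) * qBinom p l) pe
    (subst (λ z → qBinom (suc (l ℕ.+ suc d)) (suc l) ≡ qBinom (l ℕ.+ suc d) (suc l) + q⁻ z * qBinom (l ℕ.+ suc d) l) (sym (ℕP.m+n∸m≡n l (suc d))) (qBinom-pascal-+ l d))
    where
    d : ℕ
    d = p ∸ suc l
    pe : l ℕ.+ suc d ≡ p
    pe = trans (ℕP.+-suc l d) (ℕP.m+[n∸m]≡n l<p)

  gaussTerm : ℕ → ℚ → ℕ → ℚ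
  gaussTerm p x l = gaussCoeff l * qBinom p l * x ^ℚ (p ∸ l)

  gaussSum : ℕ → ℚ → ℚ
  gaussSum p x = Σ< (suc p) (gaussTerm p x)

  gaussProd : ℕ → ℚ → ℚ
  gaussProd p x = Π< p (λ j → x - q⁻ j)

  gaussTerm-suc-0 : ∀ p x → gaussTerm (suc p) x 0 ≡ x * gaussTerm p x 0
  gaussTerm-suc-0 p x = trans (cong (λ z → gaussCoeff 0 * z * x ^ℚ (suc p)) (trans (qBinom-0 (suc p)) (sym (qBinom-0 p))))
                              (lem (gaussCoeff 0 * qBinom p 0) x (x ^ℚ p))
    where lem : ∀ u v w → u * (v * w) ≡ v * (u * w)
          lem = solve-∀ ℚ-ring

  gaussTerm-suc-last : ∀ p x → gaussTerm (suc p) x (suc p) ≡ - (q⁻ p * gaussTerm p x p)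
  gaussTerm-suc-last p x = trans (cong₂ (λ u v → u * v * x ^ℚ (p ∸ p)) (gaussCoeff-suc p) (trans (qBinom-diag (suc p)) (sym (qBinom-diag p))))
                                 (lem (q⁻ p) (gaussCoeff p) (qBinom p p) (x ^ℚ (p ∸ p)))
    where lem : ∀ u v w z → - (u * v) * w * z ≡ - (u * (v * w * z))
          lem = solve-∀ ℚ-ring

  gaussTerm-suc : ∀ p x l → l ℕ.< p → gaussTerm (suc p) x (suc l) ≡ x * gaussTerm p x (suc l) - q⁻ p * gaussTerm p x l
  gaussTerm-suc p x l l<p = begin
      gaussCoeff (suc l) * qBinom (suc p) (suc l) * x ^ℚ (p ∸ l)
        ≡⟨ cong₂ (λ c b → c * b * x ^ℚ (p ∸ l)) (gaussCoeff-suc l) (qBinom-pascal p l l<p) ⟩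
      - (q⁻ l * a) * (B′ + q⁻ (p ∸ l) * B) * x ^ℚ (p ∸ l)
        ≡⟨ cong (λ z → - (q⁻ l * a) * (B′ + q⁻ (p ∸ l) * B) * z) (sym x*y≡x^[p∸l]) ⟩
      - (q⁻ l * a) * (B′ + q⁻ (p ∸ l) * B) * (x * y)
        ≡⟨ expand (q⁻ l) (q⁻ (p ∸ l)) a B′ B x y ⟩
      x * (- (q⁻ l * a) * B′ * y) - q⁻ l * q⁻ (p ∸ l) * (a * B * (x * y))
        ≡⟨ cong₂ (λ c z → x * (c * B′ * y) - z * (a * B * (x * y))) (sym (gaussCoeff-suc l)) q⁻-split ⟩
      x * (gaussCoeff (suc l) * B′ * y) - q⁻ p * (a * B * (x * y))
        ≡⟨ cong (λ z → x * (gaussCoeff (suc l) * B′ * y) - q⁻ p * (a * B * z)) x*y≡x^[p∸l] ⟩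
      x * gaussTerm p x (suc l) - q⁻ p * gaussTerm p x l ∎
    where
    open ≡-Reasoning
    a : ℚ
    a = gaussCoeff l
    B : ℚ
    B = qBinom p l
    B′ : ℚ
    B′ = qBinom p (suc l)
    y : ℚ
    y = x ^ℚ (p ∸ suc l)
    x*y≡x^[p∸l] : x * y ≡ x ^ℚ (p ∸ l)
    x*y≡x^[p∸l] = cong (x ^ℚ_) (sym (ℕP.+-∸-assoc 1 l<p))
    q⁻-split : q⁻ l * q⁻ (p ∸ l) ≡ q⁻ p
    q⁻-split = trans (sym (q⁻-+ l (p ∸ l))) (cong q⁻ (ℕP.m+[n∸m]≡n (ℕP.<⇒≤ l<p)))
    expand : ∀ A D a B′ B x y → - (A * a) * (B′ + D * B) * (x * y) ≡ x * (- (A * a) * B′ * y) - A * D * (a * B * (x * y))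
    expand = solve-∀ ℚ-ring

  gaussSum-suc : ∀ p x → gaussSum (suc p) x ≡ (x - q⁻ p) * gaussSum p x
  gaussSum-suc p x = begin
      gaussSum (suc p) x
        ≡⟨ sum-sucˡ (suc p) (gaussTerm (suc p) x) ⟩
      gaussTerm (suc p) x 0 + (Σ< p (λ l → gaussTerm (suc p) x (suc l)) + gaussTerm (suc p) x (suc p))
        ≡⟨ cong₂ _+_ (gaussTerm-suc-0 p x) (cong₂ _+_ (trans (sum-cong-< p (gaussTerm-suc p x)) (sum-- p _ _)) (gaussTerm-suc-last p x)) ⟩
      x * t 0 + ((Σ< p (λ l → x * t (suc l)) - Σ< p (λ l → q⁻ p * t l)) + - (q⁻ p * t p))
        ≡⟨ cong₂ (λ u v → x * t 0 + ((u - v) + - (q⁻ p * t p))) (sym (sum-*ˡ p x (t ∘ suc))) (sym (sum-*ˡ p (q⁻ p) t)) ⟩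
      x * t 0 + ((x * Σ< p (t ∘ suc) - q⁻ p * Σ< p t) + - (q⁻ p * t p))
        ≡⟨ regroup x (q⁻ p) (t 0) (Σ< p (t ∘ suc)) (Σ< p t) (t p) ⟩
      x * (t 0 + Σ< p (t ∘ suc)) - q⁻ p * gaussSum p x
        ≡⟨ cong (λ u → x * u - q⁻ p * gaussSum p x) (sym (sum-sucˡ p t)) ⟩
      x * gaussSum p x - q⁻ p * gaussSum p x
        ≡⟨ factor x (q⁻ p) (gaussSum p x) ⟩
      (x - q⁻ p) * gaussSum p x ∎
    where
    open ≡-Reasoning
    t : ℕ → ℚ
    t = gaussTerm p x
    regroup : ∀ x y A X Y B → x * A + ((x * X - y * Y) + - (y * B)) ≡ x * (A + X) - y * (Y + B)
    regroup = solve-∀ ℚ-ring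
    factor : ∀ x y G → x * G - y * G ≡ (x - y) * G
    factor = solve-∀ ℚ-ring

  q-binomial-theorem : ∀ p x → gaussSum p x ≡ gaussProd p x
  q-binomial-theorem zero x = trans (+-identityˡ _) (trans (*-identityʳ _) (trans (cong (_* qBinom 0 0) (*-identityˡ 1ℚ)) (trans (*-identityˡ _) (qBinom-0 0))))
  q-binomial-theorem (suc p) x = trans (gaussSum-suc p x) (trans (cong ((x - q⁻ p) *_) (q-binomial-theorem p x)) (*-comm (x - q⁻ p) (gaussProd p x)))

  gaussProd-vanishes : ∀ p i → i ℕ.< p → gaussProd p (q⁻ i) ≡ 0ℚ
  gaussProd-vanishes p i i<p = prod-zero p (λ j → q⁻ i - q⁻ j) i i<p (+-inverseʳ (q⁻ i))

  gaussProd-q⁻ : ∀ p i → p ℕ.≤ i → gaussProd p (q⁻ i) ≡ sgn p * q⁻ (tri p) * qPoch i * qPoch⁻¹ (i ∸ p)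
  gaussProd-q⁻ zero i _ = sym (trans (cong (_* qPoch⁻¹ i) (trans (cong (_* qPoch i) (*-identityˡ 1ℚ)) (*-identityˡ (qPoch i)))) (qPoch*qPoch⁻¹ i))
  gaussProd-q⁻ (suc p) i p<i = begin
      gaussProd p (q⁻ i) * (q⁻ i - q⁻ p) ≡⟨ cong (_* (q⁻ i - q⁻ p)) (gaussProd-q⁻ p i (ℕP.<⇒≤ p<i)) ⟩
      sgn p * q⁻ (tri p) * qPoch i * qPoch⁻¹ (i ∸ p) * (q⁻ i - q⁻ p) ≡⟨ cong₂ (λ u v → sgn p * q⁻ (tri p) * qPoch i * qPoch⁻¹ u * (v - q⁻ p)) e1 e2 ⟩
      sgn p * q⁻ (tri p) * qPoch i * qPoch⁻¹ (suc d) * (q⁻ p * q⁻ (suc d) - q⁻ p) ≡⟨ lem (sgn p) (q⁻ (tri p)) (qPoch i) (qPoch⁻¹ (suc d)) (q⁻ p) (q⁻ (suc d)) ⟩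
      (- 1ℚ) * sgn p * (q⁻ (tri p) * q⁻ p) * qPoch i * (qPoch⁻¹ (suc d) * (1ℚ - q⁻ (suc d))) ≡⟨ cong₂ (λ u v → (- 1ℚ) * sgn p * u * qPoch i * v) (sym (q⁻-+ (tri p) p)) (sym (qPoch⁻¹-suc d)) ⟩
      sgn (suc p) * q⁻ (tri (suc p)) * qPoch i * qPoch⁻¹ (i ∸ suc p) ∎
    where
    open ≡-Reasoning
    d : ℕ
    d = i ∸ suc p
    ie : p ℕ.+ suc d ≡ i
    ie = trans (ℕP.+-suc p d) (ℕP.m+[n∸m]≡n p<i)
    e1 : i ∸ p ≡ suc d
    e1 = trans (cong (_∸ p) (sym ie)) (ℕP.m+n∸m≡n p (suc d))
    e2 : q⁻ i ≡ q⁻ p * q⁻ (suc d)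
    e2 = trans (cong q⁻ (sym ie)) (q⁻-+ p (suc d))
    lem : ∀ s A R I B C → s * A * R * I * (B * C - B) ≡ (- 1ℚ) * s * (A * B) * R * (I * (1ℚ - C))
    lem = solve-∀ ℚ-ring

  euler-coeff≡gaussTerm : ∀ p i l → gaussCoeff l * (qPoch⁻¹ (p ∸ l) * qPoch⁻¹ l) * euler (p ℕ.+ (p ∸ l)) i
                                    ≡ (q⁻ (p ℕ.* i) * qPoch⁻¹ i * qPoch⁻¹ p) * gaussTerm p (q⁻ i) l
  euler-coeff≡gaussTerm p i l = begin
      gaussCoeff l * (qPoch⁻¹ (p ∸ l) * qPoch⁻¹ l) * (q⁻ ((p ℕ.+ (p ∸ l)) ℕ.* i) * qPoch⁻¹ i)
        ≡⟨ cong (λ z → gaussCoeff l * (qPoch⁻¹ (p ∸ l) * qPoch⁻¹ l) * (q⁻ z * qPoch⁻¹ i)) (ℕP.*-distribʳ-+ i p (p ∸ l)) ⟩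
      gaussCoeff l * (qPoch⁻¹ (p ∸ l) * qPoch⁻¹ l) * (q⁻ (p ℕ.* i ℕ.+ (p ∸ l) ℕ.* i) * qPoch⁻¹ i)
        ≡⟨ cong (λ z → gaussCoeff l * (qPoch⁻¹ (p ∸ l) * qPoch⁻¹ l) * (z * qPoch⁻¹ i)) (trans (q⁻-+ (p ℕ.* i) ((p ∸ l) ℕ.* i)) (cong (q⁻ (p ℕ.* i) *_) (q⁻-* (p ∸ l) i))) ⟩
      gaussCoeff l * (qPoch⁻¹ (p ∸ l) * qPoch⁻¹ l) * (q⁻ (p ℕ.* i) * q⁻ i ^ℚ (p ∸ l) * qPoch⁻¹ i)
        ≡⟨ cong (λ z → gaussCoeff l * z * (q⁻ (p ℕ.* i) * q⁻ i ^ℚ (p ∸ l) * qPoch⁻¹ i)) (sym (*-identityˡ (qPoch⁻¹ (p ∸ l) * qPoch⁻¹ l))) ⟩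
      gaussCoeff l * (1ℚ * (qPoch⁻¹ (p ∸ l) * qPoch⁻¹ l)) * (q⁻ (p ℕ.* i) * q⁻ i ^ℚ (p ∸ l) * qPoch⁻¹ i)
        ≡⟨ cong (λ z → gaussCoeff l * (z * (qPoch⁻¹ (p ∸ l) * qPoch⁻¹ l)) * (q⁻ (p ℕ.* i) * q⁻ i ^ℚ (p ∸ l) * qPoch⁻¹ i)) (sym (trans (*-comm (qPoch⁻¹ p) (qPoch p)) (qPoch*qPoch⁻¹ p))) ⟩
      gaussCoeff l * (qPoch⁻¹ p * qPoch p * (qPoch⁻¹ (p ∸ l) * qPoch⁻¹ l)) * (q⁻ (p ℕ.* i) * q⁻ i ^ℚ (p ∸ l) * qPoch⁻¹ i)
        ≡⟨ lem (gaussCoeff l) (qPoch⁻¹ p) (qPoch p) (qPoch⁻¹ (p ∸ l)) (qPoch⁻¹ l) (q⁻ (p ℕ.* i)) (q⁻ i ^ℚ (p ∸ l)) (qPoch⁻¹ i) ⟩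
      (q⁻ (p ℕ.* i) * qPoch⁻¹ i * qPoch⁻¹ p) * (gaussCoeff l * (qPoch p * qPoch⁻¹ (p ∸ l) * qPoch⁻¹ l) * q⁻ i ^ℚ (p ∸ l)) ∎
    where
    open ≡-Reasoning
    lem : ∀ A J Pp K L Tp X I → A * (J * Pp * (K * L)) * (Tp * X * I) ≡ (Tp * I * J) * (A * (Pp * K * L) * X)
    lem = solve-∀ ℚ-ring

  gaussProd-q⁻-euler : ∀ p i → q⁻ (p ℕ.* i) * qPoch⁻¹ i * qPoch⁻¹ p * gaussProd p (q⁻ i)
                              ≡ gaussCoeff p * q⁻ (p ℕ.* p) * qPoch⁻¹ p * shift p (euler p) i
  gaussProd-q⁻-euler p i = by-cases (p ℕ.≤? i)
    where
    open ≡-Reasoning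
    by-cases : Dec (p ℕ.≤ i) → q⁻ (p ℕ.* i) * qPoch⁻¹ i * qPoch⁻¹ p * gaussProd p (q⁻ i) ≡ gaussCoeff p * q⁻ (p ℕ.* p) * qPoch⁻¹ p * shift p (euler p) i
    by-cases (yes p≤i) = begin
        q⁻ (p ℕ.* i) * qPoch⁻¹ i * qPoch⁻¹ p * gaussProd p (q⁻ i) ≡⟨ cong (q⁻ (p ℕ.* i) * qPoch⁻¹ i * qPoch⁻¹ p *_) (gaussProd-q⁻ p i p≤i) ⟩
        q⁻ (p ℕ.* i) * qPoch⁻¹ i * qPoch⁻¹ p * (sgn p * q⁻ (tri p) * qPoch i * qPoch⁻¹ (i ∸ p)) ≡⟨ cong (λ z → z * qPoch⁻¹ i * qPoch⁻¹ p * (sgn p * q⁻ (tri p) * qPoch i * qPoch⁻¹ (i ∸ p))) ei ⟩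
        q⁻ (p ℕ.* p) * q⁻ (p ℕ.* (i ∸ p)) * qPoch⁻¹ i * qPoch⁻¹ p * (sgn p * q⁻ (tri p) * qPoch i * qPoch⁻¹ (i ∸ p)) ≡⟨ lem (q⁻ (p ℕ.* p)) (q⁻ (p ℕ.* (i ∸ p))) (qPoch⁻¹ i) (qPoch⁻¹ p) (sgn p) (q⁻ (tri p)) (qPoch i) (qPoch⁻¹ (i ∸ p)) ⟩
        sgn p * q⁻ (tri p) * q⁻ (p ℕ.* p) * qPoch⁻¹ p * (q⁻ (p ℕ.* (i ∸ p)) * qPoch⁻¹ (i ∸ p)) * (qPoch i * qPoch⁻¹ i) ≡⟨ cong (sgn p * q⁻ (tri p) * q⁻ (p ℕ.* p) * qPoch⁻¹ p * (q⁻ (p ℕ.* (i ∸ p)) * qPoch⁻¹ (i ∸ p)) *_) (qPoch*qPoch⁻¹ i) ⟩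
        sgn p * q⁻ (tri p) * q⁻ (p ℕ.* p) * qPoch⁻¹ p * (q⁻ (p ℕ.* (i ∸ p)) * qPoch⁻¹ (i ∸ p)) * 1ℚ ≡⟨ trans (*-identityʳ _) (cong (sgn p * q⁻ (tri p) * q⁻ (p ℕ.* p) * qPoch⁻¹ p *_) (sym (shift-≥ p (euler p) i p≤i))) ⟩
        gaussCoeff p * q⁻ (p ℕ.* p) * qPoch⁻¹ p * shift p (euler p) i ∎
      where
      ei : q⁻ (p ℕ.* i) ≡ q⁻ (p ℕ.* p) * q⁻ (p ℕ.* (i ∸ p))
      ei = trans (cong q⁻ (trans (cong (p ℕ.*_) (sym (ℕP.m+[n∸m]≡n p≤i))) (ℕP.*-distribˡ-+ p p (i ∸ p)))) (q⁻-+ (p ℕ.* p) (p ℕ.* (i ∸ p)))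
      lem : ∀ A B I J s C R K → A * B * I * J * (s * C * R * K) ≡ s * C * A * J * (B * K) * (R * I)
      lem = solve-∀ ℚ-ring
    by-cases (no p≰i) = trans (cong (q⁻ (p ℕ.* i) * qPoch⁻¹ i * qPoch⁻¹ p *_) (gaussProd-vanishes p i (ℕP.≰⇒> p≰i)))
      (trans (*-zeroʳ (q⁻ (p ℕ.* i) * qPoch⁻¹ i * qPoch⁻¹ p)) (sym (trans (cong (gaussCoeff p * q⁻ (p ℕ.* p) * qPoch⁻¹ p *_) (shift-< p (euler p) i (ℕP.≰⇒> p≰i))) (*-zeroʳ (gaussCoeff p * q⁻ (p ℕ.* p) * qPoch⁻¹ p)))))

  -- Coefficientwise this is the q-binomial theorem at x = q⁻ i.
  gauss-euler : ∀ p i → Σ< (suc p) (λ l → gaussCoeff l * (qPoch⁻¹ (p ∸ l) * qPoch⁻¹ l) * euler (p ℕ.+ (p ∸ l)) i)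
               ≡ gaussCoeff p * q⁻ (p ℕ.* p) * qPoch⁻¹ p * shift p (euler p) i
  gauss-euler p i = begin
      Σ< (suc p) (λ l → gaussCoeff l * (qPoch⁻¹ (p ∸ l) * qPoch⁻¹ l) * euler (p ℕ.+ (p ∸ l)) i)
        ≡⟨ sum-cong (suc p) (euler-coeff≡gaussTerm p i) ⟩
      Σ< (suc p) (λ l → C * gaussTerm p (q⁻ i) l)
        ≡⟨ sym (sum-*ˡ (suc p) C (gaussTerm p (q⁻ i))) ⟩
      C * gaussSum p (q⁻ i)
        ≡⟨ cong (C *_) (q-binomial-theorem p (q⁻ i)) ⟩
      C * gaussProd p (q⁻ i)
        ≡⟨ gaussProd-q⁻-euler p i ⟩
      gaussCoeff p * q⁻ (p ℕ.* p) * qPoch⁻¹ p * shift p (euler p) i ∎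
    where
    open ≡-Reasoning
    C : ℚ
    C = q⁻ (p ℕ.* i) * qPoch⁻¹ i * qPoch⁻¹ p

  -- dilate s f is f(u/qˢ).
  dilate : ℕ → Series → Series
  dilate s f j = q⁻ (s ℕ.* j) * f j

  dilate-cong : ∀ a {f g} → f ≗ g → dilate a f ≗ dilate a g
  dilate-cong a fg j = cong (q⁻ (a ℕ.* j) *_) (fg j)

  dilate-⊛ : ∀ s f g → dilate s (f ⊛ g) ≗ dilate s f ⊛ dilate s g
  dilate-⊛ s f g k = begin
      q⁻ (s ℕ.* k) * (f ⊛ g) k ≡⟨ cong (q⁻ (s ℕ.* k) *_) (⊛-coeff f g k) ⟩
      q⁻ (s ℕ.* k) * Σ< (suc k) (λ i → f i * g (k ∸ i)) ≡⟨ sum-*ˡ (suc k) (q⁻ (s ℕ.* k)) (λ i → f i * g (k ∸ i)) ⟩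
      Σ< (suc k) (λ i → q⁻ (s ℕ.* k) * (f i * g (k ∸ i))) ≡⟨ sum-cong-< (suc k) (λ i i< → step i (ℕP.≤-pred i<)) ⟩
      Σ< (suc k) (λ i → dilate s f i * dilate s g (k ∸ i)) ≡⟨ sym (⊛-coeff (dilate s f) (dilate s g) k) ⟩
      (dilate s f ⊛ dilate s g) k ∎
    where
    open ≡-Reasoning
    lem : ∀ A B x y → (A * B) * (x * y) ≡ A * x * (B * y)
    lem = solve-∀ ℚ-ring
    step : ∀ i → i ℕ.≤ k → q⁻ (s ℕ.* k) * (f i * g (k ∸ i)) ≡ q⁻ (s ℕ.* i) * f i * (q⁻ (s ℕ.* (k ∸ i)) * g (k ∸ i))
    step i i≤k = trans (cong (_* (f i * g (k ∸ i))) (trans (cong (λ z → q⁻ (s ℕ.* z)) (sym (ℕP.m+[n∸m]≡n i≤k))) (trans (cong q⁻ (ℕP.*-distribˡ-+ s i (k ∸ i))) (q⁻-+ (s ℕ.* i) (s ℕ.* (k ∸ i))))))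
                   (lem (q⁻ (s ℕ.* i)) (q⁻ (s ℕ.* (k ∸ i))) (f i) (g (k ∸ i)))

  dilate-oneMinus : ∀ s b → dilate s (oneMinus (q⁻ b)) ≗ oneMinus (q⁻ (b ℕ.+ s))
  dilate-oneMinus s b zero = trans (cong (λ z → q⁻ z * 1ℚ) (ℕP.*-zeroʳ s)) refl
  dilate-oneMinus s b (suc zero) = trans (cong (λ z → q⁻ z * (- q⁻ b)) (ℕP.*-identityʳ s)) (trans (sym (neg-distribʳ-* (q⁻ s) (q⁻ b))) (cong -_ (trans (*-comm (q⁻ s) (q⁻ b)) (sym (q⁻-+ b s)))))
  dilate-oneMinus s b (suc (suc j)) = *-zeroʳ (q⁻ (s ℕ.* suc (suc j)))

  dilate-euler : ∀ s a' → dilate s (euler a') ≗ euler (a' ℕ.+ s)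
  dilate-euler s a' j = trans (sym (*-assoc (q⁻ (s ℕ.* j)) (q⁻ (a' ℕ.* j)) (qPoch⁻¹ j))) (cong (_* qPoch⁻¹ j) (trans (sym (q⁻-+ (s ℕ.* j) (a' ℕ.* j))) (cong q⁻ (trans (sym (ℕP.*-distribʳ-+ j s a')) (cong (ℕ._* j) (ℕP.+-comm s a'))))))

  twistedEuler : ℕ → ℕ → Series
  twistedEuler b a' = oneMinus (q⁻ b) ⊛ euler a'

  twistedEuler-dilate : ∀ s b a' j → q⁻ (s ℕ.* j) * twistedEuler b a' j ≡ twistedEuler (b ℕ.+ s) (a' ℕ.+ s) j
  twistedEuler-dilate s b a' j = trans (dilate-⊛ s (oneMinus (q⁻ b)) (euler a') j) (⊛-cong {dilate s (oneMinus (q⁻ b))} {oneMinus (q⁻ (b ℕ.+ s))} {dilate s (euler a')} {euler (a' ℕ.+ s)} (dilate-oneMinus s b) (dilate-euler s a') j)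

  gauss-twistedEuler : ∀ p i → Σ< (suc p) (λ l → (gaussCoeff l * (qPoch⁻¹ (p ∸ l) * qPoch⁻¹ l)) * twistedEuler (2 ℕ.* p) (p ℕ.+ (p ∸ l)) i)
               ≡ gaussCoeff p * q⁻ (p ℕ.* p) * qPoch⁻¹ p * shift p (summandSeries p) i
  gauss-twistedEuler p i = begin
      Σ< (suc p) (λ l → (gaussCoeff l * (qPoch⁻¹ (p ∸ l) * qPoch⁻¹ l)) * (g ⊛ euler (p ℕ.+ (p ∸ l))) i)
        ≡⟨ ⊛-linear (suc p) (λ l → gaussCoeff l * (qPoch⁻¹ (p ∸ l) * qPoch⁻¹ l)) g (λ l → euler (p ℕ.+ (p ∸ l))) i ⟩
      (g ⊛ (λ j → Σ< (suc p) (λ l → gaussCoeff l * (qPoch⁻¹ (p ∸ l) * qPoch⁻¹ l) * euler (p ℕ.+ (p ∸ l)) j))) i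
        ≡⟨ ⊛-cong {g} {g} {λ j → Σ< (suc p) (λ l → gaussCoeff l * (qPoch⁻¹ (p ∸ l) * qPoch⁻¹ l) * euler (p ℕ.+ (p ∸ l)) j)} {scale C (shift p (euler p))} (λ _ → refl) (gauss-euler p) i ⟩
      (g ⊛ scale C (shift p (euler p))) i ≡⟨ ⊛-scale g C (shift p (euler p)) i ⟩
      C * (g ⊛ shift p (euler p)) i ≡⟨ cong (C *_) (⊛-shift g p (euler p) i) ⟩
      C * shift p (summandSeries p) i ∎
    where
    open ≡-Reasoning
    g : Series
    g = oneMinus (q⁻ (2 ℕ.* p))
    C : ℚ
    C = gaussCoeff p * q⁻ (p ℕ.* p) * qPoch⁻¹ p

  -- The recursion in r

  -- The coefficient of uⁿ in the series of the statement (see infiniteProduct-⊛-sumPart).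
  seriesCoeff : ℕ → ℕ → ℚ
  seriesCoeff r n = Σ< (suc n) (λ m → summandCoeff r m * shift (r ℕ.* m) (summandSeries m) n)

  -- For r = 1 the summands telescope: c m · summandSeries m = α m + β m, while multiplying the
  -- coefficient of u^(j+1) by q⁻ (m + j + 1) turns it into β m (j + 1) + α (m + 1) j.  Hence
  -- q⁻ n · Φ n = Φ n, which forces Φ n = 0 for n > 0.
  module SeriesCoeffOne where
    open ≡-Reasoning
    open +-*-Solver using (solve; _:+_; _:*_; _:=_; con)

    c : ℕ → ℚ
    c m = summandCoeff 1 m

    α : ℕ → ℕ → ℚ
    α m j = c m * (1ℚ - q⁻ m) * euler m j

    β : ℕ → ℕ → ℚ
    β m j = c m * q⁻ m * euler (suc m) j

    euler-suc-0 : ∀ m → euler (suc m) 0 ≡ euler m 0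
    euler-suc-0 m = cong (λ z → q⁻ z * qPoch⁻¹ 0) (trans (ℕP.*-zeroʳ (suc m)) (sym (ℕP.*-zeroʳ m)))

    euler-suc : ∀ m j → euler (suc m) (suc j) ≡ euler m (suc j) - q⁻ m * euler m j
    euler-suc m j = trans (sym (euler-step m (suc j))) (trans (⊛-comm (euler m) (oneMinus (q⁻ m)) (suc j)) (oneMinus-⊛-suc (q⁻ m) (euler m) j))

    q⁻-2* : ∀ m → q⁻ (2 ℕ.* m) ≡ q⁻ m * q⁻ m
    q⁻-2* m = trans (cong q⁻ (cong (m ℕ.+_) (ℕP.+-identityʳ m))) (q⁻-+ m m)

    split-0 : ∀ m → c m * summandSeries m 0 ≡ α m 0 + β m 0
    split-0 m = begin
        c m * summandSeries m 0 ≡⟨ cong (c m *_) (oneMinus-⊛-zero (q⁻ (2 ℕ.* m)) (euler m)) ⟩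
        c m * euler m 0 ≡⟨ lem (c m) (q⁻ m) (euler m 0) ⟩
        c m * (1ℚ - q⁻ m) * euler m 0 + c m * q⁻ m * euler m 0 ≡⟨ cong (λ z → c m * (1ℚ - q⁻ m) * euler m 0 + c m * q⁻ m * z) (sym (euler-suc-0 m)) ⟩
        α m 0 + β m 0 ∎
      where lem : ∀ C A X → C * X ≡ C * (1ℚ - A) * X + C * A * X
            lem = solve-∀ ℚ-ring

    split-suc : ∀ m j → c m * summandSeries m (suc j) ≡ α m (suc j) + β m (suc j)
    split-suc m j = begin
        c m * summandSeries m (suc j) ≡⟨ cong (c m *_) (oneMinus-⊛-suc (q⁻ (2 ℕ.* m)) (euler m) j) ⟩
        c m * (euler m (suc j) - q⁻ (2 ℕ.* m) * euler m j) ≡⟨ cong (λ z → c m * (euler m (suc j) - z * euler m j)) (q⁻-2* m) ⟩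
        c m * (euler m (suc j) - q⁻ m * q⁻ m * euler m j) ≡⟨ lem (c m) (q⁻ m) (euler m (suc j)) (euler m j) ⟩
        c m * (1ℚ - q⁻ m) * euler m (suc j) + c m * q⁻ m * (euler m (suc j) - q⁻ m * euler m j) ≡⟨ cong (λ z → c m * (1ℚ - q⁻ m) * euler m (suc j) + c m * q⁻ m * z) (sym (euler-suc m j)) ⟩
        α m (suc j) + β m (suc j) ∎
      where lem : ∀ C A X Y → C * (X - A * A * Y) ≡ C * (1ℚ - A) * X + C * A * (X - A * Y)
            lem = solve-∀ ℚ-ring

    split : ∀ m j → c m * summandSeries m j ≡ α m j + β m j
    split m zero = split-0 m
    split m (suc j) = split-suc m j

    q⁻*euler : ∀ m j → q⁻ (m ℕ.+ j) * euler m j ≡ q⁻ m * euler (suc m) j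
    q⁻*euler m j = begin
        q⁻ (m ℕ.+ j) * (q⁻ (m ℕ.* j) * qPoch⁻¹ j) ≡⟨ cong (_* (q⁻ (m ℕ.* j) * qPoch⁻¹ j)) (q⁻-+ m j) ⟩
        q⁻ m * q⁻ j * (q⁻ (m ℕ.* j) * qPoch⁻¹ j) ≡⟨ lem (q⁻ m) (q⁻ j) (q⁻ (m ℕ.* j)) (qPoch⁻¹ j) ⟩
        q⁻ m * (q⁻ j * q⁻ (m ℕ.* j) * qPoch⁻¹ j) ≡⟨ cong (λ z → q⁻ m * (z * qPoch⁻¹ j)) (sym (q⁻-+ j (m ℕ.* j))) ⟩
        q⁻ m * euler (suc m) j ∎
      where lem : ∀ a b c d → a * b * (c * d) ≡ a * (b * c * d)
            lem = solve-∀ ℚ-ring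

    c-suc : ∀ m → c (suc m) * (1ℚ - q⁻ (suc m)) ≡ - (c m * q⁻ (3 ℕ.* m ℕ.+ 1))
    c-suc m = begin
        (- 1ℚ) * sgn m * (q⁻ (1 ℕ.* suc m ℕ.* suc m ℕ.+ (tri m ℕ.+ m)) * qPoch⁻¹ (suc m)) * (1ℚ - q⁻ (suc m))
          ≡⟨ cong (λ z → (- 1ℚ) * sgn m * (q⁻ z * qPoch⁻¹ (suc m)) * (1ℚ - q⁻ (suc m))) e ⟩
        (- 1ℚ) * sgn m * (q⁻ ((1 ℕ.* m ℕ.* m ℕ.+ tri m) ℕ.+ (3 ℕ.* m ℕ.+ 1)) * qPoch⁻¹ (suc m)) * (1ℚ - q⁻ (suc m))
          ≡⟨ cong (λ z → (- 1ℚ) * sgn m * (z * qPoch⁻¹ (suc m)) * (1ℚ - q⁻ (suc m))) (q⁻-+ (1 ℕ.* m ℕ.* m ℕ.+ tri m) (3 ℕ.* m ℕ.+ 1)) ⟩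
        (- 1ℚ) * sgn m * (q⁻ (1 ℕ.* m ℕ.* m ℕ.+ tri m) * q⁻ (3 ℕ.* m ℕ.+ 1) * qPoch⁻¹ (suc m)) * (1ℚ - q⁻ (suc m))
          ≡⟨ lem (sgn m) (q⁻ (1 ℕ.* m ℕ.* m ℕ.+ tri m)) (q⁻ (3 ℕ.* m ℕ.+ 1)) (qPoch⁻¹ (suc m)) (1ℚ - q⁻ (suc m)) ⟩
        - (sgn m * (q⁻ (1 ℕ.* m ℕ.* m ℕ.+ tri m) * (qPoch⁻¹ (suc m) * (1ℚ - q⁻ (suc m)))) * q⁻ (3 ℕ.* m ℕ.+ 1))
          ≡⟨ cong (λ z → - (sgn m * (q⁻ (1 ℕ.* m ℕ.* m ℕ.+ tri m) * z) * q⁻ (3 ℕ.* m ℕ.+ 1))) (sym (qPoch⁻¹-suc m)) ⟩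
        - (c m * q⁻ (3 ℕ.* m ℕ.+ 1)) ∎
      where
      e : 1 ℕ.* suc m ℕ.* suc m ℕ.+ (tri m ℕ.+ m) ≡ (1 ℕ.* m ℕ.* m ℕ.+ tri m) ℕ.+ (3 ℕ.* m ℕ.+ 1)
      e = solve 2 (λ m t → con 1 :* (con 1 :+ m) :* (con 1 :+ m) :+ (t :+ m) := (con 1 :* m :* m :+ t) :+ (con 3 :* m :+ con 1)) refl m (tri m)
      lem : ∀ s A B I D → (- 1ℚ) * s * (A * B * I) * D ≡ - (s * (A * (I * D)) * B)
      lem = solve-∀ ℚ-ring

    q⁻*split-0 : ∀ m → q⁻ (m ℕ.+ 0) * (c m * summandSeries m 0) ≡ β m 0
    q⁻*split-0 m = begin
        q⁻ (m ℕ.+ 0) * (c m * summandSeries m 0) ≡⟨ cong (λ z → q⁻ (m ℕ.+ 0) * (c m * z)) (oneMinus-⊛-zero (q⁻ (2 ℕ.* m)) (euler m)) ⟩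
        q⁻ (m ℕ.+ 0) * (c m * euler m 0) ≡⟨ lem (q⁻ (m ℕ.+ 0)) (c m) (euler m 0) ⟩
        c m * (q⁻ (m ℕ.+ 0) * euler m 0) ≡⟨ cong (c m *_) (q⁻*euler m 0) ⟩
        c m * (q⁻ m * euler (suc m) 0) ≡⟨ sym (*-assoc (c m) (q⁻ m) _) ⟩
        β m 0 ∎
      where lem : ∀ a b c → a * (b * c) ≡ b * (a * c)
            lem = solve-∀ ℚ-ring

    q⁻*split-suc : ∀ m j → q⁻ (m ℕ.+ suc j) * (c m * summandSeries m (suc j)) ≡ β m (suc j) + α (suc m) j
    q⁻*split-suc m j = begin
        q⁻ (m ℕ.+ suc j) * (c m * summandSeries m (suc j)) ≡⟨ cong (λ z → q⁻ (m ℕ.+ suc j) * (c m * z)) (oneMinus-⊛-suc (q⁻ (2 ℕ.* m)) (euler m) j) ⟩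
        q⁻ (m ℕ.+ suc j) * (c m * (euler m (suc j) - q⁻ (2 ℕ.* m) * euler m j)) ≡⟨ lem (q⁻ (m ℕ.+ suc j)) (c m) (euler m (suc j)) (q⁻ (2 ℕ.* m)) (euler m j) ⟩
        c m * (q⁻ (m ℕ.+ suc j) * euler m (suc j)) - c m * (q⁻ (2 ℕ.* m) * (q⁻ (m ℕ.+ suc j) * euler m j)) ≡⟨ cong₂ (λ u v → c m * u - c m * (q⁻ (2 ℕ.* m) * v)) (q⁻*euler m (suc j)) e2 ⟩
        c m * (q⁻ m * euler (suc m) (suc j)) - c m * (q⁻ (2 ℕ.* m) * (q⁻ 1 * (q⁻ m * euler (suc m) j))) ≡⟨ cong (λ z → c m * (q⁻ m * euler (suc m) (suc j)) - c m * z) e3 ⟩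
        c m * (q⁻ m * euler (suc m) (suc j)) - c m * (q⁻ (3 ℕ.* m ℕ.+ 1) * euler (suc m) j) ≡⟨ lem2 (c m) (q⁻ m) (euler (suc m) (suc j)) (q⁻ (3 ℕ.* m ℕ.+ 1)) (euler (suc m) j) ⟩
        β m (suc j) + (- (c m * q⁻ (3 ℕ.* m ℕ.+ 1))) * euler (suc m) j ≡⟨ cong (λ z → β m (suc j) + z * euler (suc m) j) (sym (c-suc m)) ⟩
        β m (suc j) + α (suc m) j ∎
      where
      lem : ∀ A C X B Y → A * (C * (X - B * Y)) ≡ C * (A * X) - C * (B * (A * Y))
      lem = solve-∀ ℚ-ring
      lem2 : ∀ C A X B Y → C * (A * X) - C * (B * Y) ≡ C * A * X + (- (C * B)) * Y
      lem2 = solve-∀ ℚ-ring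
      e2 : q⁻ (m ℕ.+ suc j) * euler m j ≡ q⁻ 1 * (q⁻ m * euler (suc m) j)
      e2 = trans (cong (_* euler m j) (trans (cong q⁻ (ℕP.+-suc m j)) (q⁻-+ 1 (m ℕ.+ j)))) (trans (*-assoc (q⁻ 1) (q⁻ (m ℕ.+ j)) (euler m j)) (cong (q⁻ 1 *_) (q⁻*euler m j)))
      e3 : q⁻ (2 ℕ.* m) * (q⁻ 1 * (q⁻ m * euler (suc m) j)) ≡ q⁻ (3 ℕ.* m ℕ.+ 1) * euler (suc m) j
      e3 = begin
          q⁻ (2 ℕ.* m) * (q⁻ 1 * (q⁻ m * euler (suc m) j)) ≡⟨ l3 (q⁻ (2 ℕ.* m)) (q⁻ 1) (q⁻ m) (euler (suc m) j) ⟩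
          q⁻ (2 ℕ.* m) * q⁻ 1 * q⁻ m * euler (suc m) j ≡⟨ cong (λ z → z * q⁻ m * euler (suc m) j) (sym (q⁻-+ (2 ℕ.* m) 1)) ⟩
          q⁻ (2 ℕ.* m ℕ.+ 1) * q⁻ m * euler (suc m) j ≡⟨ cong (_* euler (suc m) j) (sym (q⁻-+ (2 ℕ.* m ℕ.+ 1) m)) ⟩
          q⁻ (2 ℕ.* m ℕ.+ 1 ℕ.+ m) * euler (suc m) j ≡⟨ cong (λ z → q⁻ z * euler (suc m) j) (solve 1 (λ m → con 2 :* m :+ con 1 :+ m := con 3 :* m :+ con 1) refl m) ⟩
          q⁻ (3 ℕ.* m ℕ.+ 1) * euler (suc m) j ∎
        where l3 : ∀ a b c d → a * (b * (c * d)) ≡ a * b * c * d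
              l3 = solve-∀ ℚ-ring

    Φ : ℕ → ℚ
    Φ n = Σ< (suc n) (λ m → c m * summandSeries m (n ∸ m))

    seriesCoeff≡Φ : ∀ n → seriesCoeff 1 n ≡ Φ n
    seriesCoeff≡Φ n = sum-cong-< (suc n) (λ m m< → cong (c m *_) (trans (shift-≥ (1 ℕ.* m) (summandSeries m) n (subst (ℕ._≤ n) (sym (ℕP.*-identityˡ m)) (ℕP.≤-pred m<))) (cong (λ z → summandSeries m (n ∸ z)) (ℕP.*-identityˡ m))))

    α-0 : ∀ n → α 0 n ≡ 0ℚ
    α-0 n = trans (cong (λ z → c 0 * z * euler 0 n) (+-inverseʳ 1ℚ)) (trans (cong (_* euler 0 n) (*-zeroʳ (c 0))) (*-zeroˡ (euler 0 n)))

    q⁻*Φ≡Φ : ∀ n → q⁻ n * Φ n ≡ Φ n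
    q⁻*Φ≡Φ n = begin
        q⁻ n * Φ n ≡⟨ sum-*ˡ (suc n) (q⁻ n) _ ⟩
        Σ< n (λ m → q⁻ n * (c m * summandSeries m (n ∸ m))) + q⁻ n * (c n * summandSeries n (n ∸ n))
          ≡⟨ cong₂ _+_ (trans (sum-cong-< n mid) (sum-+ n _ _)) last ⟩
        (Σ< n (λ m → β m (n ∸ m)) + Sα) + β n (n ∸ n) ≡⟨ lem (Σ< n (λ m → β m (n ∸ m))) Sα (β n (n ∸ n)) ⟩
        0ℚ + Sα + Σ< (suc n) (λ m → β m (n ∸ m)) ≡⟨ cong (λ z → z + Sα + Σ< (suc n) (λ m → β m (n ∸ m))) (sym (α-0 n)) ⟩
        α 0 n + Sα + Σ< (suc n) (λ m → β m (n ∸ m)) ≡⟨ cong (_+ Σ< (suc n) (λ m → β m (n ∸ m))) (sym (sum-sucˡ n (λ m → α m (n ∸ m)))) ⟩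
        Σ< (suc n) (λ m → α m (n ∸ m)) + Σ< (suc n) (λ m → β m (n ∸ m)) ≡⟨ sym (sum-+ (suc n) _ _) ⟩
        Σ< (suc n) (λ m → α m (n ∸ m) + β m (n ∸ m)) ≡⟨ sym (sum-cong (suc n) (λ m → split m (n ∸ m))) ⟩
        Φ n ∎
      where
      Sα : ℚ
      Sα = Σ< n (λ m → α (suc m) (n ∸ suc m))
      lem : ∀ x y z → x + y + z ≡ 0ℚ + y + (x + z)
      lem = solve-∀ ℚ-ring
      mid : ∀ m → m ℕ.< n → q⁻ n * (c m * summandSeries m (n ∸ m)) ≡ β m (n ∸ m) + α (suc m) (n ∸ suc m)
      mid m m<n = trans (cong₂ (λ u v → q⁻ u * (c m * summandSeries m v)) e1 e2) (trans (q⁻*split-suc m j) (cong (λ v → β m v + α (suc m) j) (sym e2)))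
        where
        j : ℕ
        j = n ∸ suc m
        e1 : n ≡ m ℕ.+ suc j
        e1 = sym (trans (ℕP.+-suc m j) (ℕP.m+[n∸m]≡n m<n))
        e2 : n ∸ m ≡ suc j
        e2 = ℕP.+-∸-assoc 1 m<n
      last : q⁻ n * (c n * summandSeries n (n ∸ n)) ≡ β n (n ∸ n)
      last = trans (cong₂ (λ u v → q⁻ u * (c n * summandSeries n v)) (sym (ℕP.+-identityʳ n)) (ℕP.n∸n≡0 n)) (trans (q⁻*split-0 n) (cong (β n) (sym (ℕP.n∸n≡0 n))))

    seriesCoeff-1-suc : ∀ n → seriesCoeff 1 (suc n) ≡ 0ℚ
    seriesCoeff-1-suc n = trans (seriesCoeff≡Φ (suc n)) (*-fixed⇒0 (Φ (suc n)) (q⁻ (suc n)) (<⇒≢ (q⁻-suc<1 n)) (q⁻*Φ≡Φ (suc n)))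

    seriesCoeff-1-0 : seriesCoeff 1 0 ≡ 1ℚ
    seriesCoeff-1-0 = begin
        0ℚ + summandCoeff 1 0 * shift 0 (summandSeries 0) 0 ≡⟨ +-identityˡ _ ⟩
        summandCoeff 1 0 * summandSeries 0 0 ≡⟨ cong (summandCoeff 1 0 *_) (oneMinus-⊛-zero (q⁻ 0) (euler 0)) ⟩
        (1ℚ * (1ℚ * qPoch⁻¹ 0)) * (1ℚ * qPoch⁻¹ 0) ≡⟨ cong (λ z → (1ℚ * (1ℚ * z)) * (1ℚ * z)) qPoch⁻¹-0 ⟩
        (1ℚ * (1ℚ * 1ℚ)) * (1ℚ * 1ℚ) ≡⟨ refl ⟩
        1ℚ ∎

  -- Adding m parts equal to k to a partition ν of n ∸ k m with parts < k multiplies its weight by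
  -- q^-(2 m |ν| + k m²) / (1/q)_m; the offset a counts parts equal to k split off earlier.
  multiplicityTerm : ℕ → (ℕ → ℚ) → ℕ → ℕ → ℕ → ℚ
  multiplicityTerm k Y n a m = qPoch⁻¹ (a ℕ.+ m) * shift (k ℕ.* m) (λ j → q⁻ (2 ℕ.* m ℕ.* j ℕ.+ k ℕ.* m ℕ.* m) * Y j) n

  multiplicitySum : ℕ → (ℕ → ℚ) → ℕ → ℕ → ℚ
  multiplicitySum k Y n a = Σ< (suc n) (multiplicityTerm k Y n a)

  multiplicityTerm-0 : ∀ k Y n a → multiplicityTerm k Y n a 0 ≡ Y n * qPoch⁻¹ a
  multiplicityTerm-0 k Y n a = begin
      qPoch⁻¹ (a ℕ.+ 0) * shift (k ℕ.* 0) (λ j → q⁻ (k ℕ.* 0 ℕ.* 0) * Y j) n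
        ≡⟨ cong₂ (λ u v → qPoch⁻¹ u * shift v (λ j → q⁻ (v ℕ.* 0) * Y j) n) (ℕP.+-identityʳ a) (ℕP.*-zeroʳ k) ⟩
      qPoch⁻¹ a * (1ℚ * Y n)
        ≡⟨ trans (cong (qPoch⁻¹ a *_) (*-identityˡ (Y n))) (*-comm (qPoch⁻¹ a) (Y n)) ⟩
      Y n * qPoch⁻¹ a ∎
    where open ≡-Reasoning

  multiplicityTerm-vanishes : ∀ k Y n a m → n ℕ.< k ℕ.* m → multiplicityTerm k Y n a m ≡ 0ℚ
  multiplicityTerm-vanishes k Y n a m n<km = trans (cong (qPoch⁻¹ (a ℕ.+ m) *_) (shift-< (k ℕ.* m) _ n n<km)) (*-zeroʳ (qPoch⁻¹ (a ℕ.+ m)))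

  multiplicityTerm-suc : ∀ k Y n a m → k ℕ.≤ n →
    multiplicityTerm k Y n a (suc m) ≡ q⁻ (2 ℕ.* (n ∸ k) ℕ.+ k) * multiplicityTerm k Y (n ∸ k) (suc a) m
  multiplicityTerm-suc k Y n a m k≤n = begin
      qPoch⁻¹ (a ℕ.+ suc m) * shift (k ℕ.* suc m) (F (suc m)) n
        ≡⟨ cong₂ (λ u v → qPoch⁻¹ u * shift v (F (suc m)) n) (ℕP.+-suc a m) (ℕP.*-suc k m) ⟩
      qPoch⁻¹ (suc a ℕ.+ m) * shift (k ℕ.+ k ℕ.* m) (F (suc m)) n
        ≡⟨ cong (qPoch⁻¹ (suc a ℕ.+ m) *_) (trans (sym (shift-shift k (k ℕ.* m) (F (suc m)) n)) (shift-≥ k _ n k≤n)) ⟩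
      qPoch⁻¹ (suc a ℕ.+ m) * shift (k ℕ.* m) (F (suc m)) (n ∸ k)
        ≡⟨ cong (qPoch⁻¹ (suc a ℕ.+ m) *_) (shift-scale-at (k ℕ.* m) (F (suc m)) (F m) C (n ∸ k) F-suc) ⟩
      qPoch⁻¹ (suc a ℕ.+ m) * (C * shift (k ℕ.* m) (F m) (n ∸ k))
        ≡⟨ lem (qPoch⁻¹ (suc a ℕ.+ m)) C (shift (k ℕ.* m) (F m) (n ∸ k)) ⟩
      C * multiplicityTerm k Y (n ∸ k) (suc a) m ∎
    where
    open ≡-Reasoning
    open +-*-Solver using (solve; _:+_; _:*_; _:=_; con)
    F : ℕ → ℕ → ℚ
    F m j = q⁻ (2 ℕ.* m ℕ.* j ℕ.+ k ℕ.* m ℕ.* m) * Y j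
    C : ℚ
    C = q⁻ (2 ℕ.* (n ∸ k) ℕ.+ k)
    lem : ∀ x y z → x * (y * z) ≡ y * (x * z)
    lem = solve-∀ ℚ-ring
    F-suc : ∀ j → j ℕ.+ k ℕ.* m ≡ n ∸ k → F (suc m) j ≡ C * F m j
    F-suc j e = trans (cong (_* Y j) (trans (cong q⁻ exponent) (q⁻-+ (2 ℕ.* (n ∸ k) ℕ.+ k) _))) (*-assoc C _ (Y j))
      where
      exponent : 2 ℕ.* suc m ℕ.* j ℕ.+ k ℕ.* suc m ℕ.* suc m ≡ 2 ℕ.* (n ∸ k) ℕ.+ k ℕ.+ (2 ℕ.* m ℕ.* j ℕ.+ k ℕ.* m ℕ.* m)
      exponent = trans (solve 3 (λ m j k → con 2 :* (con 1 :+ m) :* j :+ k :* (con 1 :+ m) :* (con 1 :+ m)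
                                         := con 2 :* (j :+ k :* m) :+ k :+ (con 2 :* m :* j :+ k :* m :* m)) refl m j k)
                       (cong (λ z → 2 ℕ.* z ℕ.+ k ℕ.+ (2 ℕ.* m ℕ.* j ℕ.+ k ℕ.* m ℕ.* m)) e)

  multiplicitySum-rec : ∀ k' Y n a → multiplicitySum (suc k') Y n a
    ≡ Y n * qPoch⁻¹ a + ifYes (suc k' ℕ.≤? n) (q⁻ (2 ℕ.* (n ∸ suc k') ℕ.+ suc k') * multiplicitySum (suc k') Y (n ∸ suc k') (suc a))
  multiplicitySum-rec k' Y n a = trans (sum-sucˡ n _) (cong₂ _+_ (multiplicityTerm-0 k Y n a) (tail (k ℕ.≤? n)))
    where
    open ≡-Reasoning
    k : ℕ
    k = suc k'
    C : ℚ
    C = q⁻ (2 ℕ.* (n ∸ k) ℕ.+ k)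
    tail : (d : Dec (k ℕ.≤ n)) → Σ< n (λ m → multiplicityTerm k Y n a (suc m)) ≡ ifYes d (C * multiplicitySum k Y (n ∸ k) (suc a))
    tail (no k≰n) = sum-0 n (λ m _ → multiplicityTerm-vanishes k Y n a (suc m) (ℕP.<-≤-trans (ℕP.≰⇒> k≰n) (ℕP.m≤m*n k (suc m))))
    tail (yes k≤n) = begin
        Σ< n (λ m → multiplicityTerm k Y n a (suc m))
          ≡⟨ sum-cong n (λ m → multiplicityTerm-suc k Y n a m k≤n) ⟩
        Σ< n (λ m → C * multiplicityTerm k Y (n ∸ k) (suc a) m)
          ≡⟨ sym (sum-*ˡ n C _) ⟩
        C * Σ< n (multiplicityTerm k Y (n ∸ k) (suc a))
          ≡⟨ cong (C *_) (sum-truncate _ n∸k<n (λ m n∸k<m _ → multiplicityTerm-vanishes k Y (n ∸ k) (suc a) m (ℕP.<-≤-trans n∸k<m (ℕP.m≤n*m m k)))) ⟩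
        C * multiplicitySum k Y (n ∸ k) (suc a) ∎
      where
      n∸k<n : suc (n ∸ k) ℕ.≤ n
      n∸k<n = ℕP.∸-monoʳ-< (s≤s z≤n) k≤n

  -- Expanding seriesCoeff k inside multiplicitySum gives a double sum over (m, l) whose (m, l) term
  -- starts in u-degree k (m + l); along each antidiagonal m + l = p the q-binomial identity
  -- gauss-twistedEuler collapses the sum to the p-th summand of seriesCoeff (suc k).
  module SeriesCoeffStep (k' : ℕ) (n : ℕ) where
    open +-*-Solver
    open ≡-Reasoning

    k : ℕ
    k = suc k'

    l≤k*l : ∀ l → l ℕ.≤ k ℕ.* l
    l≤k*l l = ℕP.m≤n*m l k

    innerTerm : ℕ → ℕ → ℕ → ℚ
    innerTerm m l j = q⁻ (2 ℕ.* m ℕ.* j ℕ.+ k ℕ.* m ℕ.* m) * (summandCoeff k l * shift (k ℕ.* l) (summandSeries l) j)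

    doubleTerm : ℕ → ℕ → ℚ
    doubleTerm m l = qPoch⁻¹ m * shift (k ℕ.* m) (innerTerm m l) n

    multiplicityTerm-expand : ∀ m → multiplicityTerm k (seriesCoeff k) n 0 m ≡ Σ< (suc n) (doubleTerm m)
    multiplicityTerm-expand m = begin
        qPoch⁻¹ m * shift (k ℕ.* m) inner n ≡⟨ cong (qPoch⁻¹ m *_) (shift-cong-≤ (k ℕ.* m) inner (λ j → Σ< (suc n) (λ l → innerTerm m l j)) n pt) ⟩
        qPoch⁻¹ m * shift (k ℕ.* m) (λ j → Σ< (suc n) (λ l → innerTerm m l j)) n ≡⟨ cong (qPoch⁻¹ m *_) (sym (shift-sum (suc n) (k ℕ.* m) (innerTerm m) n)) ⟩
        qPoch⁻¹ m * Σ< (suc n) (λ l → shift (k ℕ.* m) (innerTerm m l) n) ≡⟨ sum-*ˡ (suc n) (qPoch⁻¹ m) _ ⟩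
        Σ< (suc n) (λ l → doubleTerm m l) ∎
      where
      inner : ℕ → ℚ
      inner j = q⁻ (2 ℕ.* m ℕ.* j ℕ.+ k ℕ.* m ℕ.* m) * seriesCoeff k j
      pt : ∀ j → j ℕ.≤ n → inner j ≡ Σ< (suc n) (λ l → innerTerm m l j)
      pt j j≤n = trans (cong (q⁻ (2 ℕ.* m ℕ.* j ℕ.+ k ℕ.* m ℕ.* m) *_)
                    (sym (sum-truncate (λ l → summandCoeff k l * shift (k ℕ.* l) (summandSeries l) j) (s≤s j≤n)
                       (λ l le _ → trans (cong (summandCoeff k l *_) (shift-< (k ℕ.* l) (summandSeries l) j (ℕP.<-≤-trans le (l≤k*l l)))) (*-zeroʳ (summandCoeff k l))))))
                   (sum-*ˡ (suc n) (q⁻ (2 ℕ.* m ℕ.* j ℕ.+ k ℕ.* m ℕ.* m)) _)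

    mergedTerm : ℕ → ℕ → ℕ → ℚ
    mergedTerm m l i = gaussCoeff l * qPoch⁻¹ l * q⁻ (k ℕ.* (m ℕ.+ l) ℕ.* (m ℕ.+ l)) * twistedEuler (2 ℕ.* (m ℕ.+ l)) ((m ℕ.+ l) ℕ.+ m) i

    innerTerm-≥ : ∀ m l j → k ℕ.* l ℕ.≤ j → innerTerm m l j ≡ shift (k ℕ.* l) (mergedTerm m l) j
    innerTerm-≥ m l j kl≤j = begin
        q⁻ (2 ℕ.* m ℕ.* j ℕ.+ k ℕ.* m ℕ.* m) * (summandCoeff k l * shift (k ℕ.* l) (summandSeries l) j)
          ≡⟨ cong (λ z → q⁻ (2 ℕ.* m ℕ.* j ℕ.+ k ℕ.* m ℕ.* m) * (summandCoeff k l * z)) (shift-≥ (k ℕ.* l) (summandSeries l) j kl≤j) ⟩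
        q⁻ (2 ℕ.* m ℕ.* j ℕ.+ k ℕ.* m ℕ.* m) * (sgn l * (q⁻ (k ℕ.* l ℕ.* l ℕ.+ tri l) * qPoch⁻¹ l) * summandSeries l i)
          ≡⟨ lem1 (q⁻ (2 ℕ.* m ℕ.* j ℕ.+ k ℕ.* m ℕ.* m)) (sgn l) (q⁻ (k ℕ.* l ℕ.* l ℕ.+ tri l)) (qPoch⁻¹ l) (summandSeries l i) ⟩
        sgn l * qPoch⁻¹ l * (q⁻ (2 ℕ.* m ℕ.* j ℕ.+ k ℕ.* m ℕ.* m) * q⁻ (k ℕ.* l ℕ.* l ℕ.+ tri l)) * summandSeries l i
          ≡⟨ cong (λ z → sgn l * qPoch⁻¹ l * z * summandSeries l i) (trans (sym (q⁻-+ (2 ℕ.* m ℕ.* j ℕ.+ k ℕ.* m ℕ.* m) (k ℕ.* l ℕ.* l ℕ.+ tri l))) (trans (cong q⁻ expo) (trans (q⁻-+ (2 ℕ.* m ℕ.* i) (k ℕ.* (m ℕ.+ l) ℕ.* (m ℕ.+ l) ℕ.+ tri l)) (cong (q⁻ (2 ℕ.* m ℕ.* i) *_) (q⁻-+ (k ℕ.* (m ℕ.+ l) ℕ.* (m ℕ.+ l)) (tri l)))))) ⟩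
        sgn l * qPoch⁻¹ l * (q⁻ (2 ℕ.* m ℕ.* i) * (q⁻ (k ℕ.* (m ℕ.+ l) ℕ.* (m ℕ.+ l)) * q⁻ (tri l))) * summandSeries l i
          ≡⟨ lem2 (sgn l) (qPoch⁻¹ l) (q⁻ (2 ℕ.* m ℕ.* i)) (q⁻ (k ℕ.* (m ℕ.+ l) ℕ.* (m ℕ.+ l))) (q⁻ (tri l)) (summandSeries l i) ⟩
        sgn l * q⁻ (tri l) * qPoch⁻¹ l * q⁻ (k ℕ.* (m ℕ.+ l) ℕ.* (m ℕ.+ l)) * (q⁻ (2 ℕ.* m ℕ.* i) * summandSeries l i)
          ≡⟨ cong (sgn l * q⁻ (tri l) * qPoch⁻¹ l * q⁻ (k ℕ.* (m ℕ.+ l) ℕ.* (m ℕ.+ l)) *_) (twistedEuler-dilate (2 ℕ.* m) (2 ℕ.* l) l i) ⟩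
        sgn l * q⁻ (tri l) * qPoch⁻¹ l * q⁻ (k ℕ.* (m ℕ.+ l) ℕ.* (m ℕ.+ l)) * twistedEuler (2 ℕ.* l ℕ.+ 2 ℕ.* m) (l ℕ.+ 2 ℕ.* m) i
          ≡⟨ cong₂ (λ u v → sgn l * q⁻ (tri l) * qPoch⁻¹ l * q⁻ (k ℕ.* (m ℕ.+ l) ℕ.* (m ℕ.+ l)) * twistedEuler u v i) e1 e2 ⟩
        mergedTerm m l i ≡⟨ sym (shift-≥ (k ℕ.* l) (mergedTerm m l) j kl≤j) ⟩
        shift (k ℕ.* l) (mergedTerm m l) j ∎
      where
      i : ℕ
      i = j ∸ k ℕ.* l
      jeq : j ≡ i ℕ.+ k ℕ.* l
      jeq = sym (ℕP.m∸n+n≡m kl≤j)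
      expo : 2 ℕ.* m ℕ.* j ℕ.+ k ℕ.* m ℕ.* m ℕ.+ (k ℕ.* l ℕ.* l ℕ.+ tri l) ≡ 2 ℕ.* m ℕ.* i ℕ.+ (k ℕ.* (m ℕ.+ l) ℕ.* (m ℕ.+ l) ℕ.+ tri l)
      expo = trans (cong (λ z → 2 ℕ.* m ℕ.* z ℕ.+ k ℕ.* m ℕ.* m ℕ.+ (k ℕ.* l ℕ.* l ℕ.+ tri l)) jeq)
               (solve 5 (λ m i k l t → con 2 :* m :* (i :+ k :* l) :+ k :* m :* m :+ (k :* l :* l :+ t) := con 2 :* m :* i :+ (k :* (m :+ l) :* (m :+ l) :+ t)) refl m i k l (tri l))
      e1 : 2 ℕ.* l ℕ.+ 2 ℕ.* m ≡ 2 ℕ.* (m ℕ.+ l)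
      e1 = solve 2 (λ m l → con 2 :* l :+ con 2 :* m := con 2 :* (m :+ l)) refl m l
      e2 : l ℕ.+ 2 ℕ.* m ≡ (m ℕ.+ l) ℕ.+ m
      e2 = solve 2 (λ m l → l :+ con 2 :* m := (m :+ l) :+ m) refl m l
      lem1 : ∀ A s B I D → A * (s * (B * I) * D) ≡ s * I * (A * B) * D
      lem1 = solve-∀ ℚ-ring
      lem2 : ∀ s I A B C D → s * I * (A * (B * C)) * D ≡ s * C * I * B * (A * D)
      lem2 = solve-∀ ℚ-ring

    innerTerm≡shift : ∀ m l j → innerTerm m l j ≡ shift (k ℕ.* l) (mergedTerm m l) j
    innerTerm≡shift m l j = go (j ℕ.<? k ℕ.* l)
      where
      go : Dec (j ℕ.< k ℕ.* l) → innerTerm m l j ≡ shift (k ℕ.* l) (mergedTerm m l) j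
      go (yes j<) = trans (cong (λ z → q⁻ (2 ℕ.* m ℕ.* j ℕ.+ k ℕ.* m ℕ.* m) * (summandCoeff k l * z)) (shift-< (k ℕ.* l) (summandSeries l) j j<))
                    (trans (cong (q⁻ (2 ℕ.* m ℕ.* j ℕ.+ k ℕ.* m ℕ.* m) *_) (*-zeroʳ (summandCoeff k l)))
                    (trans (*-zeroʳ (q⁻ (2 ℕ.* m ℕ.* j ℕ.+ k ℕ.* m ℕ.* m))) (sym (shift-< (k ℕ.* l) (mergedTerm m l) j j<))))
      go (no j≮) = innerTerm-≥ m l j (ℕP.≮⇒≥ j≮)

    mergedShift : ℕ → ℕ → ℚ
    mergedShift m l = shift (k ℕ.* (m ℕ.+ l)) (λ i → qPoch⁻¹ m * mergedTerm m l i) n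

    doubleTerm≡mergedShift : ∀ m l → doubleTerm m l ≡ mergedShift m l
    doubleTerm≡mergedShift m l = begin
        qPoch⁻¹ m * shift (k ℕ.* m) (innerTerm m l) n ≡⟨ cong (qPoch⁻¹ m *_) (shift-cong-≤ (k ℕ.* m) (innerTerm m l) (shift (k ℕ.* l) (mergedTerm m l)) n (λ j _ → innerTerm≡shift m l j)) ⟩
        qPoch⁻¹ m * shift (k ℕ.* m) (shift (k ℕ.* l) (mergedTerm m l)) n ≡⟨ cong (qPoch⁻¹ m *_) (shift-shift (k ℕ.* m) (k ℕ.* l) (mergedTerm m l) n) ⟩
        qPoch⁻¹ m * shift (k ℕ.* m ℕ.+ k ℕ.* l) (mergedTerm m l) n ≡⟨ shift-scale (qPoch⁻¹ m) (k ℕ.* m ℕ.+ k ℕ.* l) (mergedTerm m l) n ⟩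
        shift (k ℕ.* m ℕ.+ k ℕ.* l) (λ i → qPoch⁻¹ m * mergedTerm m l i) n ≡⟨ cong (λ z → shift z (λ i → qPoch⁻¹ m * mergedTerm m l i) n) (sym (ℕP.*-distribˡ-+ k m l)) ⟩
        mergedShift m l ∎

    doubleTerm-vanishes : ∀ m l → n ℕ.< m ℕ.+ l → doubleTerm m l ≡ 0ℚ
    doubleTerm-vanishes m l lt = trans (doubleTerm≡mergedShift m l) (shift-< (k ℕ.* (m ℕ.+ l)) (λ i → qPoch⁻¹ m * mergedTerm m l i) n (ℕP.<-≤-trans lt (l≤k*l (m ℕ.+ l))))

    antidiagonalTerm : ℕ → ℕ → ℚ
    antidiagonalTerm p l = shift (k ℕ.* p) (λ i → qPoch⁻¹ (p ∸ l) * (gaussCoeff l * qPoch⁻¹ l * q⁻ (k ℕ.* p ℕ.* p) * twistedEuler (2 ℕ.* p) (p ℕ.+ (p ∸ l)) i)) n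

    mergedShift≡antidiagonalTerm : ∀ p l → l ℕ.≤ p → mergedShift (p ∸ l) l ≡ antidiagonalTerm p l
    mergedShift≡antidiagonalTerm p l l≤p = cong (λ z → shift (k ℕ.* z) (λ i → qPoch⁻¹ (p ∸ l) * (gaussCoeff l * qPoch⁻¹ l * q⁻ (k ℕ.* z ℕ.* z) * twistedEuler (2 ℕ.* z) (z ℕ.+ (p ∸ l)) i)) n) (ℕP.m∸n+n≡m l≤p)

    gaussLeading : ℕ → ℚ
    gaussLeading p = gaussCoeff p * q⁻ (p ℕ.* p) * qPoch⁻¹ p

    antidiagonal-sum : ∀ p → Σ< (suc p) (λ l → antidiagonalTerm p l) ≡ summandCoeff (suc k) p * shift (suc k ℕ.* p) (summandSeries p) n
    antidiagonal-sum p = begin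
        Σ< (suc p) (λ l → antidiagonalTerm p l) ≡⟨ shift-sum (suc p) (k ℕ.* p) _ n ⟩
        shift (k ℕ.* p) (λ i → Σ< (suc p) (λ l → qPoch⁻¹ (p ∸ l) * (gaussCoeff l * qPoch⁻¹ l * q⁻ (k ℕ.* p ℕ.* p) * twistedEuler (2 ℕ.* p) (p ℕ.+ (p ∸ l)) i))) n
          ≡⟨ shift-cong-≤ (k ℕ.* p) _ _ n (λ i _ → trans (sum-cong (suc p) (λ l → lem1 (qPoch⁻¹ (p ∸ l)) (gaussCoeff l) (qPoch⁻¹ l) (q⁻ (k ℕ.* p ℕ.* p)) (twistedEuler (2 ℕ.* p) (p ℕ.+ (p ∸ l)) i)))
                                       (trans (sym (sum-*ˡ (suc p) (q⁻ (k ℕ.* p ℕ.* p)) _)) (cong (q⁻ (k ℕ.* p ℕ.* p) *_) (gauss-twistedEuler p i)))) ⟩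
        shift (k ℕ.* p) (λ i → q⁻ (k ℕ.* p ℕ.* p) * (gaussLeading p * shift p (summandSeries p) i)) n
          ≡⟨ shift-cong-≤ (k ℕ.* p) _ _ n (λ i _ → trans (sym (*-assoc (q⁻ (k ℕ.* p ℕ.* p)) (gaussLeading p) _)) (shift-scale (q⁻ (k ℕ.* p ℕ.* p) * gaussLeading p) p (summandSeries p) i)) ⟩
        shift (k ℕ.* p) (shift p (λ j → q⁻ (k ℕ.* p ℕ.* p) * gaussLeading p * summandSeries p j)) n ≡⟨ shift-shift (k ℕ.* p) p _ n ⟩
        shift (k ℕ.* p ℕ.+ p) (λ j → q⁻ (k ℕ.* p ℕ.* p) * gaussLeading p * summandSeries p j) n ≡⟨ sym (shift-scale (q⁻ (k ℕ.* p ℕ.* p) * gaussLeading p) (k ℕ.* p ℕ.+ p) (summandSeries p) n) ⟩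
        q⁻ (k ℕ.* p ℕ.* p) * gaussLeading p * shift (k ℕ.* p ℕ.+ p) (summandSeries p) n ≡⟨ cong₂ (λ u v → u * shift v (summandSeries p) n) coef (ℕP.+-comm (k ℕ.* p) p) ⟩
        summandCoeff (suc k) p * shift (suc k ℕ.* p) (summandSeries p) n ∎
      where
      lem1 : ∀ A B C D F → A * (B * C * D * F) ≡ D * (B * (A * C) * F)
      lem1 = solve-∀ ℚ-ring
      lem2 : ∀ s A B C I → C * (s * A * B * I) ≡ s * (B * C * A * I)
      lem2 = solve-∀ ℚ-ring
      coef : q⁻ (k ℕ.* p ℕ.* p) * gaussLeading p ≡ summandCoeff (suc k) p
      coef = begin
          q⁻ (k ℕ.* p ℕ.* p) * (sgn p * q⁻ (tri p) * q⁻ (p ℕ.* p) * qPoch⁻¹ p) ≡⟨ lem2 (sgn p) (q⁻ (tri p)) (q⁻ (p ℕ.* p)) (q⁻ (k ℕ.* p ℕ.* p)) (qPoch⁻¹ p) ⟩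
          sgn p * (q⁻ (p ℕ.* p) * q⁻ (k ℕ.* p ℕ.* p) * q⁻ (tri p) * qPoch⁻¹ p) ≡⟨ cong (λ z → sgn p * (z * q⁻ (tri p) * qPoch⁻¹ p)) (sym (q⁻-+ (p ℕ.* p) (k ℕ.* p ℕ.* p))) ⟩
          sgn p * (q⁻ (p ℕ.* p ℕ.+ k ℕ.* p ℕ.* p) * q⁻ (tri p) * qPoch⁻¹ p) ≡⟨ cong (λ z → sgn p * (z * qPoch⁻¹ p)) (sym (q⁻-+ (p ℕ.* p ℕ.+ k ℕ.* p ℕ.* p) (tri p))) ⟩
          sgn p * (q⁻ (p ℕ.* p ℕ.+ k ℕ.* p ℕ.* p ℕ.+ tri p) * qPoch⁻¹ p) ≡⟨ cong (λ z → sgn p * (q⁻ (z ℕ.+ tri p) * qPoch⁻¹ p)) (solve 2 (λ p k → p :* p :+ k :* p :* p := (con 1 :+ k) :* p :* p) refl p k) ⟩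
          summandCoeff (suc k) p ∎

    seriesCoeff-suc : seriesCoeff (suc k) n ≡ multiplicitySum k (seriesCoeff k) n 0
    seriesCoeff-suc = sym (begin
        multiplicitySum k (seriesCoeff k) n 0 ≡⟨ sum-cong (suc n) multiplicityTerm-expand ⟩
        Σ< (suc n) (λ m → Σ< (suc n) (λ l → doubleTerm m l)) ≡⟨ sum-antidiagonals n doubleTerm doubleTerm-vanishes ⟩
        Σ< (suc n) (λ p → Σ< (suc p) (λ l → doubleTerm (p ∸ l) l)) ≡⟨ sum-cong (suc n) (λ p → sum-cong-< (suc p) (λ l l< → trans (doubleTerm≡mergedShift (p ∸ l) l) (mergedShift≡antidiagonalTerm p l (ℕP.≤-pred l<)))) ⟩
        Σ< (suc n) (λ p → Σ< (suc p) (λ l → antidiagonalTerm p l)) ≡⟨ sum-cong (suc n) antidiagonal-sum ⟩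
        seriesCoeff (suc k) n ∎)

  -- Partition weights

  weightUpTo : ℕ → List ℕ → ℚ
  weightUpTo K μ = Π< K (λ i → q⁻ (conj (suc i) μ ℕ.* conj (suc i) μ) * qPoch⁻¹ (mult (suc i) μ))

  weight : List ℕ → ℚ
  weight μ = weightUpTo (largestPart μ) μ

  -- Removing the largest part j lowers λ'₁, …, λ'ⱼ by one and m_j by one.
  weightRec : List ℕ → ℚ
  weightRec [] = 1ℚ
  weightRec (j ∷ μ) = q⁻ (2 ℕ.* sum μ ℕ.+ j) * (qPoch⁻¹ (suc (mult j μ)) * qPoch (mult j μ)) * weightRec μ

  weightUpTo-truncate : ∀ K K' μ → Parts≤ K' μ → K' ℕ.≤ K → weightUpTo K μ ≡ weightUpTo K' μ
  weightUpTo-truncate K K' μ g le = prod-truncate _ le (λ i K'≤i _ → let z = Parts≤-beyond K' μ g (suc i) (s≤s K'≤i) in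
     trans (cong₂ (λ a b → q⁻ (a ℕ.* a) * qPoch⁻¹ b) (proj₁ z) (proj₂ z)) (trans (*-identityˡ (qPoch⁻¹ 0)) qPoch⁻¹-0))

  prod-q⁻ : ∀ K h → Π< K (λ i → q⁻ (h i)) ≡ q⁻ (Σℕ K h)
  prod-q⁻ zero h = refl
  prod-q⁻ (suc K) h = trans (cong (_* q⁻ (h K)) (prod-q⁻ K h)) (sym (q⁻-+ (Σℕ K h) (h K)))

  weightUpTo-∷ : ∀ j' ν → Parts≤ (suc j') ν →
    weightUpTo (suc j') (suc j' ∷ ν) ≡ q⁻ (2 ℕ.* sum ν ℕ.+ suc j') * (qPoch⁻¹ (suc (mult (suc j') ν)) * qPoch (mult (suc j') ν)) * weightUpTo (suc j') ν
  weightUpTo-∷ j' ν g = begin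
      Π< j' f * f j'
        ≡⟨ cong₂ _*_ (trans (prod-cong-< j' (λ i i<j' → factor-below i i<j')) (prod-* j' A B)) factor-top ⟩
      Π< j' A * Π< j' B * (A j' * (q⁻ (c' j' ℕ.* c' j') * qPoch⁻¹ (suc m)))
        ≡⟨ sym (trans (cong (Π< j' A * Π< j' B * (A j' * (q⁻ (c' j' ℕ.* c' j') * qPoch⁻¹ (suc m))) *_) (qPoch*qPoch⁻¹ m)) (*-identityʳ _)) ⟩
      Π< j' A * Π< j' B * (A j' * (q⁻ (c' j' ℕ.* c' j') * qPoch⁻¹ (suc m))) * (qPoch m * qPoch⁻¹ m)
        ≡⟨ lem (Π< j' A) (Π< j' B) (A j') (q⁻ (c' j' ℕ.* c' j')) (qPoch⁻¹ (suc m)) (qPoch m) (qPoch⁻¹ m) ⟩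
      Π< (suc j') A * (qPoch⁻¹ (suc m) * qPoch m) * weightUpTo (suc j') ν
        ≡⟨ cong (λ z → z * (qPoch⁻¹ (suc m) * qPoch m) * weightUpTo (suc j') ν) (trans (prod-q⁻ (suc j') (λ i → 2 ℕ.* c' i ℕ.+ 1)) (cong q⁻ (trans (Σℕ-2+1 (suc j') c') (cong (λ z → 2 ℕ.* z ℕ.+ suc j') (Σℕ-conj (suc j') ν g))))) ⟩
      q⁻ (2 ℕ.* sum ν ℕ.+ suc j') * (qPoch⁻¹ (suc m) * qPoch m) * weightUpTo (suc j') ν ∎
    where
    open ≡-Reasoning
    open +-*-Solver using (solve; _:+_; _:*_; _:=_; con)
    j : ℕ
    j = suc j'
    m : ℕ
    m = mult j ν
    c' : ℕ → ℕ
    c' i = conj (suc i) ν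
    f : ℕ → ℚ
    f i = q⁻ (conj (suc i) (j ∷ ν) ℕ.* conj (suc i) (j ∷ ν)) * qPoch⁻¹ (mult (suc i) (j ∷ ν))
    A : ℕ → ℚ
    A i = q⁻ (2 ℕ.* c' i ℕ.+ 1)
    B : ℕ → ℚ
    B i = q⁻ (c' i ℕ.* c' i) * qPoch⁻¹ (mult (suc i) ν)
    sq : ∀ c → suc c ℕ.* suc c ≡ (2 ℕ.* c ℕ.+ 1) ℕ.+ c ℕ.* c
    sq c = solve 1 (λ c → (con 1 :+ c) :* (con 1 :+ c) := (con 2 :* c :+ con 1) :+ c :* c) refl c
    q⁻-conj² : ∀ i → i ℕ.< j → q⁻ (conj (suc i) (j ∷ ν) ℕ.* conj (suc i) (j ∷ ν)) ≡ A i * q⁻ (c' i ℕ.* c' i)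
    q⁻-conj² i i<j = trans (cong (λ z → q⁻ (z ℕ.* z)) (conj-yes ν i<j)) (trans (cong q⁻ (sq (c' i))) (q⁻-+ (2 ℕ.* c' i ℕ.+ 1) (c' i ℕ.* c' i)))
    factor-below : ∀ i → i ℕ.< j' → f i ≡ A i * B i
    factor-below i i<j' = trans (cong₂ _*_ (q⁻-conj² i (ℕP.m≤n⇒m≤1+n i<j')) (cong qPoch⁻¹ (mult-no ν (λ e → ℕP.<-irrefl (sym e) i<j'')))) (*-assoc (A i) _ _)
      where i<j'' : suc i ℕ.< suc j'
            i<j'' = s≤s i<j'
    factor-top : f j' ≡ A j' * (q⁻ (c' j' ℕ.* c' j') * qPoch⁻¹ (suc m))
    factor-top = trans (cong₂ _*_ (q⁻-conj² j' ℕP.≤-refl) (cong qPoch⁻¹ (mult-yes ν refl))) (*-assoc (A j') _ _)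
    lem : ∀ X Y a C I Pm Im → X * Y * (a * (C * I)) * (Pm * Im) ≡ X * a * (I * Pm) * (Y * (C * Im))
    lem = solve-∀ ℚ-ring

  weight≡weightRec : ∀ k μ → Parts≤ k μ → weight μ ≡ weightRec μ
  weight≡weightRec k [] _ = refl
  weight≡weightRec k (suc j' ∷ ν) (_ , _ , g) = begin
      weightUpTo (suc j') (suc j' ∷ ν) ≡⟨ weightUpTo-∷ j' ν g ⟩
      q⁻ (2 ℕ.* sum ν ℕ.+ suc j') * (qPoch⁻¹ (suc (mult (suc j') ν)) * qPoch (mult (suc j') ν)) * weightUpTo (suc j') ν
        ≡⟨ cong (q⁻ (2 ℕ.* sum ν ℕ.+ suc j') * (qPoch⁻¹ (suc (mult (suc j') ν)) * qPoch (mult (suc j') ν)) *_)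
            (trans (weightUpTo-truncate (suc j') (largestPart ν) ν (Parts≤-largestPart-self (suc j') ν g) (Parts≤-largestPart (suc j') ν g)) (weight≡weightRec (suc j') ν g)) ⟩
      weightRec (suc j' ∷ ν) ∎
    where open ≡-Reasoning

  normalizer : ℕ → ℚ
  normalizer n = ℕ→ℚ q ^ℚ n * poch q (1ℚ ÷' ℕ→ℚ q) n

  Pmeas≡normalizer*weight : ∀ n μ → Pmeas q n μ ≡ normalizer n * weight μ
  Pmeas≡normalizer*weight n μ = begin
      normalizer n ÷' prodℚ (map gg (applyUpTo suc K)) ≡⟨ cong (normalizer n ÷'_) (prodℚ-applyUpTo K gg suc) ⟩
      normalizer n ÷' W ≡⟨ ÷'-≢0 (normalizer n) W nz ⟩
      normalizer n * (1/ W) {{≢-nonZero nz}} ≡⟨ cong (normalizer n *_) (inverse-unique W _ _ (*-inverseʳ W {{≢-nonZero nz}}) W*weight≡1) ⟩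
      normalizer n * weight μ ∎
    where
    open ≡-Reasoning
    K : ℕ
    K = largestPart μ
    gg : ℕ → ℚ
    gg j = (ℕ→ℚ q ^ℚ (conj j μ ℕ.* conj j μ)) * poch q (1ℚ ÷' ℕ→ℚ q) (mult j μ)
    W : ℚ
    W = Π< K (gg ∘ suc)
    W*weight≡1 : W * weight μ ≡ 1ℚ
    W*weight≡1 = trans (sym (prod-* K (gg ∘ suc) _)) (trans (prod-cong-< K (λ i _ → fac i)) (prod-one K))
      where
      lem : ∀ a b c d → a * b * (c * d) ≡ (a * c) * (b * d)
      lem = solve-∀ ℚ-ring
      fac : ∀ i → gg (suc i) * (q⁻ (conj (suc i) μ ℕ.* conj (suc i) μ) * qPoch⁻¹ (mult (suc i) μ)) ≡ 1ℚ
      fac i = trans (lem (Q ^ℚ (cc ℕ.* cc)) (poch q (1ℚ ÷' Q) m) (q⁻ (cc ℕ.* cc)) (qPoch⁻¹ m)) (trans (cong₂ _*_ (Q^*q⁻ (cc ℕ.* cc)) (trans (cong (_* qPoch⁻¹ m) (poch≡qPoch m)) (qPoch*qPoch⁻¹ m))) (*-identityˡ 1ℚ))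
        where cc : ℕ
              cc = conj (suc i) μ
              m : ℕ
              m = mult (suc i) μ
    nz : W ≢ 0ℚ
    nz e = <-irrefl refl (subst (0ℚ <_) (trans (sym W*weight≡1) (trans (cong (_* weight μ) e) (*-zeroˡ (weight μ)))) (0<q⁻ 0))

  partitionSum : ℕ → ℕ → ℕ → ℚ
  partitionSum f n k = sumOver weightRec (ptns f n k)

  partitionSum-0 : ∀ f k → partitionSum f 0 k ≡ 1ℚ
  partitionSum-0 f k = +-identityʳ 1ℚ

  shiftedWeight : ℕ → ℕ → List ℕ → ℚ
  shiftedWeight k a μ = weightRec μ * (qPoch (mult k μ) * qPoch⁻¹ (mult k μ ℕ.+ a))

  shiftedPartitionSum : ℕ → ℕ → ℕ → ℕ → ℚ
  shiftedPartitionSum f n k a = sumOver (shiftedWeight k a) (ptns f n k)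

  partitionSum≡shifted : ∀ f n k → partitionSum f n k ≡ shiftedPartitionSum f n k 0
  partitionSum≡shifted f n k = sumOver-cong (ptns f n k) (λ μ → sym (trans (cong (λ z → weightRec μ * (qPoch (mult k μ) * qPoch⁻¹ z)) (ℕP.+-identityʳ (mult k μ))) (trans (cong (weightRec μ *_) (qPoch*qPoch⁻¹ (mult k μ))) (*-identityʳ (weightRec μ)))))

  -- Split off the partitions whose largest part is k; removing one such part raises a by one.
  shiftedPartitionSum-rec : ∀ f' n' k' a → shiftedPartitionSum (suc f') (suc n') (suc k') a ≡
     partitionSum (suc f') (suc n') k' * qPoch⁻¹ a + ifYes (suc k' ℕ.≤? suc n') (q⁻ (2 ℕ.* (n' ∸ k') ℕ.+ suc k') * shiftedPartitionSum f' (n' ∸ k') (suc k') (suc a))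
  shiftedPartitionSum-rec f' n' k' a = begin
      shiftedPartitionSum (suc f') (suc n') k a ≡⟨ sumOver-ptns (shiftedWeight k a) f' n' k ⟩
      Σ< k' (λ i → ifYes (suc i ℕ.≤? suc n') (sumOver (shiftedWeight k a ∘ (suc i ∷_)) (ptns f' (n' ∸ i) (suc i)))) + ifYes (k ℕ.≤? suc n') (sumOver (shiftedWeight k a ∘ (k ∷_)) (ptns f' (n' ∸ k') k))
        ≡⟨ cong₂ _+_ (trans (sum-cong-< k' first) (trans (sym (sum-*ʳ k' (qPoch⁻¹ a) (λ i → ifYes (suc i ℕ.≤? suc n') (sumOver (weightRec ∘ (suc i ∷_)) (ptns f' (n' ∸ i) (suc i)))))) (cong (_* qPoch⁻¹ a) (sym (sumOver-ptns weightRec f' n' k'))))) (ifYes-cong (k ℕ.≤? suc n') (λ _ → second)) ⟩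
      partitionSum (suc f') (suc n') k' * qPoch⁻¹ a + ifYes (k ℕ.≤? suc n') (q⁻ (2 ℕ.* (n' ∸ k') ℕ.+ k) * shiftedPartitionSum f' (n' ∸ k') k (suc a)) ∎
    where
    open ≡-Reasoning
    k : ℕ
    k = suc k'
    first : ∀ i → i ℕ.< k' → ifYes (suc i ℕ.≤? suc n') (sumOver (shiftedWeight k a ∘ (suc i ∷_)) (ptns f' (n' ∸ i) (suc i)))
                            ≡ ifYes (suc i ℕ.≤? suc n') (sumOver (weightRec ∘ (suc i ∷_)) (ptns f' (n' ∸ i) (suc i))) * qPoch⁻¹ a
    first i i<k' = trans (ifYes-cong (suc i ℕ.≤? suc n') (λ _ → trans (sumOver-ptns-cong f' (n' ∸ i) (suc i) _ (λ μ → weightRec (suc i ∷ μ) * qPoch⁻¹ a) el) (sumOver-*ʳ (weightRec ∘ (suc i ∷_)) (qPoch⁻¹ a) (ptns f' (n' ∸ i) (suc i)))))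
                      (ifYes-*ʳ (suc i ℕ.≤? suc n') _ (qPoch⁻¹ a))
      where
      el : ∀ ν → Parts≤ (suc i) ν → sum ν ≡ n' ∸ i → shiftedWeight k a (suc i ∷ ν) ≡ weightRec (suc i ∷ ν) * qPoch⁻¹ a
      el ν g _ = trans (cong (λ z → weightRec (suc i ∷ ν) * (qPoch z * qPoch⁻¹ (z ℕ.+ a))) (proj₂ (Parts≤-beyond (suc i) (suc i ∷ ν) (s≤s z≤n , ℕP.≤-refl , g) k (s≤s i<k'))))
                       (cong (weightRec (suc i ∷ ν) *_) (*-identityˡ (qPoch⁻¹ a)))
    second : sumOver (shiftedWeight k a ∘ (k ∷_)) (ptns f' (n' ∸ k') k) ≡ q⁻ (2 ℕ.* (n' ∸ k') ℕ.+ k) * shiftedPartitionSum f' (n' ∸ k') k (suc a)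
    second = trans (sumOver-ptns-cong f' (n' ∸ k') k _ (λ μ → q⁻ (2 ℕ.* (n' ∸ k') ℕ.+ k) * shiftedWeight k (suc a) μ) el) (sumOver-*ˡ (shiftedWeight k (suc a)) (q⁻ (2 ℕ.* (n' ∸ k') ℕ.+ k)) (ptns f' (n' ∸ k') k))
      where
      lem : ∀ A I Pm W P1 I2 → A * (I * Pm) * W * (P1 * I2) ≡ A * (W * (Pm * I2)) * (I * P1)
      lem = solve-∀ ℚ-ring
      el : ∀ ν → Parts≤ k ν → sum ν ≡ n' ∸ k' → shiftedWeight k a (k ∷ ν) ≡ q⁻ (2 ℕ.* (n' ∸ k') ℕ.+ k) * shiftedWeight k (suc a) ν
      el ν g s = begin
          weightRec (k ∷ ν) * (qPoch (mult k (k ∷ ν)) * qPoch⁻¹ (mult k (k ∷ ν) ℕ.+ a))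
            ≡⟨ cong (λ z → weightRec (k ∷ ν) * (qPoch z * qPoch⁻¹ (z ℕ.+ a))) (mult-yes ν refl) ⟩
          q⁻ (2 ℕ.* sum ν ℕ.+ k) * (qPoch⁻¹ (suc m) * qPoch m) * weightRec ν * (qPoch (suc m) * qPoch⁻¹ (suc m ℕ.+ a))
            ≡⟨ lem (q⁻ (2 ℕ.* sum ν ℕ.+ k)) (qPoch⁻¹ (suc m)) (qPoch m) (weightRec ν) (qPoch (suc m)) (qPoch⁻¹ (suc m ℕ.+ a)) ⟩
          q⁻ (2 ℕ.* sum ν ℕ.+ k) * (weightRec ν * (qPoch m * qPoch⁻¹ (suc m ℕ.+ a))) * (qPoch⁻¹ (suc m) * qPoch (suc m))
            ≡⟨ trans (cong (q⁻ (2 ℕ.* sum ν ℕ.+ k) * (weightRec ν * (qPoch m * qPoch⁻¹ (suc m ℕ.+ a))) *_) (trans (*-comm (qPoch⁻¹ (suc m)) (qPoch (suc m))) (qPoch*qPoch⁻¹ (suc m)))) (*-identityʳ _) ⟩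
          q⁻ (2 ℕ.* sum ν ℕ.+ k) * (weightRec ν * (qPoch m * qPoch⁻¹ (suc m ℕ.+ a)))
            ≡⟨ cong₂ (λ u v → q⁻ (2 ℕ.* u ℕ.+ k) * (weightRec ν * (qPoch m * qPoch⁻¹ v))) s (sym (ℕP.+-suc m a)) ⟩
          q⁻ (2 ℕ.* (n' ∸ k') ℕ.+ k) * shiftedWeight k (suc a) ν ∎
        where m : ℕ
              m = mult k ν

  shiftedPartitionSum≡multiplicitySum : ∀ k' (Y : ℕ → ℚ) → (∀ f n → n ℕ.≤ f → partitionSum f n k' ≡ Y n) → ∀ f n → n ℕ.≤ f → ∀ a → shiftedPartitionSum f n (suc k') a ≡ multiplicitySum (suc k') Y n a
  shiftedPartitionSum≡multiplicitySum k' Y HZ f zero _ a = begin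
      shiftedPartitionSum f 0 (suc k') a ≡⟨ trans (+-identityʳ _) (trans (*-identityˡ _) (*-identityˡ (qPoch⁻¹ a))) ⟩
      qPoch⁻¹ a ≡⟨ sym (*-identityˡ (qPoch⁻¹ a)) ⟩
      1ℚ * qPoch⁻¹ a ≡⟨ cong (_* qPoch⁻¹ a) (trans (sym (partitionSum-0 f k')) (HZ f 0 z≤n)) ⟩
      Y 0 * qPoch⁻¹ a ≡⟨ sym (+-identityʳ _) ⟩
      Y 0 * qPoch⁻¹ a + 0ℚ ≡⟨ cong (Y 0 * qPoch⁻¹ a +_) (sym (ifYes-no (suc k' ℕ.≤? 0) {q⁻ (2 ℕ.* (0 ∸ suc k') ℕ.+ suc k') * multiplicitySum (suc k') Y (0 ∸ suc k') (suc a)} (λ ()))) ⟩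
      Y 0 * qPoch⁻¹ a + ifYes (suc k' ℕ.≤? 0) (q⁻ (2 ℕ.* (0 ∸ suc k') ℕ.+ suc k') * multiplicitySum (suc k') Y (0 ∸ suc k') (suc a)) ≡⟨ sym (multiplicitySum-rec k' Y 0 a) ⟩
      multiplicitySum (suc k') Y 0 a ∎
    where open ≡-Reasoning
  shiftedPartitionSum≡multiplicitySum k' Y HZ (suc f') (suc n') (s≤s n'≤f') a = begin
      shiftedPartitionSum (suc f') (suc n') (suc k') a ≡⟨ shiftedPartitionSum-rec f' n' k' a ⟩
      partitionSum (suc f') (suc n') k' * qPoch⁻¹ a + ifYes (suc k' ℕ.≤? suc n') (q⁻ (2 ℕ.* (n' ∸ k') ℕ.+ suc k') * shiftedPartitionSum f' (n' ∸ k') (suc k') (suc a))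
        ≡⟨ cong₂ (λ u v → u * qPoch⁻¹ a + ifYes (suc k' ℕ.≤? suc n') (q⁻ (2 ℕ.* (n' ∸ k') ℕ.+ suc k') * v)) (HZ (suc f') (suc n') (s≤s n'≤f'))
             (shiftedPartitionSum≡multiplicitySum k' Y HZ f' (n' ∸ k') (ℕP.≤-trans (ℕP.m∸n≤m n' k') n'≤f') (suc a)) ⟩
      Y (suc n') * qPoch⁻¹ a + ifYes (suc k' ℕ.≤? suc n') (q⁻ (2 ℕ.* (n' ∸ k') ℕ.+ suc k') * multiplicitySum (suc k') Y (n' ∸ k') (suc a)) ≡⟨ sym (multiplicitySum-rec k' Y (suc n') a) ⟩
      multiplicitySum (suc k') Y (suc n') a ∎
    where open ≡-Reasoning

  partitionSum≡seriesCoeff : ∀ K f n → n ℕ.≤ f → partitionSum f n K ≡ seriesCoeff (suc K) n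
  partitionSum≡seriesCoeff zero f zero _ = trans (partitionSum-0 f 0) (sym SeriesCoeffOne.seriesCoeff-1-0)
  partitionSum≡seriesCoeff zero (suc f') (suc n') _ = trans (sumOver-ptns weightRec f' n' 0) (sym (SeriesCoeffOne.seriesCoeff-1-suc n'))
  partitionSum≡seriesCoeff (suc k') f n n≤f = begin
      partitionSum f n (suc k') ≡⟨ partitionSum≡shifted f n (suc k') ⟩
      shiftedPartitionSum f n (suc k') 0 ≡⟨ shiftedPartitionSum≡multiplicitySum k' (seriesCoeff (suc k')) (partitionSum≡seriesCoeff k') f n n≤f 0 ⟩
      multiplicitySum (suc k') (seriesCoeff (suc k')) n 0 ≡⟨ sym (SeriesCoeffStep.seriesCoeff-suc k' n) ⟩
      seriesCoeff (suc (suc k')) n ∎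
    where open ≡-Reasoning

  summandCoeff-0 : ∀ r → summandCoeff r 0 ≡ 1ℚ
  summandCoeff-0 r = trans (*-identityˡ _) (trans (cong (λ z → q⁻ (z ℕ.+ 0) * qPoch⁻¹ 0) (ℕP.*-zeroʳ (r ℕ.* 0))) (trans (*-identityˡ (qPoch⁻¹ 0)) qPoch⁻¹-0))

  seriesCoeff-large : ∀ r n → n ℕ.< r → seriesCoeff r n ≡ summandSeries 0 n
  seriesCoeff-large r n n<r = begin
      seriesCoeff r n ≡⟨ sum-sucˡ n _ ⟩
      summandCoeff r 0 * shift (r ℕ.* 0) (summandSeries 0) n + Σ< n (λ m → summandCoeff r (suc m) * shift (r ℕ.* suc m) (summandSeries (suc m)) n)
        ≡⟨ cong₂ _+_ (cong₂ (λ u v → u * shift v (summandSeries 0) n) (summandCoeff-0 r) (ℕP.*-zeroʳ r))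
             (sum-0 n (λ m _ → trans (cong (summandCoeff r (suc m) *_) (shift-< (r ℕ.* suc m) (summandSeries (suc m)) n (ℕP.<-≤-trans n<r (ℕP.m≤m*n r (suc m))))) (*-zeroʳ (summandCoeff r (suc m))))) ⟩
      1ℚ * shift 0 (summandSeries 0) n + 0ℚ ≡⟨ trans (+-identityʳ _) (trans (*-identityˡ _) (shift-≥ 0 (summandSeries 0) n z≤n)) ⟩
      summandSeries 0 n ∎
    where open ≡-Reasoning

  Pr≡normalizer*seriesCoeff : ∀ n r → 1 ℕ.≤ r → Pr q n r ≡ normalizer n * seriesCoeff r n
  Pr≡normalizer*seriesCoeff n r r≥1 = begin
      sumOver (Pmeas q n) (filter (largestBelow? r) (ptns n n n)) ≡⟨ sumOver-cong (filter (largestBelow? r) (ptns n n n)) (Pmeas≡normalizer*weight n) ⟩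
      sumOver (λ μ → normalizer n * weight μ) (filter (largestBelow? r) (ptns n n n)) ≡⟨ sumOver-*ˡ weight (normalizer n) (filter (largestBelow? r) (ptns n n n)) ⟩
      normalizer n * sumOver weight (filter (largestBelow? r) (ptns n n n)) ≡⟨ cong (normalizer n *_) (sumOver-filter-ptns r r≥1 weight n n n) ⟩
      normalizer n * sumOver weight (ptns n n K) ≡⟨ cong (normalizer n *_) (sumOver-ptns-cong n n K weight weightRec (λ μ g _ → weight≡weightRec K μ g)) ⟩
      normalizer n * partitionSum n n K ≡⟨ cong (normalizer n *_) (partitionSum≡seriesCoeff K n n ℕP.≤-refl) ⟩
      normalizer n * seriesCoeff (suc K) n ≡⟨ cong (normalizer n *_) (seriesCoeff-min (r ∸ 1 ℕ.≤? n)) ⟩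
      normalizer n * seriesCoeff r n ∎
    where
    open ≡-Reasoning
    K : ℕ
    K = n ℕ.⊓ (r ∸ 1)
    r≡ : suc (r ∸ 1) ≡ r
    r≡ = trans (ℕP.+-comm 1 (r ∸ 1)) (ℕP.m∸n+n≡m r≥1)
    seriesCoeff-min : Dec (r ∸ 1 ℕ.≤ n) → seriesCoeff (suc K) n ≡ seriesCoeff r n
    seriesCoeff-min (yes p) = trans (cong (λ z → seriesCoeff (suc z) n) (ℕP.m≥n⇒m⊓n≡n p)) (cong (λ z → seriesCoeff z n) r≡)
    seriesCoeff-min (no p) = trans (cong (λ z → seriesCoeff (suc z) n) (ℕP.m≤n⇒m⊓n≡m (ℕP.<⇒≤ (ℕP.≰⇒> p))))
                 (trans (seriesCoeff-large (suc n) n ℕP.≤-refl) (sym (seriesCoeff-large r n (subst (n ℕ.<_) r≡ (s≤s (ℕP.<⇒≤ (ℕP.≰⇒> p)))))))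

  -- Truncating the infinite product

  partialProduct : ℕ → Series
  partialProduct N = prodS (map (geom ∘ q⁻ ∘ suc) (upTo N))

  prodPart≗partialProduct : ∀ N → prodPart q N ≗ partialProduct N
  prodPart≗partialProduct N k = cong (λ L → prodS L k) (LP.map-cong (λ i → cong geom (trans (÷'-Q^ 1ℚ (suc i)) (*-identityˡ (q⁻ (suc i))))) (upTo N))

  prodS-geom-dilate : ∀ N a (g : ℕ → ℕ) → (∀ i → g i ≡ a ℕ.+ i) → prodS (map (geom ∘ q⁻ ∘ suc) (applyUpTo g N)) ≗ dilate a (partialProduct N)
  prodS-geom-dilate zero a g e zero = sym (trans (*-identityʳ _) (cong q⁻ (ℕP.*-zeroʳ a)))
  prodS-geom-dilate zero a g e (suc j) = sym (*-zeroʳ (q⁻ (a ℕ.* suc j)))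
  prodS-geom-dilate (suc N) a g e j = begin
      (geom (q⁻ (suc (g 0))) ⊛ prodS (map (geom ∘ q⁻ ∘ suc) (applyUpTo (g ∘ suc) N))) j
        ≡⟨ ⊛-cong {geom (q⁻ (suc (g 0)))} {geom (q⁻ (suc a))} {prodS (map (geom ∘ q⁻ ∘ suc) (applyUpTo (g ∘ suc) N))} {dilate (suc a) (partialProduct N)}
             (λ k → cong (λ z → geom (q⁻ (suc z)) k) (trans (e 0) (ℕP.+-identityʳ a))) (prodS-geom-dilate N (suc a) (g ∘ suc) (λ i → trans (e (suc i)) (ℕP.+-suc a i))) j ⟩
      (geom (q⁻ (suc a)) ⊛ dilate (suc a) (partialProduct N)) j
        ≡⟨ sym (⊛-cong {dilate a (geom (q⁻ 1))} {geom (q⁻ (suc a))} {dilate a (dilate 1 (partialProduct N))} {dilate (suc a) (partialProduct N)} sg ss j) ⟩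
      (dilate a (geom (q⁻ 1)) ⊛ dilate a (dilate 1 (partialProduct N))) j ≡⟨ sym (dilate-⊛ a (geom (q⁻ 1)) (dilate 1 (partialProduct N)) j) ⟩
      dilate a (geom (q⁻ 1) ⊛ dilate 1 (partialProduct N)) j
        ≡⟨ sym (dilate-cong a (⊛-cong {geom (q⁻ 1)} {geom (q⁻ 1)} {prodS (map (geom ∘ q⁻ ∘ suc) (applyUpTo suc N))} {dilate 1 (partialProduct N)} (λ _ → refl) (prodS-geom-dilate N 1 suc (λ _ → refl))) j) ⟩
      dilate a (partialProduct (suc N)) j ∎
    where
    open ≡-Reasoning
    open +-*-Solver using (solve; _:+_; _:*_; _:=_; con)
    sg : dilate a (geom (q⁻ 1)) ≗ geom (q⁻ (suc a))
    sg k = trans (cong (q⁻ (a ℕ.* k) *_) (sym (q⁻-* k 1))) (trans (sym (q⁻-+ (a ℕ.* k) (k ℕ.* 1)))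
             (trans (cong q⁻ (solve 2 (λ a k → a :* k :+ k :* con 1 := k :* (con 1 :+ a)) refl a k)) (q⁻-* k (suc a))))
    ss : dilate a (dilate 1 (partialProduct N)) ≗ dilate (suc a) (partialProduct N)
    ss k = trans (sym (*-assoc (q⁻ (a ℕ.* k)) (q⁻ (1 ℕ.* k)) (partialProduct N k))) (cong (_* partialProduct N k) (trans (sym (q⁻-+ (a ℕ.* k) (1 ℕ.* k)))
             (cong q⁻ (solve 2 (λ a k → a :* k :+ con 1 :* k := (con 1 :+ a) :* k) refl a k))))

  partialProduct-suc : ∀ N → partialProduct (suc N) ≗ geom (q⁻ 1) ⊛ dilate 1 (partialProduct N)
  partialProduct-suc N = ⊛-cong {geom (q⁻ 1)} {geom (q⁻ 1)} {prodS (map (geom ∘ q⁻ ∘ suc) (applyUpTo suc N))} {dilate 1 (partialProduct N)} (λ _ → refl) (prodS-geom-dilate N 1 suc (λ _ → refl))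

  tailPoch : ℕ → ℕ → ℚ
  tailPoch N j = Π< j (λ i → 1ℚ - q⁻ (N ℕ.+ i))

  tailPoch-suc : ∀ N j → tailPoch N (suc j) ≡ (1ℚ - q⁻ N) * tailPoch (suc N) j
  tailPoch-suc N j = trans (prod-sucˡ j (λ i → 1ℚ - q⁻ (N ℕ.+ i))) (cong₂ _*_ (cong (λ z → 1ℚ - q⁻ z) (ℕP.+-identityʳ N)) (prod-cong-< j (λ i _ → cong (λ z → 1ℚ - q⁻ z) (ℕP.+-suc N i))))

  sum-tailPoch : ∀ N j → Σ< (suc j) (λ b → q⁻ b * qPoch⁻¹ b * tailPoch N b) ≡ qPoch⁻¹ j * tailPoch (suc N) j
  sum-tailPoch N zero = trans (+-identityˡ _) (trans (*-identityʳ _) (*-identityˡ (qPoch⁻¹ 0)))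
  sum-tailPoch N (suc j) = begin
      Σ< (suc j) (λ b → q⁻ b * qPoch⁻¹ b * tailPoch N b) + q⁻ (suc j) * qPoch⁻¹ (suc j) * tailPoch N (suc j)
        ≡⟨ cong₂ _+_ (trans (sum-tailPoch N j) (cong (_* tailPoch (suc N) j) (qPoch⁻¹-suc j))) (cong (q⁻ (suc j) * qPoch⁻¹ (suc j) *_) (tailPoch-suc N j)) ⟩
      qPoch⁻¹ (suc j) * (1ℚ - q⁻ (suc j)) * tailPoch (suc N) j + q⁻ (suc j) * qPoch⁻¹ (suc j) * ((1ℚ - q⁻ N) * tailPoch (suc N) j)
        ≡⟨ lem (qPoch⁻¹ (suc j)) (q⁻ (suc j)) (q⁻ N) (tailPoch (suc N) j) ⟩
      qPoch⁻¹ (suc j) * (tailPoch (suc N) j * (1ℚ - q⁻ (suc j) * q⁻ N))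
        ≡⟨ cong (λ z → qPoch⁻¹ (suc j) * (tailPoch (suc N) j * (1ℚ - z))) (trans (sym (q⁻-+ (suc j) N)) (cong q⁻ (cong suc (ℕP.+-comm j N)))) ⟩
      qPoch⁻¹ (suc j) * tailPoch (suc N) (suc j) ∎
    where
    open ≡-Reasoning
    lem : ∀ I A B Rr → I * (1ℚ - A) * Rr + A * I * ((1ℚ - B) * Rr) ≡ I * (Rr * (1ℚ - A * B))
    lem = solve-∀ ℚ-ring

  partialProduct-coeff : ∀ N j → partialProduct N j ≡ q⁻ j * qPoch⁻¹ j * tailPoch N j
  partialProduct-coeff zero zero = sym (trans (*-identityʳ _) (trans (*-identityˡ (qPoch⁻¹ 0)) (trans (sym (*-identityˡ (qPoch⁻¹ 0))) (qPoch*qPoch⁻¹ 0))))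
  partialProduct-coeff zero (suc j) = sym (trans (cong (q⁻ (suc j) * qPoch⁻¹ (suc j) *_) (prod-zero (suc j) (λ i → 1ℚ - q⁻ (0 ℕ.+ i)) 0 (s≤s z≤n) (+-inverseʳ 1ℚ))) (*-zeroʳ (q⁻ (suc j) * qPoch⁻¹ (suc j))))
  partialProduct-coeff (suc N) j = begin
      partialProduct (suc N) j ≡⟨ partialProduct-suc N j ⟩
      (geom (q⁻ 1) ⊛ dilate 1 (partialProduct N)) j ≡⟨ ⊛-coeff (geom (q⁻ 1)) (dilate 1 (partialProduct N)) j ⟩
      Σ< (suc j) (λ i → q⁻ 1 ^ℚ i * (q⁻ (1 ℕ.* (j ∸ i)) * partialProduct N (j ∸ i))) ≡⟨ sum-cong-< (suc j) (λ i i< → term i (ℕP.≤-pred i<)) ⟩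
      Σ< (suc j) (λ i → q⁻ j * partialProduct N (j ∸ i)) ≡⟨ sym (sum-*ˡ (suc j) (q⁻ j) (λ i → partialProduct N (j ∸ i))) ⟩
      q⁻ j * Σ< (suc j) (λ i → partialProduct N (j ∸ i)) ≡⟨ cong (q⁻ j *_) (sym (sum-reverse (suc j) (partialProduct N))) ⟩
      q⁻ j * Σ< (suc j) (partialProduct N) ≡⟨ cong (q⁻ j *_) (trans (sum-cong (suc j) (partialProduct-coeff N)) (sum-tailPoch N j)) ⟩
      q⁻ j * (qPoch⁻¹ j * tailPoch (suc N) j) ≡⟨ sym (*-assoc (q⁻ j) (qPoch⁻¹ j) _) ⟩
      q⁻ j * qPoch⁻¹ j * tailPoch (suc N) j ∎
    where
    open ≡-Reasoning
    term : ∀ i → i ℕ.≤ j → q⁻ 1 ^ℚ i * (q⁻ (1 ℕ.* (j ∸ i)) * partialProduct N (j ∸ i)) ≡ q⁻ j * partialProduct N (j ∸ i)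
    term i i≤j = trans (sym (*-assoc (q⁻ 1 ^ℚ i) _ (partialProduct N (j ∸ i)))) (cong (_* partialProduct N (j ∸ i))
       (trans (cong₂ _*_ (sym (q⁻-* i 1)) refl) (trans (sym (q⁻-+ (i ℕ.* 1) (1 ℕ.* (j ∸ i))))
         (cong q⁻ (trans (cong₂ ℕ._+_ (ℕP.*-identityʳ i) (ℕP.*-identityˡ (j ∸ i))) (ℕP.m+[n∸m]≡n i≤j))))))

  0≤1-q⁻ : ∀ N i → 0ℚ ≤ 1ℚ - q⁻ (N ℕ.+ i)
  0≤1-q⁻ N i = ≤⇒0≤- (q⁻≤1 (N ℕ.+ i))

  1-q⁻≤1 : ∀ N i → 1ℚ - q⁻ (N ℕ.+ i) ≤ 1ℚ
  1-q⁻≤1 N i = 0≤-⇒≤ (subst (0ℚ ≤_) (lem (q⁻ (N ℕ.+ i))) (0≤q⁻ (N ℕ.+ i)))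
    where lem : ∀ x → x ≡ 1ℚ - (1ℚ - x)
          lem = solve-∀ ℚ-ring

  0≤tailPoch : ∀ N j → 0ℚ ≤ tailPoch N j
  0≤tailPoch N zero = <⇒≤ (0<q⁻ 0)
  0≤tailPoch N (suc j) = 0≤* (0≤tailPoch N j) (0≤1-q⁻ N j)

  tailPoch≤1 : ∀ N j → tailPoch N j ≤ 1ℚ
  tailPoch≤1 N zero = ≤-refl
  tailPoch≤1 N (suc j) = ≤-trans (≤-*ˡ (tailPoch N j) (0≤tailPoch N j) (1-q⁻≤1 N j)) (subst (_≤ 1ℚ) (sym (*-identityʳ (tailPoch N j))) (tailPoch≤1 N j))

  1-tailPoch≤ : ∀ N j → 1ℚ - tailPoch N j ≤ ℕ→ℚ j * q⁻ N
  1-tailPoch≤ N zero = subst (_≤ ℕ→ℚ 0 * q⁻ N) (sym (+-inverseʳ 1ℚ)) (subst (0ℚ ≤_) (sym (*-zeroˡ (q⁻ N))) ≤-refl) 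
  1-tailPoch≤ N (suc j) = begin
      1ℚ - tailPoch N j * (1ℚ - q⁻ (N ℕ.+ j)) ≡⟨ lem (tailPoch N j) (q⁻ (N ℕ.+ j)) ⟩
      (1ℚ - tailPoch N j) + tailPoch N j * q⁻ (N ℕ.+ j) ≤⟨ +-mono-≤ (1-tailPoch≤ N j) (≤-trans (≤-*ʳ (q⁻ (N ℕ.+ j)) (0≤q⁻ (N ℕ.+ j)) (tailPoch≤1 N j)) (subst (_≤ q⁻ N) (sym (*-identityˡ (q⁻ (N ℕ.+ j)))) (q⁻-+≤ N j))) ⟩
      ℕ→ℚ j * q⁻ N + q⁻ N ≡⟨ lem2 (ℕ→ℚ j) (q⁻ N) ⟩
      (ℕ→ℚ j + ℕ→ℚ 1) * q⁻ N ≡⟨ cong (_* q⁻ N) (trans (ℕ→ℚ-+ j 1) (cong ℕ→ℚ (ℕP.+-comm j 1))) ⟩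
      ℕ→ℚ (suc j) * q⁻ N ∎
    where
    open ≤-Reasoning
    lem : ∀ a b → 1ℚ - a * (1ℚ - b) ≡ (1ℚ - a) + a * b
    lem = solve-∀ ℚ-ring
    lem2 : ∀ a b → a * b + b ≡ (a + 1ℚ) * b
    lem2 = solve-∀ ℚ-ring

  infiniteProduct-coeff : ∀ i → infiniteProduct i ≡ q⁻ i * qPoch⁻¹ i
  infiniteProduct-coeff i = cong (λ z → q⁻ z * qPoch⁻¹ i) (ℕP.*-identityˡ i)

  partialProduct-error : ∀ N i → ∣ partialProduct N i - infiniteProduct i ∣ ≤ q⁻ i * qPoch⁻¹ i * (ℕ→ℚ i * q⁻ N)
  partialProduct-error N i = begin
      ∣ partialProduct N i - infiniteProduct i ∣ ≡⟨ cong ∣_∣ (trans (cong₂ _-_ (partialProduct-coeff N i) (infiniteProduct-coeff i)) (lem (q⁻ i * qPoch⁻¹ i) (tailPoch N i))) ⟩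
      ∣ - (q⁻ i * qPoch⁻¹ i * (1ℚ - tailPoch N i)) ∣ ≡⟨ ∣-p∣≡∣p∣ _ ⟩
      ∣ q⁻ i * qPoch⁻¹ i * (1ℚ - tailPoch N i) ∣ ≡⟨ 0≤p⇒∣p∣≡p (0≤* (0≤* (0≤q⁻ i) (0≤qPoch⁻¹ i)) (≤⇒0≤- (tailPoch≤1 N i))) ⟩
      q⁻ i * qPoch⁻¹ i * (1ℚ - tailPoch N i) ≤⟨ ≤-*ˡ (q⁻ i * qPoch⁻¹ i) (0≤* (0≤q⁻ i) (0≤qPoch⁻¹ i)) (1-tailPoch≤ N i) ⟩
      q⁻ i * qPoch⁻¹ i * (ℕ→ℚ i * q⁻ N) ∎
    where
    open ≤-Reasoning
    lem : ∀ a x → a * x - a ≡ - (a * (1ℚ - x))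
    lem = solve-∀ ℚ-ring

  errorBound : ℕ → ℕ → ℚ
  errorBound n r = ∣ normalizer n ∣ * Σ< (suc n) (λ i → q⁻ i * qPoch⁻¹ i * ℕ→ℚ i * ∣ sumPart q r n (n ∸ i) ∣)

  approx-Pr-difference : ∀ n r → 1 ℕ.≤ r → ∀ N →
    approx q n r N - Pr q n r ≡ normalizer n * Σ< (suc n) (λ i → (partialProduct N i - infiniteProduct i) * sumPart q r n (n ∸ i))
  approx-Pr-difference n r r≥1 N = begin
      normalizer n * (prodPart q N ⊛ S) n - Pr q n r
        ≡⟨ cong₂ (λ u v → normalizer n * u - v) (⊛-cong {g = S} {g' = S} (prodPart≗partialProduct N) (λ _ → refl) n)
                 (trans (Pr≡normalizer*seriesCoeff n r r≥1) (cong (normalizer n *_) (sym (infiniteProduct-⊛-sumPart r n n)))) ⟩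
      normalizer n * (partialProduct N ⊛ S) n - normalizer n * (infiniteProduct ⊛ S) n
        ≡⟨ factor (normalizer n) _ _ ⟩
      normalizer n * ((partialProduct N ⊛ S) n - (infiniteProduct ⊛ S) n)
        ≡⟨ cong (normalizer n *_) (cong₂ _-_ (⊛-coeff (partialProduct N) S n) (⊛-coeff infiniteProduct S n)) ⟩
      normalizer n * (Σ< (suc n) (λ i → partialProduct N i * S (n ∸ i)) - Σ< (suc n) (λ i → infiniteProduct i * S (n ∸ i)))
        ≡⟨ cong (normalizer n *_) (trans (sym (sum-- (suc n) _ _)) (sum-cong (suc n) (λ i → factorʳ (partialProduct N i) (infiniteProduct i) (S (n ∸ i))))) ⟩
      normalizer n * Σ< (suc n) (λ i → (partialProduct N i - infiniteProduct i) * S (n ∸ i)) ∎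
    where
    open ≡-Reasoning
    S : Series
    S = sumPart q r n
    factor : ∀ c a b → c * a - c * b ≡ c * (a - b)
    factor = solve-∀ ℚ-ring
    factorʳ : ∀ a b x → a * x - b * x ≡ (a - b) * x
    factorʳ = solve-∀ ℚ-ring

  approx-error : ∀ n r → 1 ℕ.≤ r → ∀ N → ∣ approx q n r N - Pr q n r ∣ ≤ q⁻ N * errorBound n r
  approx-error n r r≥1 N = begin
      ∣ approx q n r N - Pr q n r ∣
        ≡⟨ trans (cong ∣_∣ (approx-Pr-difference n r r≥1 N)) (∣p*q∣≡∣p∣*∣q∣ (normalizer n) _) ⟩
      ∣ normalizer n ∣ * ∣ Σ< (suc n) (λ i → (partialProduct N i - infiniteProduct i) * S (n ∸ i)) ∣
        ≤⟨ ≤-*ˡ ∣ normalizer n ∣ (0≤∣p∣ (normalizer n)) (≤-trans (sum-abs (suc n) _) (sum-mono (suc n) (λ i _ → term-bound i))) ⟩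
      ∣ normalizer n ∣ * Σ< (suc n) (λ i → q⁻ i * qPoch⁻¹ i * (ℕ→ℚ i * q⁻ N) * ∣ S (n ∸ i) ∣)
        ≡⟨ cong (∣ normalizer n ∣ *_) (trans (sum-cong (suc n) (λ i → regroup (q⁻ i * qPoch⁻¹ i) (ℕ→ℚ i) (q⁻ N) ∣ S (n ∸ i) ∣)) (sym (sum-*ˡ (suc n) (q⁻ N) _))) ⟩
      ∣ normalizer n ∣ * (q⁻ N * Σ< (suc n) (λ i → q⁻ i * qPoch⁻¹ i * ℕ→ℚ i * ∣ S (n ∸ i) ∣))
        ≡⟨ swap ∣ normalizer n ∣ (q⁻ N) _ ⟩
      q⁻ N * errorBound n r ∎
    where
    open ≤-Reasoning
    S : Series
    S = sumPart q r n
    term-bound : ∀ i → ∣ (partialProduct N i - infiniteProduct i) * S (n ∸ i) ∣ ≤ q⁻ i * qPoch⁻¹ i * (ℕ→ℚ i * q⁻ N) * ∣ S (n ∸ i) ∣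
    term-bound i = subst (_≤ q⁻ i * qPoch⁻¹ i * (ℕ→ℚ i * q⁻ N) * ∣ S (n ∸ i) ∣) (sym (∣p*q∣≡∣p∣*∣q∣ (partialProduct N i - infiniteProduct i) (S (n ∸ i))))
                         (≤-*ʳ ∣ S (n ∸ i) ∣ (0≤∣p∣ (S (n ∸ i))) (partialProduct-error N i))
    regroup : ∀ A i x y → A * (i * x) * y ≡ x * (A * i * y)
    regroup = solve-∀ ℚ-ring
    swap : ∀ c x y → c * (x * y) ≡ x * (c * y)
    swap = solve-∀ ℚ-ring

  q⁻*-eventually-< : ∀ B ε → 0ℚ < ε → ∃[ N₀ ] (∀ N → N₀ ℕ.≤ N → q⁻ N * B < ε)
  q⁻*-eventually-< B ε ε>0 = N₀ , q⁻N*B<ε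
    where
    instance
      ε≢0 : NonZero ε
      ε≢0 = pos⇒nonZero ε {{positive ε>0}}
    N₀ : ℕ
    N₀ = proj₁ (archimedean (B * 1/ ε))
    B<N₀*ε : B < ℕ→ℚ N₀ * ε
    B<N₀*ε = subst (_< ℕ→ℚ N₀ * ε) (trans (*-assoc B (1/ ε) ε) (trans (cong (B *_) (*-inverseˡ ε)) (*-identityʳ B)))
                   (*-monoˡ-<-pos ε {{positive ε>0}} (proj₂ (archimedean (B * 1/ ε))))
    q⁻N*B<ε : ∀ N → N₀ ℕ.≤ N → q⁻ N * B < ε
    q⁻N*B<ε N N₀≤N = subst (q⁻ N * B <_) q⁻N*Q^N*ε≡ε (<-*ˡ (q⁻ N) (0<q⁻ N) B<Q^N*ε)
      where
      N₀≤Q^N : ℕ→ℚ N₀ ≤ Q ^ℚ N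
      N₀≤Q^N = ≤-trans (ℕ→ℚ-mono-≤ (ℕP.≤-trans N₀≤N (ℕP.n≤1+n N))) (≤-trans (ℕ→ℚ-mono-≤ (suc≤q^ N)) (≤-reflexive (sym (Q^≡ℕ→ℚ N))))
      B<Q^N*ε : B < Q ^ℚ N * ε
      B<Q^N*ε = <-≤-trans B<N₀*ε (≤-*ʳ ε (<⇒≤ ε>0) N₀≤Q^N)
      q⁻N*Q^N*ε≡ε : q⁻ N * (Q ^ℚ N * ε) ≡ ε
      q⁻N*Q^N*ε≡ε = trans (sym (*-assoc (q⁻ N) (Q ^ℚ N) ε)) (trans (cong (_* ε) (trans (*-comm (q⁻ N) (Q ^ℚ N)) (Q^*q⁻ N))) (*-identityˡ ε))

open import Defs
open import Data.Nat using (ℕ; _≤_)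
open import Data.Rational using (ℚ; 0ℚ; _<_; _-_; ∣_∣)
open import Data.Rational.Properties using (≤-<-trans)
open import Data.Product using (∃-syntax)
open import Data.Product using (_,_)

proposition2 : (q n r : ℕ) → 2 ≤ q → 1 ≤ r →
    (ε : ℚ) → 0ℚ < ε →
    ∃[ N₀ ] ((N : ℕ) → N₀ ≤ N → ∣ approx q n r N - Pr q n r ∣ < ε)
proposition2 q n r hq hr ε hε =
  let open FixedBase q hq
      (N₀ , q⁻ᴺ*bound<ε) = q⁻*-eventually-< (errorBound n r) ε hε
  in N₀ , λ N N₀≤N → ≤-<-trans (approx-error n r hr N) (q⁻ᴺ*bound<ε N N₀≤N)
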